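{- \[\sum_{n\geq1}|\hat{\mathcal{B}}_n(132)|\,t^n=\frac{t^2-2t+1-\sqrt{t^4+2t^2-4t+1}}{2t}.\]
   Context: An endofunction of size $n$ is a word $x=x_1\cdots x_n$ with entries in $\{1,\dots,n\}$; it is a Cayley permutation if it contains every integer between $1$ and $\max(x)$. Let $\mathrm{Ascbot}(x)=\{1\}\cup\{i:1\leq i\leq n-1,\ x_i<x_{i+1}\}$ and $\mathrm{Nub}(x)$ the set of indices $i$ such that $x_i$ is the leftmost occurrence of its value. A revised ascent sequence of length $n$ is a Cayley permutation $x$ of length $n$ with $\mathrm{Ascbot}(x)=\mathrm{Nub}(x)$. For Cayley permutations $x$ and $\sigma=\sigma_1\cdots\sigma_k$, $x$ contains $\sigma$ if there are indices $i_1<\cdots<i_k$ such that for all $s,t$: $x_{i_s}<x_{i_t}\iff\sigma_s<\sigma_t$ and $x_{i_s}=x_{i_t}\iff\sigma_s=\sigma_t$; otherwise $x$ avoids $\sigma$. $\hat{\mathcal{B}}_n(\sigma)$ is the set of revised ascent sequences of length $n$ avoiding $\sigma$. -}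

module Defs where

open import Data.Bool using (Bool; true; false; _∧_; _∨_; not)
open import Data.Nat using (ℕ; zero; suc; _⊔_; _<ᵇ_; _≡ᵇ_; _∸_)
open import Data.List using (List; []; _∷_; map; concatMap; length; foldr; filterᵇ; upTo; _++_)
open import Data.Bool.ListAction using (all; any)
open import Data.Integer using (ℤ; +_; _-_; _*_; _+_; -_)

-- Words (endofunctions) are lists of naturals; positions are 1-based.

-- x_i for 1 ≤ i ≤ length x (0 outside that range; never used there)
at : List ℕ → ℕ → ℕ
at []       _             = 0
at (a ∷ _)  zero          = 0
at (a ∷ _)  (suc zero)    = a
at (_ ∷ xs) (suc (suc i)) = at xs (suc i)

range1 : ℕ → List ℕ
range1 n = map suc (upTo n)

wordsOver : ℕ → ℕ → List (List ℕ)
wordsOver m zero      = [] ∷ []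
wordsOver m (suc len) = concatMap (λ v → map (v ∷_) (wordsOver m len)) (range1 m)

endofunctions : ℕ → List (List ℕ)
endofunctions n = wordsOver n n

elemᵇ : ℕ → List ℕ → Bool
elemᵇ v xs = any (λ y → v ≡ᵇ y) xs

maxL : List ℕ → ℕ
maxL = foldr _⊔_ 0

isCayley : List ℕ → Bool
isCayley x = all (λ v → elemᵇ v x) (range1 (maxL x))

takeL : ℕ → List ℕ → List ℕ
takeL zero    _        = []
takeL (suc i) []       = []
takeL (suc i) (a ∷ xs) = a ∷ takeL i xs

inAscbot : List ℕ → ℕ → Bool
inAscbot x i = (i ≡ᵇ 1) ∨ ((i <ᵇ length x) ∧ (at x i <ᵇ at x (suc i)))

inNub : List ℕ → ℕ → Bool
inNub x i = not (elemᵇ (at x i) (takeL (i ∸ 1) x))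

iffᵇ : Bool → Bool → Bool
iffᵇ true  b = b
iffᵇ false b = not b

ascbotEqNub : List ℕ → Bool
ascbotEqNub x = all (λ i → iffᵇ (inAscbot x i) (inNub x i)) (range1 (length x))

isRevisedAscentSeq : List ℕ → Bool
isRevisedAscentSeq x = isCayley x ∧ ascbotEqNub x

subseqs : List ℕ → List (List ℕ)
subseqs []       = [] ∷ []
subseqs (a ∷ xs) = map (a ∷_) (subseqs xs) ++ subseqs xs

orderIsoᵇ : List ℕ → List ℕ → Bool
orderIsoᵇ y σ =
  all (λ s → all (λ t →
        iffᵇ (at y s <ᵇ at y t) (at σ s <ᵇ at σ t) ∧
        iffᵇ (at y s ≡ᵇ at y t) (at σ s ≡ᵇ at σ t))
      (range1 (length σ))) (range1 (length σ))

containsᵇ : List ℕ → List ℕ → Bool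
containsᵇ x σ = any (λ y → (length y ≡ᵇ length σ) ∧ orderIsoᵇ y σ) (subseqs x)

avoidsᵇ : List ℕ → List ℕ → Bool
avoidsᵇ x σ = not (containsᵇ x σ)

countB : List ℕ → ℕ → ℕ
countB σ n = length (filterᵇ (λ x → isRevisedAscentSeq x ∧ avoidsᵇ x σ) (endofunctions n))

pat132 : List ℕ
pat132 = 1 ∷ 3 ∷ 2 ∷ []

Series : Set
Series = ℕ → ℤ

sumTo : ℕ → (ℕ → ℤ) → ℤ
sumTo zero    f = f 0
sumTo (suc n) f = sumTo n f + f (suc n)

_⊛_ : Series → Series → Series
(f ⊛ g) n = sumTo n (λ i → f i * g (n ∸ i))

F132 : Series
F132 zero    = + 0
F132 (suc n) = + countB pat132 (suc n)

polyA : Series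
polyA 0 = + 1
polyA 1 = - (+ 2)
polyA 2 = + 1
polyA _ = + 0

polyD : Series
polyD 0 = + 1
polyD 1 = - (+ 4)
polyD 2 = + 2
polyD 3 = + 0
polyD 4 = + 1
polyD _ = + 0

-- S(t) = A(t) - 2t F(t); the theorem F = (A - √D)/(2t) says exactly that
-- S is the square root of D with constant term 1.
seriesS : Series
seriesS zero    = polyA zero
seriesS (suc n) = polyA (suc n) - (+ 2) * F132 n

module Submission where

open import Defs
open import Data.Integer using (ℤ; +_)
open import Data.Product using (_×_)
open import Relation.Binary.PropositionalEquality using (_≡_)

-- Let f(n) = |B̂_n(132)| with series F. In a revised ascent sequence the first
-- letter is the maximum and the last letter repeats an earlier one. Appending a
-- final 1, and repeating a final letter c > 1, are injective with images the
-- words ending in 1, resp. in c c; hence f(n+2) - 2f(n+1) + f(n) counts the words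
-- ending in two distinct letters, the last one c > 1. Cutting such a word before
-- its first letter smaller than c splits it into an arbitrary word (raised by
-- c - 1) and a bracketed word c t … c with t < c. A bracketed word of length n+3
-- either ends in 1 c above a word of length n+1 whose first two letters differ,
-- or contains 1 2, whose 1 can be deleted to leave a bracketed word of length
-- n+2; since repeating the first letter accounts for the other words, induction
-- gives f(n+1) bracketed words of length n+3. So (1 - t)² F = t - t² + t F², and
-- S = A - 2tF satisfies S² = A² - 4t(t - t²) = D.

module PowerSeries where

  open import Data.List using (applyUpTo)
  open import Data.Nat as ℕ using (ℕ; zero; suc; _∸_; z≤n)
  open import Data.Nat.ListAction using (sum)
  import Data.Nat.Properties as ℕ
  open import Data.Integer using (ℤ; +_; -[1+_]; _+_; _*_)
  open import Data.Integer.Properties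
  open import Data.Integer.Solver using (module +-*-Solver)
  open import Function using (_∘_)
  open import Relation.Binary.PropositionalEquality

  open +-*-Solver using (solve; _:=_; _:+_; _:*_; con)

  infixl 6 _⊕_
  infixl 7 _·_

  _⊕_ : Series → Series → Series
  (F ⊕ G) n = F n + G n

  _·_ : ℤ → Series → Series
  (c · F) n = c * F n

  shift : Series → Series
  shift F zero    = + 0
  shift F (suc n) = F n

  sumTo-cong : ∀ n {φ ψ : ℕ → ℤ} → (∀ i → i ℕ.≤ n → φ i ≡ ψ i) → sumTo n φ ≡ sumTo n ψ
  sumTo-cong zero    eq = eq 0 z≤n
  sumTo-cong (suc n) eq = cong₂ _+_ (sumTo-cong n (λ i i≤n → eq i (ℕ.m≤n⇒m≤1+n i≤n))) (eq (suc n) ℕ.≤-refl)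

  sumTo-+ : ∀ n (φ ψ : ℕ → ℤ) → sumTo n (λ i → φ i + ψ i) ≡ sumTo n φ + sumTo n ψ
  sumTo-+ zero    φ ψ = refl
  sumTo-+ (suc n) φ ψ rewrite sumTo-+ n φ ψ =
    solve 4 (λ a b c d → (a :+ b) :+ (c :+ d) := (a :+ c) :+ (b :+ d)) refl
      (sumTo n φ) (sumTo n ψ) (φ (suc n)) (ψ (suc n))

  sumTo-* : ∀ n c (φ : ℕ → ℤ) → sumTo n (λ i → c * φ i) ≡ c * sumTo n φ
  sumTo-* zero    c φ = refl
  sumTo-* (suc n) c φ rewrite sumTo-* n c φ = sym (*-distribˡ-+ c (sumTo n φ) (φ (suc n)))

  sumTo-suc : ∀ n (φ : ℕ → ℤ) → sumTo (suc n) φ ≡ φ 0 + sumTo n (φ ∘ suc)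
  sumTo-suc zero    φ = refl
  sumTo-suc (suc n) φ rewrite sumTo-suc n φ = +-assoc (φ 0) _ _

  sumTo-reverse : ∀ n (φ : ℕ → ℤ) → sumTo n φ ≡ sumTo n (λ i → φ (n ∸ i))
  sumTo-reverse zero    φ = refl
  sumTo-reverse (suc n) φ = begin
    sumTo (suc n) φ                             ≡⟨ sumTo-suc n φ ⟩
    φ 0 + sumTo n (φ ∘ suc)                     ≡⟨ +-comm (φ 0) _ ⟩
    sumTo n (φ ∘ suc) + φ 0                     ≡⟨ cong (_+ φ 0) (sumTo-reverse n (φ ∘ suc)) ⟩
    sumTo n (λ i → φ (suc (n ∸ i))) + φ 0       ≡⟨ cong₂ _+_ (sumTo-cong n λ i i≤n → cong φ (sym (ℕ.+-∸-assoc 1 i≤n)))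
                                                             (cong φ (sym (ℕ.n∸n≡0 (suc n)))) ⟩
    sumTo (suc n) (λ i → φ (suc n ∸ i))         ∎
    where open ≡-Reasoning

  sumTo-zero : ∀ n {φ : ℕ → ℤ} → (∀ i → φ i ≡ + 0) → sumTo n φ ≡ + 0
  sumTo-zero zero    φ≡0 = φ≡0 0
  sumTo-zero (suc n) φ≡0 rewrite sumTo-zero n φ≡0 | φ≡0 (suc n) = refl

  ⊛-comm : ∀ F G → F ⊛ G ≗ G ⊛ F
  ⊛-comm F G n = trans (sumTo-reverse n _) (sumTo-cong n λ i i≤n →
    trans (cong (λ j → F (n ∸ i) * G j) (ℕ.m∸[m∸n]≡n i≤n)) (*-comm (F (n ∸ i)) (G i)))

  ⊛-congˡ : ∀ {F F′} G → F ≗ F′ → F ⊛ G ≗ F′ ⊛ G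
  ⊛-congˡ G F≗F′ n = sumTo-cong n λ i _ → cong (_* G (n ∸ i)) (F≗F′ i)

  ⊛-congʳ : ∀ F {G G′} → G ≗ G′ → F ⊛ G ≗ F ⊛ G′
  ⊛-congʳ F {G} {G′} G≗G′ n =
    trans (⊛-comm F G n) (trans (⊛-congˡ F G≗G′ n) (⊛-comm G′ F n))

  ⊛-distribʳ-⊕ : ∀ F G H → (F ⊕ G) ⊛ H ≗ F ⊛ H ⊕ G ⊛ H
  ⊛-distribʳ-⊕ F G H n =
    trans (sumTo-cong n λ i _ → *-distribʳ-+ (H (n ∸ i)) (F i) (G i)) (sumTo-+ n _ _)

  ⊛-distribˡ-⊕ : ∀ F G H → F ⊛ (G ⊕ H) ≗ F ⊛ G ⊕ F ⊛ H
  ⊛-distribˡ-⊕ F G H n = begin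
    (F ⊛ (G ⊕ H)) n          ≡⟨ ⊛-comm F (G ⊕ H) n ⟩
    ((G ⊕ H) ⊛ F) n          ≡⟨ ⊛-distribʳ-⊕ G H F n ⟩
    (G ⊛ F) n + (H ⊛ F) n    ≡⟨ cong₂ _+_ (⊛-comm G F n) (⊛-comm H F n) ⟩
    (F ⊛ G) n + (F ⊛ H) n    ∎
    where open ≡-Reasoning

  ⊛-·ˡ : ∀ c F G → (c · F) ⊛ G ≗ c · (F ⊛ G)
  ⊛-·ˡ c F G n = trans (sumTo-cong n λ i _ → *-assoc c (F i) (G (n ∸ i))) (sumTo-* n c _)

  ⊛-·ʳ : ∀ c F G → F ⊛ (c · G) ≗ c · (F ⊛ G)
  ⊛-·ʳ c F G n =
    trans (⊛-comm F (c · G) n) (trans (⊛-·ˡ c G F n) (cong (c *_) (⊛-comm G F n)))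

  ⊛-shiftˡ : ∀ F G → shift F ⊛ G ≗ shift (F ⊛ G)
  ⊛-shiftˡ F G zero    = *-zeroˡ (G 0)
  ⊛-shiftˡ F G (suc n) = begin
    (shift F ⊛ G) (suc n)                       ≡⟨ sumTo-suc n _ ⟩
    + 0 * G (suc n) + (F ⊛ G) n                 ≡⟨ cong (_+ (F ⊛ G) n) (*-zeroˡ (G (suc n))) ⟩
    + 0 + (F ⊛ G) n                             ≡⟨ +-identityˡ _ ⟩
    (F ⊛ G) n                                   ∎
    where open ≡-Reasoning

  ⊛-shiftʳ : ∀ F G → F ⊛ shift G ≗ shift (F ⊛ G)
  ⊛-shiftʳ F G zero    = trans (⊛-comm F (shift G) 0) (⊛-shiftˡ G F 0)
  ⊛-shiftʳ F G (suc n) = trans (⊛-comm F (shift G) (suc n)) (trans (⊛-shiftˡ G F (suc n)) (⊛-comm G F n))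

  ⊛-quadratic : ∀ {A B F S} → S ≗ A ⊕ -[1+ 1 ] · shift F → A ⊛ F ≗ B ⊕ shift (F ⊛ F) →
                S ⊛ S ≗ A ⊛ A ⊕ -[1+ 3 ] · shift B
  ⊛-quadratic {A} {B} {F} {S} S≗ AF≗ zero = begin
    S 0 * S 0                   ≡⟨ cong₂ _*_ (S≗ 0) (S≗ 0) ⟩
    (A 0 + c * + 0) * (A 0 + c * + 0)
      ≡⟨ solve 1 (λ a → (a :+ con c :* con (+ 0)) :* (a :+ con c :* con (+ 0))
                      := a :* a :+ con -[1+ 3 ] :* con (+ 0)) refl (A 0) ⟩
    A 0 * A 0 + -[1+ 3 ] * + 0  ∎
    where
    open ≡-Reasoning
    c : ℤ
    c = -[1+ 1 ]
  ⊛-quadratic {A} {B} {F} {S} S≗ AF≗ (suc m) = begin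
    (S ⊛ S) (suc m)                                 ≡⟨ trans (⊛-congˡ S S≗ (suc m)) (⊛-congʳ P S≗ (suc m)) ⟩
    (P ⊛ P) (suc m)                                 ≡⟨ ⊛-distribʳ-⊕ A c·tF P (suc m) ⟩
    (A ⊛ P) (suc m) + (c·tF ⊛ P) (suc m)            ≡⟨ cong₂ _+_ (⊛-distribˡ-⊕ A A c·tF (suc m))
                                                                 (⊛-·ˡ c (shift F) P (suc m)) ⟩
    AA + (A ⊛ c·tF) (suc m) + c * (shift F ⊛ P) (suc m)
      ≡⟨ cong₂ (λ u v → AA + u + c * v) (⊛-·ʳ c A (shift F) (suc m)) (⊛-shiftˡ F P (suc m)) ⟩
    AA + c * (A ⊛ shift F) (suc m) + c * (F ⊛ P) m
      ≡⟨ cong₂ (λ u v → AA + c * u + c * v) (⊛-shiftʳ A F (suc m)) (⊛-distribˡ-⊕ F A c·tF m) ⟩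
    AA + c * AF + c * ((F ⊛ A) m + (F ⊛ c·tF) m)
      ≡⟨ cong₂ (λ u v → AA + c * AF + c * (u + v)) (⊛-comm F A m)
               (trans (⊛-·ʳ c F (shift F) m) (cong (c *_) (⊛-shiftʳ F F m))) ⟩
    AA + c * AF + c * (AF + c * Y)
      ≡⟨ cong (λ u → AA + c * u + c * (u + c * Y)) (AF≗ m) ⟩
    AA + c * (B m + Y) + c * ((B m + Y) + c * Y)
      ≡⟨ solve 3 (λ a b y → a :+ con c :* (b :+ y) :+ con c :* ((b :+ y) :+ con c :* y)
                          := a :+ con -[1+ 3 ] :* b) refl AA (B m) Y ⟩
    AA + -[1+ 3 ] * B m                             ∎
    where
    open ≡-Reasoning
    c : ℤ
    c = -[1+ 1 ]
    c·tF P : Series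
    c·tF = c · shift F
    P = A ⊕ c·tF
    AA AF Y : ℤ
    AA = (A ⊛ A) (suc m)
    AF = (A ⊛ F) m
    Y = shift (F ⊛ F) m

  polyA-⊛ : ∀ F m → (polyA ⊛ F) (suc (suc m)) ≡ F (suc (suc m)) + -[1+ 1 ] * F (suc m) + F m
  polyA-⊛ F m = begin
    (polyA ⊛ F) (suc (suc m))                          ≡⟨ vanishing m ⟩
    + 1 * F (suc (suc m)) + -[1+ 1 ] * F (suc m) + + 1 * F m
      ≡⟨ cong₂ (λ u v → u + -[1+ 1 ] * F (suc m) + v) (*-identityˡ (F (suc (suc m)))) (*-identityˡ (F m)) ⟩
    F (suc (suc m)) + -[1+ 1 ] * F (suc m) + F m       ∎
    where
    open ≡-Reasoning
    φ : ℕ → ℤ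
    φ i = polyA i * F (2 ℕ.+ m ∸ i)
    vanishing : ∀ d → sumTo (2 ℕ.+ d) φ ≡ sumTo 2 φ
    vanishing zero    = refl
    vanishing (suc d) = trans (cong (λ z → sumTo (2 ℕ.+ d) φ + z) (*-zeroˡ (F (2 ℕ.+ m ∸ suc (suc (suc d))))))
      (trans (+-identityʳ _) (vanishing d))

  second-difference : ∀ {f₀ f₁ f₂ g₁ g₂ e₂ : ℕ} → f₁ ≡ f₀ ℕ.+ g₁ → f₂ ≡ f₁ ℕ.+ g₂ → g₂ ≡ g₁ ℕ.+ e₂ →
                      + f₂ + -[1+ 1 ] * + f₁ + + f₀ ≡ + e₂
  second-difference {f₀} {g₁ = g₁} {e₂ = e₂} refl refl refl = begin
    + (f₀ ℕ.+ g₁ ℕ.+ (g₁ ℕ.+ e₂)) + -[1+ 1 ] * + (f₀ ℕ.+ g₁) + + f₀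
      ≡⟨ cong₂ (λ u v → u + -[1+ 1 ] * v + + f₀)
               (trans (pos-+ (f₀ ℕ.+ g₁) (g₁ ℕ.+ e₂)) (cong₂ _+_ (pos-+ f₀ g₁) (pos-+ g₁ e₂))) (pos-+ f₀ g₁) ⟩
    (+ f₀ + + g₁) + (+ g₁ + + e₂) + -[1+ 1 ] * (+ f₀ + + g₁) + + f₀
      ≡⟨ solve 3 (λ f g e → (f :+ g) :+ (g :+ e) :+ con -[1+ 1 ] :* (f :+ g) :+ f := e) refl (+ f₀) (+ g₁) (+ e₂) ⟩
    + e₂ ∎
    where open ≡-Reasoning

  +-sum-applyUpTo : ∀ n (φ : ℕ → ℕ) → + sum (applyUpTo φ (suc n)) ≡ sumTo n (λ i → + φ i)
  +-sum-applyUpTo zero    φ = cong +_ (ℕ.+-identityʳ (φ 0))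
  +-sum-applyUpTo (suc n) φ = trans (pos-+ (φ 0) _)
    (trans (cong (λ z → + φ 0 + z) (+-sum-applyUpTo n (φ ∘ suc))) (sym (sumTo-suc n (λ i → + φ i))))

module Counting where

  open import Data.List using (List; []; _∷_; map; length)
  open import Data.List.Properties using (length-map)
  open import Data.List.Membership.Propositional using (_∈_)
  open import Data.List.Membership.Propositional.Properties using (∈-map⁺; ∈-map⁻)
  open import Data.List.Membership.Propositional.Properties.WithK using (unique∧set⇒bag)
  open import Data.List.Relation.Binary.BagAndSetEquality using (∼bag⇒↭)
  open import Data.List.Relation.Binary.Permutation.Propositional.Properties using (↭-length)
  import Data.List.Relation.Unary.All as All
  open import Data.List.Relation.Unary.AllPairs using ([]; _∷_)
  open import Data.List.Relation.Unary.Any using (here; there)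
  open import Data.List.Relation.Unary.Unique.Propositional using (Unique)
  open import Data.Product using (_,_)
  open import Function.Bundles using (mk⇔)
  open import Relation.Binary.PropositionalEquality
  open import Relation.Nullary using (¬_)

  module _ {a b} {A : Set a} {B : Set b} where

    map⁺-Unique-on : (f : A → B) {xs : List A} → Unique xs →
                     (∀ {u v} → u ∈ xs → v ∈ xs → f u ≡ f v → u ≡ v) → Unique (map f xs)
    map⁺-Unique-on f [] inj = []
    map⁺-Unique-on f {x ∷ xs} (x∉xs ∷ u) inj =
      All.tabulate fx≢ ∷ map⁺-Unique-on f u (λ p q → inj (there p) (there q))
      where
      fx≢ : ∀ {y} → y ∈ map f xs → ¬ f x ≡ y
      fx≢ y∈ fx≡y with ∈-map⁻ f y∈
      ... | x′ , x′∈ , refl = All.lookup x∉xs x′∈ (inj (here refl) (there x′∈) fx≡y)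

    inverses⇒length≡ : {xs : List A} {ys : List B} → Unique xs → Unique ys →
      (φ : A → B) (ψ : B → A) →
      (∀ {x} → x ∈ xs → φ x ∈ ys) → (∀ {y} → y ∈ ys → ψ y ∈ xs) →
      (∀ {x} → x ∈ xs → ψ (φ x) ≡ x) → (∀ {y} → y ∈ ys → φ (ψ y) ≡ y) →
      length xs ≡ length ys
    inverses⇒length≡ {xs} {ys} uxs uys φ ψ φ∈ ψ∈ ψφ φψ =
      trans (sym (length-map φ xs))
            (↭-length (∼bag⇒↭ (unique∧set⇒bag uφxs uys (mk⇔ image⊆ys ys⊆image))))
      where
      uφxs : Unique (map φ xs)
      uφxs = map⁺-Unique-on φ uxs (λ p q e → trans (sym (ψφ p)) (trans (cong ψ e) (ψφ q)))
      image⊆ys : ∀ {z} → z ∈ map φ xs → z ∈ ys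
      image⊆ys z∈ with ∈-map⁻ φ z∈
      ... | x , x∈ , refl = φ∈ x∈
      ys⊆image : ∀ {z} → z ∈ ys → z ∈ map φ xs
      ys⊆image z∈ = subst (_∈ map φ xs) (φψ z∈) (∈-map⁺ φ (ψ∈ z∈))

module RevisedAscentSequences where

  open import Data.Bool using (Bool; false)
  open import Data.Empty using (⊥; ⊥-elim)
  open import Data.List using (List; []; _∷_; _++_; map; initLast; _∷ʳ′_)
  open import Data.List.Properties using (++-assoc; ++-identityʳ; map-++)
  open import Data.List.Membership.Propositional using (_∈_; _∉_)
  open import Data.List.Membership.Propositional.Properties using (∈-++⁺ˡ; ∈-++⁺ʳ; ∈-++⁻; ∈-map⁺; ∈-map⁻)
  open import Data.List.Relation.Binary.Sublist.Propositional using (_⊆_; []; _∷_; _∷ʳ_; ⊆-trans; lookup)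
  open import Data.List.Relation.Binary.Sublist.Propositional.Properties using (map⁺)
  open import Data.List.Relation.Unary.All using (All; []; _∷_)
  open import Data.List.Relation.Unary.Any using (here; there)
  open import Data.Nat using (ℕ; suc; pred; _+_; _∸_; _≤_; _<_; _≡ᵇ_; _≟_; _≤?_; z≤n; s≤s)
  open import Data.Nat.Properties
  open import Data.List.Membership.DecPropositional _≟_ using (_∈?_)
  open import Data.Product using (∃; ∃₂; _×_; _,_; proj₁; proj₂)
  open import Data.Sum using (_⊎_; inj₁; inj₂)
  open import Data.Unit using (⊤; tt)
  open import Relation.Binary using (_Preserves_⟶_)
  open import Relation.Binary.PropositionalEquality
  open import Relation.Nullary using (¬_; yes; no)

  -- Letters of a too short word read as 0, except that second [ a ] = a.
  first : List ℕ → ℕ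
  first []      = 0
  first (a ∷ _) = a

  second : List ℕ → ℕ
  second []          = 0
  second (a ∷ [])    = a
  second (_ ∷ b ∷ _) = b

  final : List ℕ → ℕ
  final []          = 0
  final (a ∷ [])    = a
  final (_ ∷ b ∷ r) = final (b ∷ r)

  dropLast : List ℕ → List ℕ
  dropLast []          = []
  dropLast (a ∷ [])    = []
  dropLast (a ∷ b ∷ r) = a ∷ dropLast (b ∷ r)

  penultimate : List ℕ → ℕ
  penultimate x = final (dropLast x)

  firstTwoEqual : List ℕ → Bool
  firstTwoEqual (a ∷ b ∷ _) = a ≡ᵇ b
  firstTwoEqual _           = false

  lastTwoEqual : List ℕ → Bool
  lastTwoEqual x = penultimate x ≡ᵇ final x

  final-snoc : ∀ xs x → final (xs ++ x ∷ []) ≡ x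
  final-snoc []           x = refl
  final-snoc (a ∷ [])     x = refl
  final-snoc (a ∷ b ∷ xs) x = final-snoc (b ∷ xs) x

  dropLast-snoc : ∀ xs x → dropLast (xs ++ x ∷ []) ≡ xs
  dropLast-snoc []           x = refl
  dropLast-snoc (a ∷ [])     x = refl
  dropLast-snoc (a ∷ b ∷ xs) x = cong (a ∷_) (dropLast-snoc (b ∷ xs) x)

  final-++ : ∀ xs {ys} → ¬ ys ≡ [] → final (xs ++ ys) ≡ final ys
  final-++ []                  ys≢[] = refl
  final-++ (x ∷ []) {[]}       ys≢[] = ⊥-elim (ys≢[] refl)
  final-++ (x ∷ []) {y ∷ ys}   ys≢[] = refl
  final-++ (x ∷ x′ ∷ xs)       ys≢[] = final-++ (x′ ∷ xs) ys≢[]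

  dropLast-++ : ∀ xs {ys} → ¬ ys ≡ [] → dropLast (xs ++ ys) ≡ xs ++ dropLast ys
  dropLast-++ []                ys≢[] = refl
  dropLast-++ (x ∷ []) {[]}     ys≢[] = ⊥-elim (ys≢[] refl)
  dropLast-++ (x ∷ []) {y ∷ ys} ys≢[] = refl
  dropLast-++ (x ∷ x′ ∷ xs)     ys≢[] = cong (x ∷_) (dropLast-++ (x′ ∷ xs) ys≢[])

  final-∈ : ∀ xs → ¬ xs ≡ [] → final xs ∈ xs
  final-∈ []           xs≢[] = ⊥-elim (xs≢[] refl)
  final-∈ (a ∷ [])     _     = here refl
  final-∈ (a ∷ b ∷ xs) _     = there (final-∈ (b ∷ xs) (λ ()))

  penultimate-++ : ∀ xs {a b ys} → penultimate (xs ++ a ∷ b ∷ ys) ≡ penultimate (a ∷ b ∷ ys)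
  penultimate-++ xs {a} {b} {ys} =
    trans (cong final (dropLast-++ xs {a ∷ b ∷ ys} (λ ()))) (final-++ xs {dropLast (a ∷ b ∷ ys)} (λ ()))

  lastTwoEqual-++ : ∀ xs {a b ys} → lastTwoEqual (xs ++ a ∷ b ∷ ys) ≡ lastTwoEqual (a ∷ b ∷ ys)
  lastTwoEqual-++ xs = cong₂ _≡ᵇ_ (penultimate-++ xs) (final-++ xs (λ ()))

  ++-∷≢[] : ∀ (xs : List ℕ) {y ys} → ¬ xs ++ y ∷ ys ≡ []
  ++-∷≢[] []      ()
  ++-∷≢[] (_ ∷ _) ()

  ∈-snoc⁻ : ∀ {v : ℕ} xs {x} → v ∈ xs ++ x ∷ [] → v ∈ xs ⊎ v ≡ x
  ∈-snoc⁻ xs v∈ with ∈-++⁻ xs v∈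
  ... | inj₁ p        = inj₁ p
  ... | inj₂ (here e) = inj₂ e

  ∈-snoc⁺ʳ : ∀ {v : ℕ} xs → v ∈ xs ++ v ∷ []
  ∈-snoc⁺ʳ xs = ∈-++⁺ʳ xs (here refl)

  maxL-≤ : ∀ {v} xs → v ∈ xs → v ≤ maxL xs
  maxL-≤ (x ∷ xs) (here refl) = m≤m⊔n x (maxL xs)
  maxL-≤ (x ∷ xs) (there v∈)  = ≤-trans (maxL-≤ xs v∈) (m≤n⊔m x (maxL xs))

  maxL-∈ : ∀ xs → maxL xs ≡ 0 ⊎ maxL xs ∈ xs
  maxL-∈ []       = inj₁ refl
  maxL-∈ (x ∷ xs) with ⊔-sel x (maxL xs)
  ... | inj₁ e = inj₂ (here e)
  ... | inj₂ e with maxL-∈ xs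
  ...   | inj₁ z  = inj₁ (trans e z)
  ...   | inj₂ m∈ = inj₂ (there (subst (_∈ xs) (sym e) m∈))

  ⊆-++⁻ : ∀ {zs : List ℕ} xs ys → zs ⊆ xs ++ ys → ∃₂ λ z₁ z₂ → zs ≡ z₁ ++ z₂ × z₁ ⊆ xs × z₂ ⊆ ys
  ⊆-++⁻ []       ys p = [] , _ , refl , [] , p
  ⊆-++⁻ (x ∷ xs) ys (.x ∷ʳ p) with ⊆-++⁻ xs ys p
  ... | z₁ , z₂ , refl , q₁ , q₂ = z₁ , z₂ , refl , x ∷ʳ q₁ , q₂
  ⊆-++⁻ (x ∷ xs) ys (refl ∷ p) with ⊆-++⁻ xs ys p
  ... | z₁ , z₂ , refl , q₁ , q₂ = x ∷ z₁ , z₂ , refl , refl ∷ q₁ , q₂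

  ⊆-map⁻ : ∀ (f : ℕ → ℕ) {zs} ys → zs ⊆ map f ys → ∃ λ xs → xs ⊆ ys × zs ≡ map f xs
  ⊆-map⁻ f []       []        = [] , [] , refl
  ⊆-map⁻ f (y ∷ ys) (_ ∷ʳ p) with ⊆-map⁻ f ys p
  ... | xs , q , e    = xs , y ∷ʳ q , e
  ⊆-map⁻ f (y ∷ ys) (refl ∷ p) with ⊆-map⁻ f ys p
  ... | xs , q , refl = y ∷ xs , refl ∷ q , refl

  ∈-resp-⊆ : ∀ {v : ℕ} {xs ys} → v ∈ xs → xs ⊆ ys → v ∈ ys
  ∈-resp-⊆ v∈ p = lookup p v∈

  pair-⊆⇒∈ : ∀ {a b : ℕ} {xs} → (a ∷ b ∷ []) ⊆ xs → a ∈ xs × b ∈ xs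
  pair-⊆⇒∈ p = ∈-resp-⊆ (here refl) p , ∈-resp-⊆ (there (here refl)) p

  triple-⊆-++ : ∀ {a b d : ℕ} xs ys → (a ∷ b ∷ d ∷ []) ⊆ xs ++ ys →
    ((a ∷ b ∷ d ∷ []) ⊆ xs) ⊎ (((a ∷ b ∷ []) ⊆ xs) × d ∈ ys) ⊎
    ((a ∈ xs) × ((b ∷ d ∷ []) ⊆ ys)) ⊎ ((a ∷ b ∷ d ∷ []) ⊆ ys)
  triple-⊆-++ xs ys p with ⊆-++⁻ xs ys p
  ... | []                  , _  , refl , q₁ , q₂ = inj₂ (inj₂ (inj₂ q₂))
  ... | (_ ∷ [])            , _  , refl , q₁ , q₂ = inj₂ (inj₂ (inj₁ (∈-resp-⊆ (here refl) q₁ , q₂)))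
  ... | (_ ∷ _ ∷ [])        , _  , refl , q₁ , q₂ = inj₂ (inj₁ (q₁ , ∈-resp-⊆ (here refl) q₂))
  ... | (_ ∷ _ ∷ _ ∷ [])    , [] , refl , q₁ , q₂ = inj₁ q₁
  ... | (_ ∷ _ ∷ _ ∷ _ ∷ _) , _  , ()   , _  , _

  Avoids132 : List ℕ → Set
  Avoids132 x = ∀ {a b d} → (a ∷ b ∷ d ∷ []) ⊆ x → a < d → d < b → ⊥

  Cayley : List ℕ → Set
  Cayley x = ∀ {v} → v ∈ x → ∀ {u} → 1 ≤ u → u ≤ v → u ∈ x

  -- Ascbot = Nub, checked at the positions of w when the letters before w form s:
  -- a new letter must be followed by a larger one, an old letter by one that is
  -- not larger, and the last letter, which is not in Ascbot, must be old.
  AscentStep : List ℕ → ℕ → ℕ → Set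
  AscentStep s a b = (a ∈ s → b ≤ a) × (a ∉ s → a < b)

  Ascents : List ℕ → List ℕ → Set
  Ascents s []          = ⊤
  Ascents s (a ∷ [])    = a ∈ s
  Ascents s (a ∷ b ∷ r) = AscentStep s a b × Ascents (s ++ a ∷ []) (b ∷ r)

  RevisedAscent : List ℕ → Set
  RevisedAscent []      = ⊤
  RevisedAscent (a ∷ r) = Ascents (a ∷ []) r

  record RAS132 (x : List ℕ) : Set where
    constructor mkRAS132
    field
      nonEmpty      : ¬ x ≡ []
      positive      : All (1 ≤_) x
      cayley        : Cayley x
      revisedAscent : RevisedAscent x
      avoids132     : Avoids132 x

  Avoids132-⊆ : ∀ {xs ys} → xs ⊆ ys → Avoids132 ys → Avoids132 xs
  Avoids132-⊆ p avoid q = avoid (⊆-trans q p)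

  Cayley-cong : ∀ {x y} → (∀ {v} → v ∈ x → v ∈ y) → (∀ {v} → v ∈ y → v ∈ x) → Cayley x → Cayley y
  Cayley-cong x⊆y y⊆x cayley v∈ 1≤u u≤v = x⊆y (cayley (y⊆x v∈) 1≤u u≤v)

  RAS132⇒1∈ : ∀ {x} → RAS132 x → 1 ∈ x
  RAS132⇒1∈ {[]}    r = ⊥-elim (RAS132.nonEmpty r refl)
  RAS132⇒1∈ {a ∷ x} r with RAS132.positive r
  ... | 1≤a ∷ _ = RAS132.cayley r (here refl) (s≤s z≤n) 1≤a

  firstOr : List ℕ → ℕ → ℕ
  firstOr []      b = b
  firstOr (y ∷ _) _ = y

  -- Ascents s (Y ++ b ∷ T) restricted to the positions of Y.
  AscentsBefore : List ℕ → List ℕ → ℕ → Set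
  AscentsBefore s []      b = ⊤
  AscentsBefore s (a ∷ Y) b = AscentStep s a (firstOr Y b) × AscentsBefore (s ++ a ∷ []) Y b

  Ascents-cong : ∀ {s s′} w → (∀ {v} → v ∈ w → v ∈ s → v ∈ s′) → (∀ {v} → v ∈ w → v ∈ s′ → v ∈ s) →
                 Ascents s w → Ascents s′ w
  Ascents-cong []          f g ρ = tt
  Ascents-cong (a ∷ [])    f g ρ = f (here refl) ρ
  Ascents-cong {s} {s′} (a ∷ b ∷ r) f g ((old , new) , ρ) =
    ((λ a∈ → old (g (here refl) a∈)) , (λ a∉ → new (λ a∈ → a∉ (f (here refl) a∈))))
    , Ascents-cong (b ∷ r) (extend f) (extend g) ρ
    where
    extend : ∀ {t t′} → (∀ {v} → v ∈ a ∷ b ∷ r → v ∈ t → v ∈ t′) →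
             ∀ {v} → v ∈ b ∷ r → v ∈ t ++ a ∷ [] → v ∈ t′ ++ a ∷ []
    extend {t} {t′} h v∈ p with ∈-snoc⁻ t p
    ... | inj₁ q    = ∈-++⁺ˡ (h (there v∈) q)
    ... | inj₂ refl = ∈-snoc⁺ʳ t′

  Ascents-++⁻ : ∀ s Y b T → Ascents s (Y ++ b ∷ T) → AscentsBefore s Y b × Ascents (s ++ Y) (b ∷ T)
  Ascents-++⁻ s []          b T ρ = tt , subst (λ t → Ascents t (b ∷ T)) (sym (++-identityʳ s)) ρ
  Ascents-++⁻ s (a ∷ [])    b T (st , ρ) = (st , tt) , ρ
  Ascents-++⁻ s (a ∷ y ∷ Y) b T (st , ρ) with Ascents-++⁻ (s ++ a ∷ []) (y ∷ Y) b T ρ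
  ... | before , after = (st , before) , subst (λ t → Ascents t (b ∷ T)) (++-assoc s (a ∷ []) (y ∷ Y)) after

  Ascents-++⁺ : ∀ s Y b T → AscentsBefore s Y b → Ascents (s ++ Y) (b ∷ T) → Ascents s (Y ++ b ∷ T)
  Ascents-++⁺ s []          b T _            ρ = subst (λ t → Ascents t (b ∷ T)) (++-identityʳ s) ρ
  Ascents-++⁺ s (a ∷ [])    b T (st , _)     ρ = st , ρ
  Ascents-++⁺ s (a ∷ y ∷ Y) b T (st , before) ρ =
    st , Ascents-++⁺ (s ++ a ∷ []) (y ∷ Y) b T before
      (subst (λ t → Ascents t (b ∷ T)) (sym (++-assoc s (a ∷ []) (y ∷ Y))) ρ)

  Ascents-snoc⁻ : ∀ s Y ℓ → Ascents s (Y ++ ℓ ∷ []) → AscentsBefore s Y ℓ × ℓ ∈ s ++ Y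
  Ascents-snoc⁻ s Y ℓ = Ascents-++⁻ s Y ℓ []

  Ascents-snoc⁺ : ∀ s Y ℓ → AscentsBefore s Y ℓ → ℓ ∈ s ++ Y → Ascents s (Y ++ ℓ ∷ [])
  Ascents-snoc⁺ s Y ℓ = Ascents-++⁺ s Y ℓ []

  AscentsBefore-snoc⁻ : ∀ s Y ℓ b → AscentsBefore s (Y ++ ℓ ∷ []) b → AscentsBefore s Y ℓ × AscentStep (s ++ Y) ℓ b
  AscentsBefore-snoc⁻ s []      ℓ b (st , _) = tt , subst (λ t → AscentStep t ℓ b) (sym (++-identityʳ s)) st
  AscentsBefore-snoc⁻ s (a ∷ []) ℓ b (st , before) with AscentsBefore-snoc⁻ (s ++ a ∷ []) [] ℓ b before
  ... | _ , st′ = (st , tt) , subst (λ t → AscentStep t ℓ b) (++-assoc s (a ∷ []) []) st′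
  AscentsBefore-snoc⁻ s (a ∷ y ∷ Y) ℓ b (st , before) with AscentsBefore-snoc⁻ (s ++ a ∷ []) (y ∷ Y) ℓ b before
  ... | before′ , st′ = (st , before′) , subst (λ t → AscentStep t ℓ b) (++-assoc s (a ∷ []) (y ∷ Y)) st′

  AscentsBefore-snoc⁺ : ∀ s Y ℓ b → AscentsBefore s Y ℓ → AscentStep (s ++ Y) ℓ b → AscentsBefore s (Y ++ ℓ ∷ []) b
  AscentsBefore-snoc⁺ s []          ℓ b _            st = subst (λ t → AscentStep t ℓ b) (++-identityʳ s) st , tt
  AscentsBefore-snoc⁺ s (a ∷ [])    ℓ b (st₀ , _)    st =
    st₀ , AscentsBefore-snoc⁺ (s ++ a ∷ []) [] ℓ b tt (subst (λ t → AscentStep t ℓ b) (sym (++-assoc s (a ∷ []) [])) st)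
  AscentsBefore-snoc⁺ s (a ∷ y ∷ Y) ℓ b (st₀ , before) st =
    st₀ , AscentsBefore-snoc⁺ (s ++ a ∷ []) (y ∷ Y) ℓ b before
      (subst (λ t → AscentStep t ℓ b) (sym (++-assoc s (a ∷ []) (y ∷ Y))) st)

  Ascents-step : ∀ s p a b r → Ascents s (p ++ a ∷ b ∷ r) → AscentStep (s ++ p) a b
  Ascents-step s p a b r ρ = proj₁ (proj₂ (Ascents-++⁻ s p a (b ∷ r) ρ))

  AscentStep-old : ∀ {s a b} → a ∈ s → b ≤ a → AscentStep s a b
  AscentStep-old a∈ b≤a = (λ _ → b≤a) , (λ a∉ → ⊥-elim (a∉ a∈))

  Ascents⇒AscentsBefore : ∀ s Y b → Ascents s Y → (¬ Y ≡ [] → b ≤ final Y) → AscentsBefore s Y b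
  Ascents⇒AscentsBefore s Y b ρ b≤final with initLast Y
  ... | []        = tt
  ... | Y′ ∷ʳ′ ℓ with Ascents-snoc⁻ s Y′ ℓ ρ
  ... | before , ℓ∈ = AscentsBefore-snoc⁺ s Y′ ℓ b before
        (AscentStep-old ℓ∈ (subst (b ≤_) (final-snoc Y′ ℓ) (b≤final (++-∷≢[] Y′))))

  AscentsBefore⇒Ascents : ∀ s Y b → AscentsBefore s Y b → (¬ Y ≡ [] → final Y ∈ s ++ dropLast Y) → Ascents s Y
  AscentsBefore⇒Ascents s Y b before final-old with initLast Y
  ... | []        = tt
  ... | Y′ ∷ʳ′ ℓ with AscentsBefore-snoc⁻ s Y′ ℓ b before
  ... | before′ , _ = Ascents-snoc⁺ s Y′ ℓ before′
        (subst₂ (λ u v → u ∈ s ++ v) (final-snoc Y′ ℓ) (dropLast-snoc Y′ ℓ) (final-old (++-∷≢[] Y′)))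

  AscentsBefore-final-old : ∀ s Y b → AscentsBefore s Y b → ¬ Y ≡ [] → ¬ final Y < b → final Y ∈ s ++ dropLast Y
  AscentsBefore-final-old s Y b before Y≢[] final≮b with initLast Y
  ... | []        = ⊥-elim (Y≢[] refl)
  ... | Y′ ∷ʳ′ ℓ with AscentsBefore-snoc⁻ s Y′ ℓ b before
  ... | _ , (_ , new) with ℓ ∈? (s ++ Y′)
  ...   | yes p  = subst₂ (λ u v → u ∈ s ++ v) (sym (final-snoc Y′ ℓ)) (sym (dropLast-snoc Y′ ℓ)) p
  ...   | no  ¬p = ⊥-elim (final≮b (subst (_< b) (sym (final-snoc Y′ ℓ)) (new ¬p)))

  AscentsBefore-retarget : ∀ s Y b b′ → AscentsBefore s Y b → (¬ Y ≡ [] → ¬ final Y < b) →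
                           (¬ Y ≡ [] → b′ ≤ final Y) → AscentsBefore s Y b′
  AscentsBefore-retarget s Y b b′ before final≮b b′≤final =
    Ascents⇒AscentsBefore s Y b′
      (AscentsBefore⇒Ascents s Y b before (λ Y≢[] → AscentsBefore-final-old s Y b before Y≢[] (final≮b Y≢[])))
      b′≤final

  no-new-maximum : ∀ s w M → Ascents s w → M ∈ w → M ∉ s → (∀ {e} → e ∈ w → e ≤ M) → ⊥
  no-new-maximum s (a ∷ [])    M ρ             (here refl) M∉ ≤M = M∉ ρ
  no-new-maximum s (a ∷ b ∷ r) M ((_ , new) , ρ) (here refl) M∉ ≤M = <⇒≱ (new M∉) (≤M (there (here refl)))
  no-new-maximum s (a ∷ b ∷ r) M ((_ , new) , ρ) (there M∈)  M∉ ≤M with M ≟ a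
  ... | yes refl = <⇒≱ (new M∉) (≤M (there (here refl)))
  ... | no  M≢a  = no-new-maximum (s ++ a ∷ []) (b ∷ r) M ρ M∈ M∉s++a (λ e∈ → ≤M (there e∈))
    where
    M∉s++a : M ∉ s ++ a ∷ []
    M∉s++a p with ∈-snoc⁻ s p
    ... | inj₁ q = M∉ q
    ... | inj₂ q = M≢a q

  first-maximum : ∀ x → RevisedAscent x → ∀ {v} → v ∈ x → v ≤ first x
  first-maximum (a ∷ r) ρ (here refl) = ≤-refl
  first-maximum (a ∷ r) ρ {v} (there v∈) with v ≤? a
  ... | yes v≤a = v≤a
  ... | no  v≰a with maxL-∈ r
  ...   | inj₁ max≡0 = ⊥-elim (v≰a (≤-trans (subst (v ≤_) max≡0 (maxL-≤ r v∈)) z≤n))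
  ...   | inj₂ max∈  = ⊥-elim (no-new-maximum (a ∷ []) r (maxL r) ρ max∈
            (λ { (here e) → <-irrefl (sym e) (<-≤-trans (≰⇒> v≰a) (maxL-≤ r v∈)) })
            (maxL-≤ r))

  module _ {f : ℕ → ℕ} (f-mono : f Preserves _<_ ⟶ _<_) where

    mono-≤ : ∀ {x y} → x ≤ y → f x ≤ f y
    mono-≤ {x} {y} x≤y with m≤n⇒m<n∨m≡n x≤y
    ... | inj₁ x<y  = <⇒≤ (f-mono x<y)
    ... | inj₂ refl = ≤-refl

    reflect-< : ∀ {x y} → f x < f y → x < y
    reflect-< fx<fy = ≰⇒> (λ y≤x → <⇒≱ fx<fy (mono-≤ y≤x))

    reflect-≤ : ∀ {x y} → f x ≤ f y → x ≤ y
    reflect-≤ fx≤fy = ≮⇒≥ (λ y<x → <⇒≱ (f-mono y<x) fx≤fy)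

    mono-injective : ∀ {x y} → f x ≡ f y → x ≡ y
    mono-injective fx≡fy = ≤-antisym (reflect-≤ (≤-reflexive fx≡fy)) (reflect-≤ (≤-reflexive (sym fx≡fy)))

    ∈-map-reflect : ∀ {a s} → f a ∈ map f s → a ∈ s
    ∈-map-reflect {a} {s} p with ∈-map⁻ f p
    ... | a′ , a′∈ , e = subst (_∈ s) (sym (mono-injective e)) a′∈

    Ascents-map⁺ : ∀ s w → Ascents s w → Ascents (map f s) (map f w)
    Ascents-map⁺ s []          ρ = tt
    Ascents-map⁺ s (a ∷ [])    ρ = ∈-map⁺ f ρ
    Ascents-map⁺ s (a ∷ b ∷ r) ((old , new) , ρ) =
      ((λ fa∈ → mono-≤ (old (∈-map-reflect fa∈))) , (λ fa∉ → f-mono (new (λ a∈ → fa∉ (∈-map⁺ f a∈)))))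
      , subst (λ t → Ascents t (map f (b ∷ r))) (map-++ f s (a ∷ [])) (Ascents-map⁺ (s ++ a ∷ []) (b ∷ r) ρ)

    Ascents-map⁻ : ∀ s w → Ascents (map f s) (map f w) → Ascents s w
    Ascents-map⁻ s []          ρ = tt
    Ascents-map⁻ s (a ∷ [])    ρ = ∈-map-reflect ρ
    Ascents-map⁻ s (a ∷ b ∷ r) ((old , new) , ρ) =
      ((λ a∈ → reflect-≤ (old (∈-map⁺ f a∈))) , (λ a∉ → reflect-< (new (λ fa∈ → a∉ (∈-map-reflect fa∈)))))
      , Ascents-map⁻ (s ++ a ∷ []) (b ∷ r) (subst (λ t → Ascents t (map f (b ∷ r))) (sym (map-++ f s (a ∷ []))) ρ)

    RevisedAscent-map⁻ : ∀ x → RevisedAscent (map f x) → RevisedAscent x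
    RevisedAscent-map⁻ []      _ = tt
    RevisedAscent-map⁻ (a ∷ r) ρ = Ascents-map⁻ (a ∷ []) r ρ

    Avoids132-map⁺ : ∀ x → Avoids132 x → Avoids132 (map f x)
    Avoids132-map⁺ x avoid sub ad db with ⊆-map⁻ f x sub
    ... | (_ ∷ _ ∷ _ ∷ []) , sub′ , refl = avoid sub′ (reflect-< ad) (reflect-< db)

    Avoids132-map⁻ : ∀ x → Avoids132 (map f x) → Avoids132 x
    Avoids132-map⁻ x avoid sub ad db = avoid (map⁺ f sub) (f-mono ad) (f-mono db)

  +-mono : ∀ k → (_+ k) Preserves _<_ ⟶ _<_
  +-mono k = +-monoˡ-< k

  suc-pred-map : ∀ x → All (1 ≤_) x → map suc (map pred x) ≡ x
  suc-pred-map []          []      = refl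
  suc-pred-map (suc a ∷ x) (_ ∷ p) = cong (suc a ∷_) (suc-pred-map x p)

  pred-suc-map : ∀ x → map pred (map suc x) ≡ x
  pred-suc-map []      = refl
  pred-suc-map (a ∷ x) = cong (a ∷_) (pred-suc-map x)

  +-∸-map : ∀ k x → All (k ≤_) x → map (_+ k) (map (_∸ k) x) ≡ x
  +-∸-map k []      []       = refl
  +-∸-map k (a ∷ x) (p ∷ ps) = cong₂ _∷_ (m∸n+n≡m p) (+-∸-map k x ps)

  ∸-+-map : ∀ k x → map (_∸ k) (map (_+ k) x) ≡ x
  ∸-+-map k []      = refl
  ∸-+-map k (a ∷ x) = cong₂ _∷_ (m+n∸n≡m a k) (∸-+-map k x)

module BooleanCharacterisation where

  open RevisedAscentSequences
  open import Data.Bool using (Bool; true; false; T; _∧_; not)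
  open import Data.Bool.Properties using (T-∧; ∧-identityʳ)
  open import Data.Bool.ListAction using (all)
  open import Data.Empty using (⊥; ⊥-elim)
  open import Data.List using (List; []; _∷_; _++_; map; length; filterᵇ; upTo)
  open import Data.List.Properties using (length-++; length-map; ++-assoc; ∷-injective; length-upTo; filter-≐)
  open import Data.List.Membership.Propositional using (_∈_; find)
  open import Data.List.Membership.Propositional.Properties
  open import Data.List.Relation.Binary.Sublist.Propositional using (_⊆_; []; _∷_; _∷ʳ_)
  open import Data.List.Relation.Unary.All as All using (All; []; _∷_)
  open import Data.List.Relation.Unary.All.Properties using (all⁺; all⁻)
  open import Data.List.Relation.Unary.Any as Any using (Any; here; there)
  open import Data.List.Relation.Unary.Any.Properties using (any⁺; any⁻)
  open import Data.List.Relation.Unary.AllPairs as AllPairs using ([]; _∷_)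
  import Data.List.Relation.Unary.AllPairs.Properties as AllPairsₚ
  open import Data.List.Relation.Unary.Unique.Propositional using (Unique)
  import Data.List.Relation.Unary.Unique.Propositional.Properties as Unique
  open import Data.Nat using (ℕ; zero; suc; _+_; _≤_; _<_; z≤n; s≤s; _<ᵇ_; _≡ᵇ_)
  open import Data.Nat.Properties
  open import Data.Product using (_×_; _,_; proj₁; proj₂)
  open import Data.Sum using (inj₁; inj₂)
  open import Data.Unit using (tt)
  open import Function.Bundles using (Equivalence)
  open import Relation.Binary.PropositionalEquality
  open import Relation.Nullary using (¬_)

  open Equivalence using (to; from)

  ∧-elimˡ : ∀ {p q} → T (p ∧ q) → T p
  ∧-elimˡ {p} t = proj₁ (to (T-∧ {p}) t)

  ∧-elimʳ : ∀ {p q} → T (p ∧ q) → T q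
  ∧-elimʳ {p} t = proj₂ (to (T-∧ {p}) t)

  ∧-intro : ∀ {p q} → T p → T q → T (p ∧ q)
  ∧-intro tp tq = from T-∧ (tp , tq)

  not⁺ : ∀ {b} → ¬ T b → T (not b)
  not⁺ {true}  ¬b = ¬b tt
  not⁺ {false} ¬b = tt

  not⁻ : ∀ {b} → T (not b) → ¬ T b
  not⁻ {true}  () _
  not⁻ {false} _  ()

  iffᵇ⁻ : ∀ {p q} → T (iffᵇ p q) → (T p → T q) × (T q → T p)
  iffᵇ⁻ {true}  {true}  _ = (λ _ → tt) , (λ _ → tt)
  iffᵇ⁻ {false} {false} _ = (λ ()) , (λ ())

  iffᵇ⁺ : ∀ {p q} → (T p → T q) → (T q → T p) → T (iffᵇ p q)
  iffᵇ⁺ {true}  {true}  _ _ = tt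
  iffᵇ⁺ {true}  {false} f _ = f tt
  iffᵇ⁺ {false} {true}  _ g = g tt
  iffᵇ⁺ {false} {false} _ _ = tt

  elemᵇ⁻ : ∀ v xs → T (elemᵇ v xs) → v ∈ xs
  elemᵇ⁻ v xs t = Any.map (≡ᵇ⇒≡ v _) (any⁻ (v ≡ᵇ_) xs t)

  elemᵇ⁺ : ∀ {v xs} → v ∈ xs → T (elemᵇ v xs)
  elemᵇ⁺ {v} v∈ = any⁺ (v ≡ᵇ_) (Any.map (≡⇒≡ᵇ v _) v∈)

  ∈-range1⁺ : ∀ {m v} → 1 ≤ v → v ≤ m → v ∈ range1 m
  ∈-range1⁺ {v = suc v} _ v<m = ∈-map⁺ suc (∈-upTo⁺ v<m)

  ∈-range1⁻ : ∀ {m v} → v ∈ range1 m → 1 ≤ v × v ≤ m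
  ∈-range1⁻ v∈ with ∈-map⁻ suc v∈
  ... | i , i∈ , refl = s≤s z≤n , ∈-upTo⁻ i∈

  range1-unique : ∀ m → Unique (range1 m)
  range1-unique m = Unique.map⁺ suc-injective (Unique.upTo⁺ m)

  ∈-wordsOver⁺ : ∀ m len {x} → length x ≡ len → All (λ v → 1 ≤ v × v ≤ m) x → x ∈ wordsOver m len
  ∈-wordsOver⁺ m zero      {[]}    refl []               = here refl
  ∈-wordsOver⁺ m (suc len) {v ∷ x} eq   ((1≤v , v≤m) ∷ vs) =
    ∈-concatMap⁺ (λ w → map (w ∷_) (wordsOver m len))
      (Any.map (λ { refl → ∈-map⁺ (v ∷_) (∈-wordsOver⁺ m len (suc-injective eq) vs) })
                          (∈-range1⁺ 1≤v v≤m))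

  ∈-wordsOver⁻ : ∀ m len {x} → x ∈ wordsOver m len → length x ≡ len × All (λ v → 1 ≤ v × v ≤ m) x
  ∈-wordsOver⁻ m zero      (here refl) = refl , []
  ∈-wordsOver⁻ m (suc len) x∈ with ∈-concat⁻′ (map (λ v → map (v ∷_) (wordsOver m len)) (range1 m)) x∈
  ... | xs , x∈xs , xs∈ with ∈-map⁻ (λ v → map (v ∷_) (wordsOver m len)) xs∈
  ... | v , v∈ , refl with ∈-map⁻ (v ∷_) x∈xs
  ... | x′ , x′∈ , refl with ∈-wordsOver⁻ m len x′∈
  ... | length≡ , bounded = cong suc length≡ , ∈-range1⁻ v∈ ∷ bounded

  wordsOver-unique : ∀ m len → Unique (wordsOver m len)
  wordsOver-unique m zero      = [] ∷ []
  wordsOver-unique m (suc len) =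
    Unique.concat⁺ (All.tabulate blocks-unique)
      (AllPairsₚ.map⁺ (AllPairs.map blocks-disjoint (range1-unique m)))
    where
    blocks-unique : ∀ {l} → l ∈ map (λ v → map (v ∷_) (wordsOver m len)) (range1 m) → Unique l
    blocks-unique l∈ with ∈-map⁻ (λ v → map (v ∷_) (wordsOver m len)) l∈
    ... | v , _ , refl = Unique.map⁺ (λ e → proj₂ (∷-injective e)) (wordsOver-unique m len)
    blocks-disjoint : ∀ {v w} → ¬ v ≡ w → _
    blocks-disjoint v≢w (p , q) with ∈-map⁻ _ p | ∈-map⁻ _ q
    ... | _ , _ , refl | _ , _ , e = v≢w (proj₁ (∷-injective e))

  isCayley⁻ : ∀ x → T (isCayley x) → Cayley x
  isCayley⁻ x t v∈ 1≤u u≤v =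
    elemᵇ⁻ _ x (All.lookup (all⁺ (λ v → elemᵇ v x) (range1 (maxL x)) t) (∈-range1⁺ 1≤u (≤-trans u≤v (maxL-≤ x v∈))))

  isCayley⁺ : ∀ x → Cayley x → T (isCayley x)
  isCayley⁺ x cayley = all⁻ (λ v → elemᵇ v x) (All.tabulate present)
    where
    present : ∀ {u} → u ∈ range1 (maxL x) → T (elemᵇ u x)
    present u∈ with ∈-range1⁻ u∈ | maxL-∈ x
    ... | 1≤u , u≤max | inj₁ max≡0 = ⊥-elim (<⇒≱ 1≤u (subst (_ ≤_) max≡0 u≤max))
    ... | 1≤u , u≤max | inj₂ max∈  = elemᵇ⁺ (cayley max∈ 1≤u u≤max)

  remove : ∀ {v : ℕ} {ys} → v ∈ ys → List ℕ
  remove {ys = y ∷ ys} (here _)  = ys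
  remove {ys = y ∷ ys} (there p) = y ∷ remove p

  length-remove : ∀ {v : ℕ} {ys} (p : v ∈ ys) → length ys ≡ suc (length (remove p))
  length-remove (here _)  = refl
  length-remove (there p) = cong suc (length-remove p)

  ∈-remove : ∀ {v u : ℕ} {ys} (p : v ∈ ys) → u ∈ ys → ¬ u ≡ v → u ∈ remove p
  ∈-remove (here refl) (here refl) u≢v = ⊥-elim (u≢v refl)
  ∈-remove (here refl) (there q)   _   = q
  ∈-remove (there p)   (here refl) _   = here refl
  ∈-remove (there p)   (there q)   u≢v = there (∈-remove p q u≢v)

  Unique-⊆⇒length-≤ : ∀ {xs ys : List ℕ} → Unique xs → (∀ {u} → u ∈ xs → u ∈ ys) → length xs ≤ length ys
  Unique-⊆⇒length-≤ {[]}     _          _    = z≤n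
  Unique-⊆⇒length-≤ {x ∷ xs} {ys} (x∉ ∷ uxs) xs⊆ys =
    subst (suc (length xs) ≤_) (sym (length-remove x∈ys))
      (s≤s (Unique-⊆⇒length-≤ uxs (λ w∈ → ∈-remove x∈ys (xs⊆ys (there w∈)) (λ e → All.lookup x∉ w∈ (sym e)))))
    where
    x∈ys : x ∈ ys
    x∈ys = xs⊆ys (here refl)

  -- Pigeonhole: x contains the v distinct values 1, …, v.
  Cayley⇒≤length : ∀ {x v} → Cayley x → v ∈ x → v ≤ length x
  Cayley⇒≤length {x} {v} cayley v∈ =
    subst (_≤ length x) (trans (length-map suc (upTo v)) (length-upTo v))
      (Unique-⊆⇒length-≤ (range1-unique v) (λ u∈ → let 1≤u , u≤v = ∈-range1⁻ u∈ in cayley v∈ 1≤u u≤v))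

  checkAt : List ℕ → ℕ → Bool
  checkAt x i = iffᵇ (inAscbot x i) (inNub x i)

  startsWithAscent : List ℕ → Bool
  startsWithAscent (a ∷ b ∷ _) = a <ᵇ b
  startsWithAscent _           = false

  at-++ : ∀ s a r → at (s ++ a ∷ r) (suc (length s)) ≡ a
  at-++ []           a r = refl
  at-++ (q ∷ [])     a r = refl
  at-++ (q ∷ q′ ∷ s) a r = at-++ (q′ ∷ s) a r

  takeL-++ : ∀ s r → takeL (length s) (s ++ r) ≡ s
  takeL-++ []      r = refl
  takeL-++ (q ∷ s) r = cong (q ∷_) (takeL-++ s r)

  ascentTest-++ : ∀ s a r →
    ((suc (length s) <ᵇ length (s ++ a ∷ r)) ∧ (at (s ++ a ∷ r) (suc (length s)) <ᵇ at (s ++ a ∷ r) (suc (suc (length s)))))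
    ≡ startsWithAscent (a ∷ r)
  ascentTest-++ []      a []      = refl
  ascentTest-++ []      a (b ∷ r) = refl
  ascentTest-++ (q ∷ s) a r       = ascentTest-++ s a r

  -- With the prefix q ∷ s nonempty, the position 2 + |s| is never 1, so only the
  -- ascent half of Ascbot and the "not seen before" half of Nub remain.
  checkAt-++ : ∀ q s a r → checkAt ((q ∷ s) ++ a ∷ r) (suc (suc (length s)))
                           ≡ iffᵇ (startsWithAscent (a ∷ r)) (not (elemᵇ a (q ∷ s)))
  checkAt-++ q s a r =
    cong₂ iffᵇ (ascentTest-++ s a r) (cong₂ (λ y t → not (elemᵇ y (q ∷ t))) (at-++ s a r) (takeL-++ s (a ∷ r)))

  checkAt-final⁻ : ∀ q s a → T (checkAt ((q ∷ s) ++ a ∷ []) (suc (suc (length s)))) → a ∈ q ∷ s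
  checkAt-final⁻ q s a t with elemᵇ a (q ∷ s) in eq | subst T (checkAt-++ q s a []) t
  ... | true  | _ = elemᵇ⁻ a (q ∷ s) (subst T (sym eq) tt)

  checkAt-final⁺ : ∀ q s a → a ∈ q ∷ s → T (checkAt ((q ∷ s) ++ a ∷ []) (suc (suc (length s))))
  checkAt-final⁺ q s a a∈ = subst T (sym (checkAt-++ q s a [])) (iffᵇ⁺ (λ ()) (λ t → not⁻ t (elemᵇ⁺ a∈)))

  checkAt-step⁻ : ∀ q s a b r → T (checkAt ((q ∷ s) ++ a ∷ b ∷ r) (suc (suc (length s)))) → AscentStep (q ∷ s) a b
  checkAt-step⁻ q s a b r t with iffᵇ⁻ (subst T (checkAt-++ q s a (b ∷ r)) t)
  ... | asc⇒new , new⇒asc =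
    (λ a∈ → ≮⇒≥ (λ a<b → not⁻ (asc⇒new (<⇒<ᵇ a<b)) (elemᵇ⁺ a∈))) ,
    (λ a∉ → <ᵇ⇒< a b (new⇒asc (not⁺ (λ e → a∉ (elemᵇ⁻ a (q ∷ s) e)))))

  checkAt-step⁺ : ∀ q s a b r → AscentStep (q ∷ s) a b → T (checkAt ((q ∷ s) ++ a ∷ b ∷ r) (suc (suc (length s))))
  checkAt-step⁺ q s a b r (old , new) = subst T (sym (checkAt-++ q s a (b ∷ r)))
    (iffᵇ⁺ (λ a<b → not⁺ (λ e → <⇒≱ (<ᵇ⇒< a b a<b) (old (elemᵇ⁻ a (q ∷ s) e))))
           (λ t → <⇒<ᵇ (new (λ a∈ → not⁻ t (elemᵇ⁺ a∈)))))

  ChecksFrom : ℕ → List ℕ → List ℕ → Set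
  ChecksFrom q s w = ∀ j → j < length w → T (checkAt ((q ∷ s) ++ w) (suc (suc (length s + j))))

  ChecksFrom-step : ∀ q s a b r →
    ChecksFrom q s (a ∷ b ∷ r) → ChecksFrom q (s ++ a ∷ []) (b ∷ r)
  ChecksFrom-step q s a b r checks j j< =
    subst₂ (λ x i → T (checkAt x (suc (suc i)))) (sym (++-assoc (q ∷ s) (a ∷ []) (b ∷ r)))
      (sym (position-++ j)) (checks (suc j) (s≤s j<))
    where
    position-++ : ∀ j → length (s ++ a ∷ []) + j ≡ length s + suc j
    position-++ j = trans (cong (_+ j) (length-++ s)) (+-assoc (length s) 1 j)

  ChecksFrom-first : ∀ q s a r → ChecksFrom q s (a ∷ r) → T (checkAt ((q ∷ s) ++ a ∷ r) (suc (suc (length s))))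
  ChecksFrom-first q s a r checks =
    subst (λ i → T (checkAt ((q ∷ s) ++ a ∷ r) (suc (suc i)))) (+-identityʳ (length s)) (checks 0 (s≤s z≤n))

  Ascents⁻ : ∀ q s w → ChecksFrom q s w → Ascents (q ∷ s) w
  Ascents⁻ q s []          checks = tt
  Ascents⁻ q s (a ∷ [])    checks = checkAt-final⁻ q s a (ChecksFrom-first q s a [] checks)
  Ascents⁻ q s (a ∷ b ∷ r) checks =
    checkAt-step⁻ q s a b r (ChecksFrom-first q s a (b ∷ r) checks) ,
    Ascents⁻ q (s ++ a ∷ []) (b ∷ r) (ChecksFrom-step q s a b r checks)

  Ascents⁺ : ∀ q s w → Ascents (q ∷ s) w → ChecksFrom q s w
  Ascents⁺ q s (a ∷ [])    ρ zero _ =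
    subst (λ i → T (checkAt ((q ∷ s) ++ a ∷ []) (suc (suc i)))) (sym (+-identityʳ (length s))) (checkAt-final⁺ q s a ρ)
  Ascents⁺ q s (a ∷ [])    ρ (suc j) (s≤s ())
  Ascents⁺ q s (a ∷ b ∷ r) (st , ρ) zero _ =
    subst (λ i → T (checkAt ((q ∷ s) ++ a ∷ b ∷ r) (suc (suc i)))) (sym (+-identityʳ (length s)))
      (checkAt-step⁺ q s a b r st)
  Ascents⁺ q s (a ∷ b ∷ r) (st , ρ) (suc j) (s≤s j<) =
    subst₂ (λ x i → T (checkAt x (suc (suc i)))) (++-assoc (q ∷ s) (a ∷ []) (b ∷ r))
      (trans (cong (_+ j) (length-++ s)) (+-assoc (length s) 1 j)) (Ascents⁺ q (s ++ a ∷ []) (b ∷ r) ρ j j<)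

  ascbotEqNub⁻ : ∀ x → T (ascbotEqNub x) → RevisedAscent x
  ascbotEqNub⁻ []      _ = tt
  ascbotEqNub⁻ (a ∷ r) t = Ascents⁻ a [] r λ j j< →
    All.lookup (all⁺ (checkAt (a ∷ r)) (range1 (suc (length r))) t) (∈-range1⁺ (s≤s z≤n) (s≤s j<))

  ascbotEqNub⁺ : ∀ x → RevisedAscent x → T (ascbotEqNub x)
  ascbotEqNub⁺ []      _ = tt
  ascbotEqNub⁺ (a ∷ r) ρ = all⁻ (checkAt (a ∷ r)) (All.tabulate check)
    where
    check : ∀ {i} → i ∈ range1 (suc (length r)) → T (checkAt (a ∷ r) i)
    check {i} i∈ with i | ∈-range1⁻ i∈
    ... | suc zero    | _          = tt
    ... | suc (suc j) | _ , s≤s j< = Ascents⁺ a [] r ρ j j<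

  ∈-subseqs⁺ : ∀ {ys x : List ℕ} → ys ⊆ x → ys ∈ subseqs x
  ∈-subseqs⁺ []                    = here refl
  ∈-subseqs⁺ {x = y ∷ x} (_ ∷ʳ p)  = ∈-++⁺ʳ (map (y ∷_) (subseqs x)) (∈-subseqs⁺ p)
  ∈-subseqs⁺ (refl ∷ p)            = ∈-++⁺ˡ (∈-map⁺ _ (∈-subseqs⁺ p))

  ∈-subseqs⁻ : ∀ {ys} x → ys ∈ subseqs x → ys ⊆ x
  ∈-subseqs⁻ []      (here refl) = []
  ∈-subseqs⁻ (a ∷ x) ys∈ with ∈-++⁻ (map (a ∷_) (subseqs x)) ys∈
  ... | inj₂ q = a ∷ʳ ∈-subseqs⁻ x q
  ... | inj₁ q with ∈-map⁻ (a ∷_) q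
  ...   | zs , zs∈ , refl = refl ∷ ∈-subseqs⁻ x zs∈

  private
    Comparison : ℕ → ℕ → Bool → Bool → Bool
    Comparison x y lt eq = iffᵇ (x <ᵇ y) lt ∧ iffᵇ (x ≡ᵇ y) eq

    comparison-< : ∀ {x y} → x < y → T (Comparison x y true false)
    comparison-< {x} {y} x<y =
      ∧-intro (iffᵇ⁺ (λ _ → tt) (λ _ → <⇒<ᵇ x<y)) (iffᵇ⁺ (λ t → <⇒≢ x<y (≡ᵇ⇒≡ x y t)) (λ ()))

    comparison-> : ∀ {x y} → y < x → T (Comparison x y false false)
    comparison-> {x} {y} y<x =
      ∧-intro (iffᵇ⁺ (λ t → <⇒≯ (<ᵇ⇒< x y t) y<x) (λ ())) (iffᵇ⁺ (λ t → >⇒≢ y<x (≡ᵇ⇒≡ x y t)) (λ ()))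

    comparison-≡ : ∀ x → T (Comparison x x false true)
    comparison-≡ x =
      ∧-intro (iffᵇ⁺ (λ t → <-irrefl refl (<ᵇ⇒< x x t)) (λ ())) (iffᵇ⁺ (λ _ → tt) (λ _ → ≡⇒≡ᵇ x x refl))

    entry132 : List ℕ → ℕ → ℕ → Bool
    entry132 y s t = iffᵇ (at y s <ᵇ at y t) (at pat132 s <ᵇ at pat132 t) ∧ iffᵇ (at y s ≡ᵇ at y t)
      (at pat132 s ≡ᵇ at pat132 t)

  orderIsoᵇ-132⁻ : ∀ a b d → T (orderIsoᵇ (a ∷ b ∷ d ∷ []) pat132) → a < d × d < b
  orderIsoᵇ-132⁻ a b d t =
    <ᵇ⇒< a d (ascent {a} {d} (entry (here refl) (there (there (here refl))))) ,
    <ᵇ⇒< d b (ascent {d} {b} (entry (there (there (here refl))) (there (here refl))))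
    where
    y : List ℕ
    y = a ∷ b ∷ d ∷ []
    entry : ∀ {s t′} → s ∈ range1 3 → t′ ∈ range1 3 → T (entry132 y s t′)
    entry {s} s∈ t∈ = All.lookup (all⁺ (entry132 y s) _ (All.lookup (all⁺ (λ s → all (entry132 y s) (range1 3)) _ t) s∈)) t∈
    ascent : ∀ {x z eq} → T (iffᵇ (x <ᵇ z) true ∧ eq) → T (x <ᵇ z)
    ascent {x} {z} c = proj₂ (iffᵇ⁻ (∧-elimˡ {iffᵇ (x <ᵇ z) true} c)) tt

  orderIsoᵇ-132⁺ : ∀ a b d → a < d → d < b → T (orderIsoᵇ (a ∷ b ∷ d ∷ []) pat132)
  orderIsoᵇ-132⁺ a b d a<d d<b = all⁻ (λ s → all (entry132 y s) (range1 3)) {xs = range1 3}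
    ( all⁻ (entry132 y 1) {xs = range1 3} (comparison-≡ a ∷ comparison-< a<b ∷ comparison-< a<d ∷ [])
    ∷ all⁻ (entry132 y 2) {xs = range1 3} (comparison-> a<b ∷ comparison-≡ b ∷ comparison-> d<b ∷ [])
    ∷ all⁻ (entry132 y 3) {xs = range1 3} (comparison-> a<d ∷ comparison-< d<b ∷ comparison-≡ d ∷ [])
    ∷ [])
    where
    y : List ℕ
    y = a ∷ b ∷ d ∷ []
    a<b : a < b
    a<b = <-trans a<d d<b

  private
    Occurrence : List ℕ → Bool
    Occurrence y = (length y ≡ᵇ length pat132) ∧ orderIsoᵇ y pat132

  avoidsᵇ⁻ : ∀ x → T (avoidsᵇ x pat132) → Avoids132 x
  avoidsᵇ⁻ x t {a} {b} {d} sub a<d d<b =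
    not⁻ t (any⁺ Occurrence (Any.map (λ { refl → orderIsoᵇ-132⁺ a b d a<d d<b }) (∈-subseqs⁺ sub)))

  avoidsᵇ⁺ : ∀ x → Avoids132 x → T (avoidsᵇ x pat132)
  avoidsᵇ⁺ x avoid = not⁺ λ t → let y , y∈ , occ = find (any⁻ Occurrence (subseqs x) t) in no-occurrence y y∈ occ
    where
    no-occurrence : ∀ y → y ∈ subseqs x → T (Occurrence y) → ⊥
    no-occurrence (a ∷ b ∷ d ∷ []) y∈ occ =
      let a<d , d<b = orderIsoᵇ-132⁻ a b d (∧-elimʳ {true} occ) in avoid (∈-subseqs⁻ x y∈) a<d d<b

  isB132 : List ℕ → Bool
  isB132 x = isRevisedAscentSeq x ∧ avoidsᵇ x pat132

  words132 : ℕ → (List ℕ → Bool) → List (List ℕ)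
  words132 n p = filterᵇ (λ x → isB132 x ∧ p x) (endofunctions n)

  anyWord : List ℕ → Bool
  anyWord _ = true

  words132-unique : ∀ n p → Unique (words132 n p)
  words132-unique n p = Unique.filter⁺ _ (wordsOver-unique n n)

  isB132⁻ : ∀ x → T (isB132 x) → Cayley x × RevisedAscent x × Avoids132 x
  isB132⁻ x t = isCayley⁻ x (∧-elimˡ ras) , ascbotEqNub⁻ x (∧-elimʳ {isCayley x} ras) ,
    avoidsᵇ⁻ x (∧-elimʳ {isRevisedAscentSeq x} t)
    where
    ras : T (isRevisedAscentSeq x)
    ras = ∧-elimˡ {isRevisedAscentSeq x} t

  isB132⁺ : ∀ {x} → RAS132 x → T (isB132 x)
  isB132⁺ {x} r = ∧-intro (∧-intro (isCayley⁺ x cayley) (ascbotEqNub⁺ x revisedAscent)) (avoidsᵇ⁺ x avoids132)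
    where open RAS132 r

  ∈-words132⁻ : ∀ n p {x} → x ∈ words132 (suc n) p → length x ≡ suc n × RAS132 x × T (p x)
  ∈-words132⁻ n p {x} x∈ with ∈-filter⁻ _ {xs = endofunctions (suc n)} x∈
  ... | x∈words , t with ∈-wordsOver⁻ (suc n) (suc n) x∈words | isB132⁻ x (∧-elimˡ {isB132 x} t)
  ... | length≡ , bounded | cayley , ras , avoid =
    length≡ , mkRAS132 (λ { refl → 0≢1+n length≡ }) (All.map proj₁ bounded) cayley ras avoid , ∧-elimʳ {isB132 x} t

  ∈-words132⁺ : ∀ n p {x} → length x ≡ n → RAS132 x → T (p x) → x ∈ words132 n p
  ∈-words132⁺ n p {x} length≡ r t = ∈-filter⁺ _ (∈-wordsOver⁺ n n length≡ (All.tabulate bounded)) (∧-intro (isB132⁺ r) t)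
    where
    bounded : ∀ {v} → v ∈ x → 1 ≤ v × v ≤ n
    bounded v∈ = All.lookup (RAS132.positive r) v∈ , subst (_ ≤_) length≡ (Cayley⇒≤length (RAS132.cayley r) v∈)

  length-filterᵇ-split : ∀ {A : Set} (b p q : A → Bool) xs →
    length (filterᵇ (λ x → b x ∧ p x) xs) ≡
    length (filterᵇ (λ x → b x ∧ (p x ∧ q x)) xs) + length (filterᵇ (λ x → b x ∧ (p x ∧ not (q x))) xs)
  length-filterᵇ-split b p q []       = refl
  length-filterᵇ-split b p q (x ∷ xs) with b x | p x | q x
  ... | false | _     | _     = length-filterᵇ-split b p q xs
  ... | true  | false | _     = length-filterᵇ-split b p q xs
  ... | true  | true  | true  = cong suc (length-filterᵇ-split b p q xs)
  ... | true  | true  | false = trans (cong suc (length-filterᵇ-split b p q xs)) (sym (+-suc _ _))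

  length-words132-split : ∀ n p q →
    length (words132 n p) ≡ length (words132 n (λ x → p x ∧ q x)) + length (words132 n (λ x → p x ∧ not (q x)))
  length-words132-split n p q = length-filterᵇ-split isB132 p q (endofunctions n)

  countB≡length-words132 : ∀ n → countB pat132 n ≡ length (words132 n anyWord)
  countB≡length-words132 n = cong length (filter-≐ _ _
    ((λ {x} t → subst T (sym (∧-identityʳ (isB132 x))) t) , (λ {x} t → subst T (∧-identityʳ (isB132 x)) t))
    (endofunctions n))

module ElementaryBijections where

  open RevisedAscentSequences
  open BooleanCharacterisation
  open Counting
  open import Data.Bool using (Bool; T; _∧_; not)
  open import Data.Empty using (⊥-elim)
  open import Data.List using (List; []; _∷_; _++_; length; drop; initLast; _∷ʳ′_)
  open import Data.List.Properties using (length-++; ++-assoc)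
  open import Data.List.Membership.Propositional using (_∈_)
  open import Data.List.Membership.Propositional.Properties using (∈-++⁺ˡ)
  open import Data.List.Relation.Binary.Sublist.Propositional using (_⊆_; []; _∷_; _∷ʳ_; ⊆-refl; from∈)
  open import Data.List.Relation.Binary.Sublist.Propositional.Properties using (++⁺; ++⁺ʳ)
  open import Data.List.Relation.Unary.All as All using (All; []; _∷_)
  import Data.List.Relation.Unary.All.Properties as All
  open import Data.List.Relation.Unary.Any using (here; there)
  open import Data.Nat using (ℕ; suc; _≤_; z≤n; s≤s; _≡ᵇ_)
  open import Data.Nat.Properties
  open import Data.Product using (_×_; _,_; proj₁; proj₂)
  open import Data.Sum using (_⊎_; inj₁; inj₂; [_,_]′)
  open import Data.Unit using (tt)
  open import Relation.Binary.PropositionalEquality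
  open import Relation.Nullary using (¬_)

  Counted : ℕ → (List ℕ → Bool) → List ℕ → Set
  Counted n p x = length x ≡ n × RAS132 x × T (p x)

  words132-bijection : ∀ {m n p q} (φ ψ : List ℕ → List ℕ) →
    (∀ {x} → Counted (suc m) p x → Counted (suc n) q (φ x) × ψ (φ x) ≡ x) →
    (∀ {y} → Counted (suc n) q y → Counted (suc m) p (ψ y) × φ (ψ y) ≡ y) →
    length (words132 (suc m) p) ≡ length (words132 (suc n) q)
  words132-bijection {m} {n} {p} {q} φ ψ forward backward =
    inverses⇒length≡ (words132-unique (suc m) p) (words132-unique (suc n) q) φ ψ
      (λ x∈ → counted⇒∈ (proj₁ (forward (∈-words132⁻ m p x∈))))
      (λ y∈ → counted⇒∈ (proj₁ (backward (∈-words132⁻ n q y∈))))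
      (λ x∈ → proj₂ (forward (∈-words132⁻ m p x∈)))
      (λ y∈ → proj₂ (backward (∈-words132⁻ n q y∈)))
    where
    counted⇒∈ : ∀ {k r x} → Counted k r x → x ∈ words132 k r
    counted⇒∈ {k} {r} (length≡ , ras , t) = ∈-words132⁺ k r length≡ ras t

  pair⊈singleton : ∀ {a b c : ℕ} → ¬ (a ∷ b ∷ []) ⊆ (c ∷ [])
  pair⊈singleton (_ ∷ʳ ())
  pair⊈singleton (_ ∷ ())

  triple⊈singleton : ∀ {a b d c : ℕ} → ¬ (a ∷ b ∷ d ∷ []) ⊆ (c ∷ [])
  triple⊈singleton (_ ∷ʳ ())
  triple⊈singleton (_ ∷ ())

  length-snoc : ∀ (x : List ℕ) e → length (x ++ e ∷ []) ≡ suc (length x)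
  length-snoc x e = trans (length-++ x) (+-comm (length x) 1)

  endsWith1 : List ℕ → Bool
  endsWith1 x = final x ≡ᵇ 1

  RAS132-++1⁺ : ∀ x → RAS132 x → RAS132 (x ++ 1 ∷ [])
  RAS132-++1⁺ []      r = ⊥-elim (RAS132.nonEmpty r refl)
  RAS132-++1⁺ (a ∷ w) r = mkRAS132 (λ ()) (All.++⁺ positive (s≤s z≤n ∷ [])) cayley′ ascents′ avoids′
    where
    open RAS132 r
    cayley′ : Cayley (a ∷ w ++ 1 ∷ [])
    cayley′ v∈ 1≤u u≤v with ∈-snoc⁻ (a ∷ w) v∈
    ... | inj₁ p    = ∈-++⁺ˡ (cayley p 1≤u u≤v)
    ... | inj₂ refl = subst (_∈ a ∷ w ++ 1 ∷ []) (≤-antisym 1≤u u≤v) (∈-snoc⁺ʳ (a ∷ w))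
    ascents′ : Ascents (a ∷ []) (w ++ 1 ∷ [])
    ascents′ = Ascents-snoc⁺ (a ∷ []) w 1
      (Ascents⇒AscentsBefore (a ∷ []) w 1 revisedAscent (λ w≢[] → All.lookup positive (there (final-∈ w w≢[]))))
      (RAS132⇒1∈ r)
    avoids′ : Avoids132 (a ∷ w ++ 1 ∷ [])
    avoids′ sub a<d d<b with triple-⊆-++ (a ∷ w) (1 ∷ []) sub
    ... | inj₁ s                      = avoids132 s a<d d<b
    ... | inj₂ (inj₁ (s , here refl)) = <⇒≱ a<d (All.lookup positive (proj₁ (pair-⊆⇒∈ s)))
    ... | inj₂ (inj₂ (inj₁ (_ , s)))  = pair⊈singleton s
    ... | inj₂ (inj₂ (inj₂ s))        = triple⊈singleton s

  RAS132-++1⁻ : ∀ x → ¬ x ≡ [] → RAS132 (x ++ 1 ∷ []) → RAS132 x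
  RAS132-++1⁻ []      x≢[] r = ⊥-elim (x≢[] refl)
  RAS132-++1⁻ (a ∷ w) _    r =
    mkRAS132 (λ ()) (All.++⁻ˡ (a ∷ w) positive) cayley′ ascents′ (Avoids132-⊆ (++⁺ʳ (1 ∷ []) ⊆-refl) avoids132)
    where
    open RAS132 r
    split : AscentsBefore (a ∷ []) w 1 × 1 ∈ (a ∷ []) ++ w
    split = Ascents-snoc⁻ (a ∷ []) w 1 revisedAscent
    cayley′ : Cayley (a ∷ w)
    cayley′ v∈ 1≤u u≤v with ∈-snoc⁻ (a ∷ w) (cayley (∈-++⁺ˡ v∈) 1≤u u≤v)
    ... | inj₁ p    = p
    ... | inj₂ refl = proj₂ split
    ascents′ : Ascents (a ∷ []) w
    ascents′ = AscentsBefore⇒Ascents (a ∷ []) w 1 (proj₁ split) λ w≢[] →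
      AscentsBefore-final-old (a ∷ []) w 1 (proj₁ split) w≢[]
        (λ final<1 → <⇒≱ final<1 (All.lookup positive (there (∈-++⁺ˡ (final-∈ w w≢[])))))

  count-endsWith1 : ∀ m → length (words132 (suc m) anyWord) ≡ length (words132 (suc (suc m)) endsWith1)
  count-endsWith1 m = words132-bijection (_++ 1 ∷ []) dropLast forward backward
    where
    forward : ∀ {x} → Counted (suc m) anyWord x →
              Counted (suc (suc m)) endsWith1 (x ++ 1 ∷ []) × dropLast (x ++ 1 ∷ []) ≡ x
    forward {x} (length≡ , r , _) =
      (trans (length-snoc x 1) (cong suc length≡) , RAS132-++1⁺ x r , subst (λ z → T (z ≡ᵇ 1)) (sym (final-snoc x 1)) tt) ,
      dropLast-snoc x 1
    backward : ∀ {y} → Counted (suc (suc m)) endsWith1 y →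
               Counted (suc m) anyWord (dropLast y) × dropLast y ++ 1 ∷ [] ≡ y
    backward {y} (length≡ , r , t) with initLast y
    ... | []       = ⊥-elim (0≢1+n length≡)
    ... | y′ ∷ʳ′ ℓ with trans (sym (final-snoc y′ ℓ)) (≡ᵇ⇒≡ _ 1 t)
    ...   | refl =
      subst (Counted (suc m) anyWord) (sym (dropLast-snoc y′ 1))
        (length≡′ , RAS132-++1⁻ y′ (λ { refl → 0≢1+n length≡′ }) r , tt) ,
      cong (_++ 1 ∷ []) (dropLast-snoc y′ 1)
      where
      length≡′ : length y′ ≡ suc m
      length≡′ = suc-injective (trans (sym (length-snoc y′ 1)) length≡)

  endsAbove1 : List ℕ → Bool
  endsAbove1 x = not (endsWith1 x)

  pair-⊆-snoc : ∀ {p q : ℕ} x ℓ → (p ∷ q ∷ []) ⊆ x ++ ℓ ∷ [] → (p ∷ q ∷ []) ⊆ x ⊎ q ≡ ℓ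
  pair-⊆-snoc []      ℓ s          = ⊥-elim (pair⊈singleton s)
  pair-⊆-snoc (y ∷ x) ℓ (_ ∷ʳ s) with pair-⊆-snoc x ℓ s
  ... | inj₁ s′ = inj₁ (y ∷ʳ s′)
  ... | inj₂ e  = inj₂ e
  pair-⊆-snoc (y ∷ x) ℓ (refl ∷ s) with ∈-snoc⁻ x (∈-resp-⊆ (here refl) s)
  ... | inj₁ q∈ = inj₁ (refl ∷ from∈ q∈)
  ... | inj₂ e  = inj₂ e

  RAS132-dupLast⁺ : ∀ x ℓ → ¬ x ≡ [] → RAS132 (x ++ ℓ ∷ []) → RAS132 ((x ++ ℓ ∷ []) ++ ℓ ∷ [])
  RAS132-dupLast⁺ []      ℓ x≢[] r = ⊥-elim (x≢[] refl)
  RAS132-dupLast⁺ (a ∷ w) ℓ _    r =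
    mkRAS132 (λ ()) (All.++⁺ positive (All.lookup positive ℓ∈ ∷ [])) cayley′ ascents′ avoids′
    where
    open RAS132 r
    x : List ℕ
    x = a ∷ w ++ ℓ ∷ []
    ℓ∈ : ℓ ∈ x
    ℓ∈ = ∈-snoc⁺ʳ (a ∷ w)
    cayley′ : Cayley (x ++ ℓ ∷ [])
    cayley′ = Cayley-cong ∈-++⁺ˡ (λ v∈ → [ (λ p → p) , (λ { refl → ℓ∈ }) ]′ (∈-snoc⁻ x v∈)) cayley
    ascents′ : Ascents (a ∷ []) ((w ++ ℓ ∷ []) ++ ℓ ∷ [])
    ascents′ = Ascents-snoc⁺ (a ∷ []) (w ++ ℓ ∷ []) ℓ
      (Ascents⇒AscentsBefore (a ∷ []) (w ++ ℓ ∷ []) ℓ revisedAscent (λ _ → ≤-reflexive (sym (final-snoc w ℓ))))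
      (there (∈-snoc⁺ʳ w))
    avoids′ : Avoids132 (x ++ ℓ ∷ [])
    avoids′ sub a<d d<b with triple-⊆-++ x (ℓ ∷ []) sub
    ... | inj₁ s                      = avoids132 s a<d d<b
    ... | inj₂ (inj₂ (inj₁ (_ , s)))  = pair⊈singleton s
    ... | inj₂ (inj₂ (inj₂ s))        = triple⊈singleton s
    ... | inj₂ (inj₁ (s , here refl)) with pair-⊆-snoc (a ∷ w) ℓ s
    ...   | inj₁ s′   = avoids132 (++⁺ s′ (refl ∷ [])) a<d d<b
    ...   | inj₂ refl = <-irrefl refl d<b

  RAS132-dupLast⁻ : ∀ x ℓ → RAS132 ((x ++ ℓ ∷ []) ++ ℓ ∷ []) → RAS132 (x ++ ℓ ∷ [])
  RAS132-dupLast⁻ x ℓ r =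
    mkRAS132 (++-∷≢[] x) (All.++⁻ˡ (x ++ ℓ ∷ []) positive) cayley′ (ascents′ x revisedAscent)
             (Avoids132-⊆ (++⁺ʳ (ℓ ∷ []) ⊆-refl) avoids132)
    where
    open RAS132 r
    cayley′ : Cayley (x ++ ℓ ∷ [])
    cayley′ = Cayley-cong (λ v∈ → [ (λ p → p) , (λ { refl → ∈-snoc⁺ʳ x }) ]′ (∈-snoc⁻ (x ++ ℓ ∷ []) v∈)) ∈-++⁺ˡ cayley
    ascents′ : ∀ x → RevisedAscent ((x ++ ℓ ∷ []) ++ ℓ ∷ []) → RevisedAscent (x ++ ℓ ∷ [])
    ascents′ []      _ = tt
    ascents′ (a ∷ w) ρ with Ascents-snoc⁻ (a ∷ []) (w ++ ℓ ∷ []) ℓ ρ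
    ... | before , _ = AscentsBefore⇒Ascents (a ∷ []) (w ++ ℓ ∷ []) ℓ before λ ne →
      AscentsBefore-final-old (a ∷ []) (w ++ ℓ ∷ []) ℓ before ne (<-irrefl (final-snoc w ℓ))

  lastTwoEqual-snoc-snoc : ∀ x a b → lastTwoEqual ((x ++ a ∷ []) ++ b ∷ []) ≡ (a ≡ᵇ b)
  lastTwoEqual-snoc-snoc x a b = trans (cong lastTwoEqual (++-assoc x (a ∷ []) (b ∷ []))) (lastTwoEqual-++ x)

  endsAbove1-snoc : ∀ x ℓ → T (endsAbove1 (x ++ ℓ ∷ [])) → ¬ ℓ ≡ 1
  endsAbove1-snoc x ℓ t ℓ≡1 = not⁻ t (subst (λ z → T (z ≡ᵇ 1)) (sym (trans (final-snoc x ℓ) ℓ≡1)) tt)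

  count-lastTwoEqual : ∀ m → length (words132 (suc m) endsAbove1) ≡
                             length (words132 (suc (suc m)) (λ x → endsAbove1 x ∧ lastTwoEqual x))
  count-lastTwoEqual m = words132-bijection (λ x → x ++ final x ∷ []) dropLast forward backward
    where
    forward : ∀ {x} → Counted (suc m) endsAbove1 x →
              Counted (suc (suc m)) (λ x → endsAbove1 x ∧ lastTwoEqual x) (x ++ final x ∷ []) ×
              dropLast (x ++ final x ∷ []) ≡ x
    forward {x} (length≡ , r , t) with initLast x
    ... | []      = ⊥-elim (0≢1+n length≡)
    ... | [] ∷ʳ′ ℓ with RAS132⇒1∈ r
    ...   | here ℓ≡1 = ⊥-elim (endsAbove1-snoc [] ℓ t (sym ℓ≡1))
    forward {x} (length≡ , r , ℓ≠1) | (a ∷ w) ∷ʳ′ ℓ rewrite final-snoc (a ∷ w) ℓ =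
      (trans (length-snoc (a ∷ w ++ ℓ ∷ []) ℓ) (cong suc length≡) ,
       RAS132-dupLast⁺ (a ∷ w) ℓ (λ ()) r ,
       ∧-intro (subst (λ z → T (not (z ≡ᵇ 1))) (sym (final-snoc (a ∷ w ++ ℓ ∷ []) ℓ)) ℓ≠1)
               (subst T (sym (lastTwoEqual-snoc-snoc (a ∷ w) ℓ ℓ)) (≡⇒≡ᵇ ℓ ℓ refl))) ,
      dropLast-snoc (a ∷ w ++ ℓ ∷ []) ℓ
    backward : ∀ {y} → Counted (suc (suc m)) (λ x → endsAbove1 x ∧ lastTwoEqual x) y →
               Counted (suc m) endsAbove1 (dropLast y) × dropLast y ++ final (dropLast y) ∷ [] ≡ y
    backward {y} (length≡ , r , t) with initLast y
    ... | []       = ⊥-elim (0≢1+n length≡)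
    ... | y′ ∷ʳ′ b with initLast y′
    ...   | []       = ⊥-elim (0≢1+n (suc-injective length≡))
    ...   | x ∷ʳ′ a with ≡ᵇ⇒≡ a b
      (subst T (lastTwoEqual-snoc-snoc x a b) (∧-elimʳ {endsAbove1 ((x ++ a ∷ []) ++ b ∷ [])} t))
    ...     | refl rewrite dropLast-snoc (x ++ a ∷ []) a | final-snoc x a =
      (suc-injective (trans (sym (length-snoc (x ++ a ∷ []) a)) length≡) ,
       RAS132-dupLast⁻ x a r ,
       subst (λ z → T (not (z ≡ᵇ 1))) (final-snoc (x ++ a ∷ []) a) (∧-elimˡ {endsAbove1 ((x ++ a ∷ []) ++ a ∷ [])} t)) ,
      refl

  RAS132-dupFirst⁺ : ∀ a w → RAS132 (a ∷ w) → RAS132 (a ∷ a ∷ w)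
  RAS132-dupFirst⁺ a w r =
    mkRAS132 (λ ()) (All.head positive ∷ positive) (Cayley-cong there drop-repeat cayley)
             (ascents′ w revisedAscent (first-maximum (a ∷ w) revisedAscent)) avoids′
    where
    open RAS132 r
    drop-repeat : ∀ {v} → v ∈ a ∷ a ∷ w → v ∈ a ∷ w
    drop-repeat (here e)  = here e
    drop-repeat (there p) = p
    ascents′ : ∀ w → Ascents (a ∷ []) w → (∀ {v} → v ∈ a ∷ w → v ≤ a) → Ascents (a ∷ []) (a ∷ w)
    ascents′ []      _ _  = here refl
    ascents′ (b ∷ w) ρ ≤a = AscentStep-old (here refl) (≤a (there (here refl))) ,
      Ascents-cong (b ∷ w) (λ _ → ∈-++⁺ˡ) (λ _ p → [ (λ q → q) , here ]′ (∈-snoc⁻ (a ∷ []) p)) ρ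
    avoids′ : Avoids132 (a ∷ a ∷ w)
    avoids′ (_ ∷ʳ s)          = avoids132 s
    avoids′ (refl ∷ _ ∷ʳ s)   = avoids132 (refl ∷ s)
    avoids′ (refl ∷ refl ∷ s) a<d d<b = <-asym a<d d<b

  RAS132-dupFirst⁻ : ∀ a w → RAS132 (a ∷ a ∷ w) → RAS132 (a ∷ w)
  RAS132-dupFirst⁻ a w r =
    mkRAS132 (λ ()) (All.tail positive) (Cayley-cong drop-repeat there cayley) (ascents′ w revisedAscent)
             (Avoids132-⊆ (a ∷ʳ ⊆-refl) avoids132)
    where
    open RAS132 r
    drop-repeat : ∀ {v} → v ∈ a ∷ a ∷ w → v ∈ a ∷ w
    drop-repeat (here e)  = here e
    drop-repeat (there p) = p
    ascents′ : ∀ w → Ascents (a ∷ []) (a ∷ w) → Ascents (a ∷ []) w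
    ascents′ []      _       = tt
    ascents′ (b ∷ w) (_ , ρ) = Ascents-cong (b ∷ w) (λ _ p → [ (λ q → q) , here ]′ (∈-snoc⁻ (a ∷ []) p)) (λ _ → ∈-++⁺ˡ) ρ

  count-firstTwoEqual : ∀ m → length (words132 (suc m) anyWord) ≡ length (words132 (suc (suc m)) firstTwoEqual)
  count-firstTwoEqual m = words132-bijection (λ x → first x ∷ x) (drop 1) forward backward
    where
    forward : ∀ {x} → Counted (suc m) anyWord x →
      Counted (suc (suc m)) firstTwoEqual (first x ∷ x) × drop 1 (first x ∷ x) ≡ x
    forward {[]}    (length≡ , _ , _) = ⊥-elim (0≢1+n length≡)
    forward {a ∷ w} (length≡ , r , _) = (cong suc length≡ , RAS132-dupFirst⁺ a w r , ≡⇒≡ᵇ a a refl) , refl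
    backward : ∀ {y} → Counted (suc (suc m)) firstTwoEqual y →
      Counted (suc m) anyWord (drop 1 y) × first (drop 1 y) ∷ drop 1 y ≡ y
    backward {[]}        (length≡ , _ , _) = ⊥-elim (0≢1+n length≡)
    backward {a ∷ []}    (_ , _ , ())
    backward {a ∷ b ∷ w} (length≡ , r , t) with ≡ᵇ⇒≡ a b t
    ... | refl = (suc-injective length≡ , RAS132-dupFirst⁻ a w r , tt) , refl

module BracketedWords where

  open RevisedAscentSequences
  open BooleanCharacterisation
  open ElementaryBijections
  open import Data.Bool using (Bool; true; false; T; _∧_; not; if_then_else_)
  open import Data.Empty using (⊥; ⊥-elim)
  open import Data.List using (List; []; _∷_; _++_; map; length; initLast; _∷ʳ′_)
  open import Data.List.Properties using (length-++; length-map; ++-assoc; map-++)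
  open import Data.List.Membership.Propositional using (_∈_; _∉_)
  open import Data.List.Membership.Propositional.Properties using (∈-++⁺ˡ; ∈-++⁺ʳ; ∈-++⁻; ∈-map⁺; ∈-map⁻; ∈-∃++)
  open import Data.List.Relation.Binary.Sublist.Propositional using (_⊆_; []; _∷_; _∷ʳ_; ⊆-refl; from∈; minimum)
  open import Data.List.Relation.Binary.Sublist.Propositional.Properties using (++⁺; ++⁺ˡ; ++⁺ʳ; length-mono-≤)
  open import Data.List.Relation.Unary.All as All using (All; []; _∷_)
  import Data.List.Relation.Unary.All.Properties as All
  open import Data.List.Relation.Unary.Any using (here; there)
  open import Data.Nat using (ℕ; zero; suc; pred; _+_; _≤_; _<_; z≤n; s≤s; _≡ᵇ_; _<ᵇ_; _≟_)
  open import Data.Nat.Properties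
  open import Data.Product using (∃; ∃₂; _×_; _,_; proj₁; proj₂)
  open import Data.Sum using (_⊎_; inj₁; inj₂; [_,_]′)
  open import Data.Unit using (tt)
  open import Relation.Binary using (tri<; tri≈; tri>)
  open import Relation.Binary.PropositionalEquality
  open import Relation.Nullary using (¬_; yes; no)

  -- Words c t … c with t < c whose last two letters differ: the second factor
  -- when a word ending in two distinct letters is split before its first letter
  -- smaller than the last one.
  bracketed : List ℕ → Bool
  bracketed x = (second x <ᵇ first x) ∧ ((first x ≡ᵇ final x) ∧ not (lastTwoEqual x))

  penultimateIs1 : List ℕ → Bool
  penultimateIs1 x = penultimate x ≡ᵇ 1

  firstTwoDistinct : List ℕ → Bool
  firstTwoDistinct x = not (firstTwoEqual x)

  record Bracketed (x : List ℕ) : Set where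
    field
      second<first  : second x < first x
      final≡first   : final x ≡ first x
      lastTwoDiffer : ¬ T (lastTwoEqual x)

  bracketed⁻ : ∀ x → T (bracketed x) → Bracketed x
  bracketed⁻ x t = record
    { second<first  = <ᵇ⇒< _ _ (∧-elimˡ {second x <ᵇ first x} t)
    ; final≡first   = sym (≡ᵇ⇒≡ _ _ (∧-elimˡ {first x ≡ᵇ final x} rest))
    ; lastTwoDiffer = not⁻ (∧-elimʳ {first x ≡ᵇ final x} rest)
    }
    where
    rest : T ((first x ≡ᵇ final x) ∧ not (lastTwoEqual x))
    rest = ∧-elimʳ {second x <ᵇ first x} t

  bracketed⁺ : ∀ x → Bracketed x → T (bracketed x)
  bracketed⁺ x b = ∧-intro (<⇒<ᵇ second<first) (∧-intro (≡⇒≡ᵇ _ _ (sym final≡first)) (not⁺ lastTwoDiffer))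
    where open Bracketed b

  map-suc-positive : ∀ x → All (1 ≤_) (map suc x)
  map-suc-positive []      = []
  map-suc-positive (a ∷ x) = s≤s z≤n ∷ map-suc-positive x

  1∉map-suc : ∀ {x} → All (1 ≤_) x → 1 ∉ map suc x
  1∉map-suc positive p with ∈-map⁻ suc p
  ... | v , v∈ , e with subst (1 ≤_) (sym (suc-injective e)) (All.lookup positive v∈)
  ... | ()

  final-map-suc : ∀ x → ¬ x ≡ [] → 1 ≤ final (map suc x)
  final-map-suc []          x≢[] = ⊥-elim (x≢[] refl)
  final-map-suc (a ∷ [])    _    = s≤s z≤n
  final-map-suc (a ∷ b ∷ x) _    = final-map-suc (b ∷ x) (λ ())

  pair-⊆-pair : ∀ {q d a b : ℕ} → (q ∷ d ∷ []) ⊆ (a ∷ b ∷ []) → q ≡ a × d ≡ b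
  pair-⊆-pair (refl ∷ refl ∷ []) = refl , refl
  pair-⊆-pair (_ ∷ _ ∷ʳ s)       with length-mono-≤ s
  ... | ()
  pair-⊆-pair (_ ∷ʳ s)           with length-mono-≤ s
  ... | s≤s ()

  triple⊈pair : ∀ {p q d a b : ℕ} → ¬ (p ∷ q ∷ d ∷ []) ⊆ (a ∷ b ∷ [])
  triple⊈pair s with length-mono-≤ s
  ... | s≤s (s≤s ())

  ∈-pair⁻ : ∀ {v a b : ℕ} → v ∈ a ∷ b ∷ [] → v ≡ a ⊎ v ≡ b
  ∈-pair⁻ (here e)         = inj₁ e
  ∈-pair⁻ (there (here e)) = inj₂ e

  second-∈ : ∀ a r → ¬ r ≡ [] → second (a ∷ r) ∈ a ∷ r
  second-∈ a []      r≢[] = ⊥-elim (r≢[] refl)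
  second-∈ a (b ∷ r) _    = there (here refl)

  raiseAndClose : List ℕ → List ℕ
  raiseAndClose h = map suc h ++ 1 ∷ suc (first h) ∷ []

  module RaiseAndClose {h₀ h′} (r : RAS132 (h₀ ∷ h′)) (distinct : T (firstTwoDistinct (h₀ ∷ h′))) where
    open RAS132 r
    private
      h : List ℕ
      h = h₀ ∷ h′
      c : ℕ
      c = suc h₀
      U : List ℕ
      U = map suc h
      w : List ℕ
      w = U ++ 1 ∷ c ∷ []

    1≤h₀ : 1 ≤ h₀
    1≤h₀ = All.head positive

    U≤c : ∀ {q} → q ∈ U → q ≤ c
    U≤c q∈ with ∈-map⁻ suc q∈
    ... | v , v∈ , refl = s≤s (first-maximum h revisedAscent v∈)

    cayley′ : Cayley w
    cayley′ v∈ {suc zero}    _ _ = ∈-++⁺ʳ U (here refl)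
    cayley′ v∈ {suc (suc t)} _ u≤v with ∈-++⁻ U v∈
    ... | inj₁ p with ∈-map⁻ suc p
    ...   | v′ , v′∈ , refl = ∈-++⁺ˡ (∈-map⁺ suc (cayley v′∈ (s≤s z≤n) (≤-pred u≤v)))
    cayley′ v∈ {suc (suc t)} _ u≤v | inj₂ q with ∈-pair⁻ q
    ... | inj₁ refl = ⊥-elim (<⇒≱ (s≤s (s≤s z≤n)) u≤v)
    ... | inj₂ refl = ∈-++⁺ˡ (∈-map⁺ suc (cayley (here refl) (s≤s z≤n) (≤-pred u≤v)))

    ascents′ : RevisedAscent w
    ascents′ = Ascents-++⁺ (c ∷ []) (map suc h′) 1 (c ∷ [])
      (Ascents⇒AscentsBefore (c ∷ []) (map suc h′) 1 (Ascents-map⁺ s≤s (h₀ ∷ []) h′ revisedAscent)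
         (λ ne → final-map-suc h′ (λ { refl → ne refl })))
      (((λ p → ⊥-elim (1∉map-suc positive p)) , (λ _ → s≤s 1≤h₀)) , ∈-++⁺ˡ {ys = 1 ∷ []} (here refl))

    avoids′ : Avoids132 w
    avoids′ s a<d d<b with triple-⊆-++ U (1 ∷ c ∷ []) s
    ... | inj₁ s′ = Avoids132-map⁺ s≤s h avoids132 s′ a<d d<b
    ... | inj₂ (inj₁ (s′ , d∈)) with ∈-pair⁻ d∈
    ...   | inj₁ refl = <⇒≱ a<d (All.lookup (map-suc-positive h) (proj₁ (pair-⊆⇒∈ s′)))
    ...   | inj₂ refl = <⇒≱ d<b (U≤c (proj₂ (pair-⊆⇒∈ s′)))
    avoids′ s a<d d<b | inj₂ (inj₂ (inj₁ (_ , s′))) with pair-⊆-pair s′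
    ... | refl , refl = <⇒≱ d<b (s≤s z≤n)
    avoids′ s a<d d<b | inj₂ (inj₂ (inj₂ s′)) = triple⊈pair s′

    ras132 : RAS132 w
    ras132 = mkRAS132 (λ ()) (All.++⁺ (map-suc-positive h) (s≤s z≤n ∷ s≤s z≤n ∷ [])) cayley′ ascents′ avoids′

    second<c : second w < c
    second<c = go h′ distinct (first-maximum h revisedAscent)
      where
      go : ∀ h′ → T (firstTwoDistinct (h₀ ∷ h′)) → (∀ {v} → v ∈ h₀ ∷ h′ → v ≤ h₀) →
        second (map suc (h₀ ∷ h′) ++ 1 ∷ c ∷ []) < c
      go []        _ _  = s≤s 1≤h₀
      go (h₁ ∷ _)  d ≤h₀ = s≤s (≤∧≢⇒< (≤h₀ (there (here refl))) (λ e → not⁻ d (≡⇒≡ᵇ h₀ h₁ (sym e))))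

    class : T (bracketed w ∧ penultimateIs1 w)
    class = ∧-intro (bracketed⁺ w record
      { second<first  = second<c
      ; final≡first   = final-++ U (λ ())
      ; lastTwoDiffer = λ t → <⇒≢ (s≤s 1≤h₀) (≡ᵇ⇒≡ 1 c (subst T (lastTwoEqual-++ U) t))
      }) (subst (λ z → T (z ≡ᵇ 1)) (sym (penultimate-++ U)) tt)

    length≡ : length w ≡ suc (suc (length h))
    length≡ = trans (length-++ U) (trans (cong (_+ 2) (length-map suc h)) (+-comm (length h) 2))

  module LowerAndOpen {h₀ h′ c} (r : RAS132 (map suc (h₀ ∷ h′) ++ 1 ∷ c ∷ []))
                      (k : Bracketed (map suc (h₀ ∷ h′) ++ 1 ∷ c ∷ [])) where
    open RAS132 r
    open Bracketed k
    private
      h : List ℕ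
      h = h₀ ∷ h′
      U : List ℕ
      U = map suc h
      w : List ℕ
      w = U ++ 1 ∷ c ∷ []

    c≡suc-h₀ : c ≡ suc h₀
    c≡suc-h₀ = trans (sym (final-++ U (λ ()))) final≡first

    1≤h₀ : 1 ≤ h₀
    1≤h₀ = ≤-pred
      (≤-trans (s≤s (All.lookup positive (second-∈ (suc h₀) (map suc h′ ++ 1 ∷ c ∷ []) (++-∷≢[] _)))) second<first)

    1∉U : 1 ∉ U
    1∉U 1∈U = <⇒≱ (s≤s 1≤h₀)
      (subst (_≤ 1) c≡suc-h₀ (proj₁ (Ascents-step (suc h₀ ∷ []) (map suc h′) 1 c [] revisedAscent) 1∈U))

    positive′ : All (1 ≤_) h
    positive′ = All.tabulate λ {v} v∈ → case v v∈
      where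
      case : ∀ v → v ∈ h → 1 ≤ v
      case zero    v∈ = ⊥-elim (1∉U (∈-map⁺ suc v∈))
      case (suc v) _  = s≤s z≤n

    cayley′ : Cayley h
    cayley′ v∈ 1≤t t≤v with ∈-++⁻ U (cayley (∈-++⁺ˡ (∈-map⁺ suc v∈)) (s≤s z≤n) (s≤s t≤v))
    ... | inj₁ p = ∈-map-reflect s≤s p
    ... | inj₂ q with ∈-pair⁻ q
    ...   | inj₁ e = ⊥-elim (<⇒≢ (s≤s 1≤t) (sym e))
    ...   | inj₂ e = subst (_∈ h) (sym (suc-injective (trans e c≡suc-h₀))) (here refl)

    ascents′ : RevisedAscent h
    ascents′ with Ascents-++⁻ (suc h₀ ∷ []) (map suc h′) 1 (c ∷ []) revisedAscent
    ... | before , _ = Ascents-map⁻ s≤s (h₀ ∷ []) h′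
      (AscentsBefore⇒Ascents (suc h₀ ∷ []) (map suc h′) 1 before λ ne →
        AscentsBefore-final-old (suc h₀ ∷ []) (map suc h′) 1 before ne
          (λ final<1 → <⇒≱ final<1 (final-map-suc h′ (λ { refl → ne refl }))))

    ras132 : RAS132 h
    ras132 = mkRAS132 (λ ()) positive′ cayley′ ascents′
                      (Avoids132-map⁻ s≤s h (Avoids132-⊆ (++⁺ʳ (1 ∷ c ∷ []) ⊆-refl) avoids132))

    distinct : T (firstTwoDistinct h)
    distinct = not⁺ (go h′ second<first)
      where
      go : ∀ h′ → second (map suc (h₀ ∷ h′) ++ 1 ∷ c ∷ []) < suc h₀ → ¬ T (firstTwoEqual (h₀ ∷ h′))
      go []       _   ()
      go (h₁ ∷ _) lt  t = <-irrefl (cong suc (sym (≡ᵇ⇒≡ h₀ h₁ t))) lt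

  lowerAndOpen : List ℕ → List ℕ
  lowerAndOpen w = map pred (dropLast (dropLast w))

  dropLast²-++ : ∀ (u : List ℕ) a b → dropLast (dropLast (u ++ a ∷ b ∷ [])) ≡ u
  dropLast²-++ u a b = trans (cong (λ z → dropLast (dropLast z)) (sym (++-assoc u (a ∷ []) (b ∷ []))))
                             (trans (cong dropLast (dropLast-snoc (u ++ a ∷ []) b)) (dropLast-snoc u a))

  lowerAndOpen-raise : ∀ h a b → lowerAndOpen (map suc h ++ a ∷ b ∷ []) ≡ h
  lowerAndOpen-raise h a b = trans (cong (map pred) (dropLast²-++ (map suc h) a b)) (pred-suc-map h)

  penultimate1-view : ∀ {n y} → Counted (suc (suc (suc n))) (λ x → bracketed x ∧ penultimateIs1 x) y →
    ∃₂ λ h₀ h′ → ∃ λ c → y ≡ map suc (h₀ ∷ h′) ++ 1 ∷ c ∷ [] × length h′ ≡ n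
  penultimate1-view {n} {y} (length≡ , r , t) with initLast y
  ... | []       = ⊥-elim (0≢1+n length≡)
  ... | y′ ∷ʳ′ b with initLast y′
  ...   | []      = ⊥-elim (0≢1+n (suc-injective length≡))
  ...   | u ∷ʳ′ a with ≡ᵇ⇒≡ a 1 (subst (λ z → T (z ≡ᵇ 1)) penultimate≡ (∧-elimʳ {bracketed ((u ++ a ∷ []) ++ b ∷ [])} t))
    where
    penultimate≡ : penultimate ((u ++ a ∷ []) ++ b ∷ []) ≡ penultimate (a ∷ b ∷ [])
    penultimate≡ = trans (cong penultimate (++-assoc u (a ∷ []) (b ∷ []))) (penultimate-++ u)
  ...     | refl = view u (length-u u length≡) (All.++⁻ˡ u (All.++⁻ˡ (u ++ 1 ∷ []) (RAS132.positive r)))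
    where
    length-u : ∀ u → length ((u ++ 1 ∷ []) ++ b ∷ []) ≡ suc (suc (suc n)) → length u ≡ suc n
    length-u u e = suc-injective
      (suc-injective (trans (sym (trans (length-snoc (u ++ 1 ∷ []) b) (cong suc (length-snoc u 1)))) e))
    view : ∀ u → length u ≡ suc n → All (1 ≤_) u →
           ∃₂ λ h₀ h′ → ∃ λ c → (u ++ 1 ∷ []) ++ b ∷ [] ≡ map suc (h₀ ∷ h′) ++ 1 ∷ c ∷ [] × length h′ ≡ n
    view (u₀ ∷ u′) e p = pred u₀ , map pred u′ , b ,
      trans (++-assoc (u₀ ∷ u′) (1 ∷ []) (b ∷ [])) (cong (_++ 1 ∷ b ∷ []) (sym (suc-pred-map (u₀ ∷ u′) p))) ,
      trans (length-map pred u′) (suc-injective e)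

  count-penultimateIs1 : ∀ m → length (words132 (suc m) firstTwoDistinct) ≡
                               length (words132 (suc (suc (suc m))) (λ x → bracketed x ∧ penultimateIs1 x))
  count-penultimateIs1 m = words132-bijection raiseAndClose lowerAndOpen forward backward
    where
    forward : ∀ {x} → Counted (suc m) firstTwoDistinct x →
              Counted (suc (suc (suc m))) (λ x → bracketed x ∧ penultimateIs1 x) (raiseAndClose x) ×
              lowerAndOpen (raiseAndClose x) ≡ x
    forward {[]}      (length≡ , _ , _) = ⊥-elim (0≢1+n length≡)
    forward {h₀ ∷ h′} (length≡ , r , t) =
      (trans length≡′ (cong (λ z → suc (suc z)) length≡) , ras132 , class) , lowerAndOpen-raise (h₀ ∷ h′) 1 (suc h₀)
      where open RaiseAndClose r t renaming (length≡ to length≡′)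
    backward : ∀ {y} → Counted (suc (suc (suc m))) (λ x → bracketed x ∧ penultimateIs1 x) y →
               Counted (suc m) firstTwoDistinct (lowerAndOpen y) × raiseAndClose (lowerAndOpen y) ≡ y
    backward counted@(_ , r , t) with penultimate1-view counted
    ... | h₀ , h′ , c , refl , length≡ rewrite lowerAndOpen-raise (h₀ ∷ h′) 1 c =
      (cong suc length≡ , ras132 , distinct) , cong (λ z → map suc (h₀ ∷ h′) ++ 1 ∷ z ∷ []) (sym c≡suc-h₀)
      where open LowerAndOpen r (bracketed⁻ _ (∧-elimˡ {bracketed (map suc (h₀ ∷ h′) ++ 1 ∷ c ∷ [])} t))

  before1 : List ℕ → List ℕ
  before1 []      = []
  before1 (a ∷ x) = if a ≡ᵇ 1 then [] else a ∷ before1 x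

  after1 : List ℕ → List ℕ
  after1 []      = []
  after1 (a ∷ x) = if a ≡ᵇ 1 then x else after1 x

  ≢1⇒≡ᵇfalse : ∀ {a} → ¬ a ≡ 1 → (a ≡ᵇ 1) ≡ false
  ≢1⇒≡ᵇfalse {a} a≢1 with a ≡ᵇ 1 in eq
  ... | true  = ⊥-elim (a≢1 (≡ᵇ⇒≡ a 1 (subst T (sym eq) tt)))
  ... | false = refl

  before1-++ : ∀ u v → 1 ∉ u → before1 (u ++ 1 ∷ v) ≡ u
  before1-++ []      v _   = refl
  before1-++ (a ∷ u) v 1∉ rewrite ≢1⇒≡ᵇfalse {a} (λ e → 1∉ (here (sym e))) =
    cong (a ∷_) (before1-++ u v (λ p → 1∉ (there p)))

  after1-++ : ∀ u v → 1 ∉ u → after1 (u ++ 1 ∷ v) ≡ v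
  after1-++ []      v _   = refl
  after1-++ (a ∷ u) v 1∉ rewrite ≢1⇒≡ᵇfalse {a} (λ e → 1∉ (here (sym e))) = after1-++ u v (λ p → 1∉ (there p))

  split-at-1 : ∀ w → 1 ∈ w → w ≡ before1 w ++ 1 ∷ after1 w × 1 ∉ before1 w
  split-at-1 (a ∷ w) p with a ≟ 1
  ... | yes refl = refl , (λ ())
  split-at-1 (a ∷ w) (here e)  | no a≢1 = ⊥-elim (a≢1 (sym e))
  split-at-1 (a ∷ w) (there p) | no a≢1 rewrite ≢1⇒≡ᵇfalse a≢1 with split-at-1 w p
  ... | e , 1∉ = cong (a ∷_) e , (λ { (here e′) → a≢1 (sym e′) ; (there q) → 1∉ q })

  final-after-old-1 : ∀ s q → Ascents s (1 ∷ q) → 1 ∈ s → All (1 ≤_) q → final (1 ∷ q) ≡ 1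
  final-after-old-1 s []      ρ               _   _          = refl
  final-after-old-1 s (b ∷ q) ((old , _) , ρ) 1∈s (1≤b ∷ 1≤q) with ≤-antisym (old 1∈s) 1≤b
  ... | refl = final-after-old-1 (s ++ 1 ∷ []) q ρ (∈-snoc⁺ʳ s) 1≤q

  Sorted : List ℕ → Set
  Sorted v = ∀ {q d} → (q ∷ d ∷ []) ⊆ v → q ≤ d

  old-sorted⇒lastTwoEqual : ∀ s r q v → Ascents s (r ∷ q ∷ v) → r ∈ s → Sorted (r ∷ q ∷ v) → T (lastTwoEqual (r ∷ q ∷ v))
  old-sorted⇒lastTwoEqual s r q []       ((old , _) , _) r∈s sorted with ≤-antisym (old r∈s) (sorted (refl ∷ refl ∷ []))
  ... | refl = ≡⇒≡ᵇ q q refl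
  old-sorted⇒lastTwoEqual s r q (q′ ∷ v) ((old , _) , ρ) r∈s sorted with ≤-antisym (old r∈s)
    (sorted (refl ∷ refl ∷ minimum _))
  ... | refl = subst T (sym (lastTwoEqual-++ (r ∷ []) {q} {q′} {v}))
                 (old-sorted⇒lastTwoEqual (s ++ r ∷ []) q q′ v ρ (∈-snoc⁺ʳ s) (λ p → sorted (_ ∷ʳ p)))

  NoJumpOver : List ℕ → ℕ → Set
  NoJumpOver z r = ∀ {a b} → (a ∷ b ∷ []) ⊆ z → a < r → r < b → ⊥

  -- A new letter a < r must be followed by a larger new letter, which cannot jump
  -- over r; this chain of new letters cannot reach the 1 ahead.
  new-below-blocked : ∀ r s a z rest → Ascents s (a ∷ z ++ 1 ∷ rest) → a ∉ s → a < r →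
    (∀ {e} → e ∈ s → r < e ⊎ e < a) → r ∉ z → 1 ≤ a → NoJumpOver (a ∷ z) r → ⊥
  new-below-blocked r s a []      rest ((_ , new) , _) a∉ a<r sep r∉ 1≤a noJump = <⇒≱ (new a∉) 1≤a
  new-below-blocked r s a (b ∷ z) rest ((_ , new) , ρ) a∉ a<r sep r∉ 1≤a noJump with <-cmp b r
  ... | tri> _ _ r<b  = noJump (refl ∷ refl ∷ minimum _) a<r r<b
  ... | tri≈ _ refl _ = r∉ (here refl)
  ... | tri< b<r _ _  = new-below-blocked r (s ++ a ∷ []) b z rest ρ b∉ b<r sep′ (λ p → r∉ (there p))
                          (≤-trans 1≤a (<⇒≤ a<b)) (λ p → noJump (_ ∷ʳ p))
    where
    a<b : a < b
    a<b = new a∉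
    b∉ : b ∉ s ++ a ∷ []
    b∉ p with ∈-snoc⁻ s p
    ... | inj₂ refl = <-irrefl refl a<b
    ... | inj₁ q with sep q
    ...   | inj₁ r<b = <-asym b<r r<b
    ...   | inj₂ b<a = <-asym a<b b<a
    sep′ : ∀ {e} → e ∈ s ++ a ∷ [] → r < e ⊎ e < b
    sep′ p with ∈-snoc⁻ s p
    ... | inj₂ refl = inj₂ a<b
    ... | inj₁ q with sep q
    ...   | inj₁ r<e = inj₁ r<e
    ...   | inj₂ e<a = inj₂ (<-trans e<a a<b)

  above-before-1 : ∀ r s z rest → Ascents s (z ++ 1 ∷ rest) → All (r <_) s → r ∉ z → All (1 ≤_) z →
                   NoJumpOver z r → All (r <_) z
  above-before-1 r s []      rest ρ s>r r∉ _           _      = []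
  above-before-1 r s (a ∷ z) rest ρ s>r r∉ (1≤a ∷ 1≤z) noJump with <-cmp a r
  ... | tri≈ _ refl _ = ⊥-elim (r∉ (here refl))
  ... | tri> _ _ r<a  = r<a ∷ above-before-1 r (s ++ a ∷ []) z rest (drop-first z ρ) (All.++⁺ s>r (r<a ∷ []))
                                (λ p → r∉ (there p)) 1≤z (λ p → noJump (_ ∷ʳ p))
    where
    drop-first : ∀ z → Ascents s (a ∷ z ++ 1 ∷ rest) → Ascents (s ++ a ∷ []) (z ++ 1 ∷ rest)
    drop-first []      (_ , ρ) = ρ
    drop-first (_ ∷ _) (_ , ρ) = ρ
  ... | tri< a<r _ _  = ⊥-elim (new-below-blocked r s a z rest ρ (λ p → <-asym a<r (All.lookup s>r p)) a<r
                                  (λ p → inj₁ (All.lookup s>r p)) (λ p → r∉ (there p)) 1≤a noJump)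

  module BracketedAt1 {c u′ v} (r : RAS132 (c ∷ u′ ++ 1 ∷ v)) (k : Bracketed (c ∷ u′ ++ 1 ∷ v)) (1∉ : 1 ∉ c ∷ u′) where
    open RAS132 r public
    open Bracketed k public
    private
      w : List ℕ
      w = c ∷ u′ ++ 1 ∷ v

    2≤c : 2 ≤ c
    2≤c = ≤-trans (s≤s (All.lookup positive (second-∈ c (u′ ++ 1 ∷ v) (++-∷≢[] u′)))) second<first

    v≢[] : ¬ v ≡ []
    v≢[] refl = <⇒≢ 2≤c (trans (sym (final-snoc (c ∷ u′) 1)) final≡first)

    1∉v : 1 ∉ v
    1∉v p with ∈-∃++ p
    ... | p₁ , p₂ , refl = <⇒≢ 2≤c (trans (sym final≡1) final≡first)
      where
      reassoc : u′ ++ 1 ∷ p₁ ++ 1 ∷ p₂ ≡ (u′ ++ 1 ∷ p₁) ++ 1 ∷ p₂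
      reassoc = sym (++-assoc u′ (1 ∷ p₁) (1 ∷ p₂))
      ρ : Ascents ((c ∷ []) ++ (u′ ++ 1 ∷ p₁)) (1 ∷ p₂)
      ρ = proj₂ (Ascents-++⁻ (c ∷ []) (u′ ++ 1 ∷ p₁) 1 p₂ (subst (Ascents (c ∷ [])) reassoc revisedAscent))
      positive₂ : All (1 ≤_) p₂
      positive₂ = All.tail (All.++⁻ʳ (c ∷ u′ ++ 1 ∷ p₁) (subst (All (1 ≤_)) (cong (c ∷_) reassoc) positive))
      final≡1 : final w ≡ 1
      final≡1 = trans (cong (λ z → final (c ∷ z)) reassoc)
                  (trans (final-++ (c ∷ u′ ++ 1 ∷ p₁) (λ ()))
                         (final-after-old-1 _ p₂ ρ (there (∈-++⁺ʳ u′ (here refl))) positive₂))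

    v≥2 : ∀ {d} → d ∈ v → 2 ≤ d
    v≥2 d∈ = ≤∧≢⇒< (All.lookup positive (there (∈-++⁺ʳ u′ (there d∈)))) (λ e → 1∉v (subst (_∈ v) (sym e) d∈))

    u≥2 : ∀ {d} → d ∈ c ∷ u′ → 2 ≤ d
    u≥2 d∈ = ≤∧≢⇒< (All.lookup positive (∈-++⁺ˡ {ys = 1 ∷ v} d∈)) (λ e → 1∉ (subst (_∈ c ∷ u′) (sym e) d∈))

    -- A descent in v would form a 132 with the 1 in front of it.
    sorted-v : Sorted v
    sorted-v s = ≮⇒≥ (λ d<q → avoids132 (++⁺ˡ (c ∷ u′) (refl ∷ s)) (v≥2 (proj₂ (pair-⊆⇒∈ s))) d<q)

  lastTwoEqual-++-∷ : ∀ (pre : List ℕ) r v → ¬ v ≡ [] → lastTwoEqual (pre ++ r ∷ v) ≡ lastTwoEqual (r ∷ v)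
  lastTwoEqual-++-∷ pre r []      v≢[] = ⊥-elim (v≢[] refl)
  lastTwoEqual-++-∷ pre r (q ∷ v) _    = lastTwoEqual-++ pre

  -- Unless the first 1 is the penultimate letter, it is followed by 2 and all
  -- other letters exceed 2.
  module BracketedAt1Then {c u′ t v′} (r : RAS132 (c ∷ u′ ++ 1 ∷ t ∷ v′)) (k : Bracketed (c ∷ u′ ++ 1 ∷ t ∷ v′))
                          (1∉ : 1 ∉ c ∷ u′) (v′≢[] : ¬ v′ ≡ []) where
    open BracketedAt1 r k 1∉ public
    private
      w : List ℕ
      w = c ∷ u′ ++ 1 ∷ t ∷ v′
      seen : List ℕ
      seen = (c ∷ []) ++ (u′ ++ 1 ∷ [])

    reassoc : u′ ++ 1 ∷ t ∷ v′ ≡ (u′ ++ 1 ∷ []) ++ t ∷ v′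
    reassoc = sym (++-assoc u′ (1 ∷ []) (t ∷ v′))

    ρ : Ascents seen (t ∷ v′)
    ρ = proj₂ (Ascents-++⁻ (c ∷ []) (u′ ++ 1 ∷ []) t v′ (subst (Ascents (c ∷ [])) reassoc revisedAscent))

    t∉u : t ∉ c ∷ u′
    t∉u t∈ = lastTwoDiffer (subst T (sym lastTwoEqual≡) (old-equal v′ v′≢[] ρ sorted-v))
      where
      lastTwoEqual≡ : lastTwoEqual w ≡ lastTwoEqual (t ∷ v′)
      lastTwoEqual≡ = trans (cong (λ z → lastTwoEqual (c ∷ z)) reassoc) (lastTwoEqual-++-∷ (c ∷ u′ ++ 1 ∷ []) t v′ v′≢[])
      old-equal : ∀ v′ → ¬ v′ ≡ [] → Ascents seen (t ∷ v′) → Sorted (t ∷ v′) → T (lastTwoEqual (t ∷ v′))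
      old-equal []      v′≢[] _ _      = ⊥-elim (v′≢[] refl)
      old-equal (q ∷ v) _     ρ sorted = old-sorted⇒lastTwoEqual _ t q v ρ (∈-++⁺ˡ t∈) sorted

    t∉seen : t ∉ seen
    t∉seen p with ∈-++⁻ (c ∷ u′) {1 ∷ []} p
    ... | inj₁ q        = t∉u q
    ... | inj₂ (here e) = 1∉v (subst (_∈ t ∷ v′) e (here refl))

    t<v′ : ∀ {d} → d ∈ v′ → t < d
    t<v′ {d} d∈ = go v′ ρ sorted-v d∈
      where
      go : ∀ v′ → Ascents seen (t ∷ v′) → Sorted (t ∷ v′) → d ∈ v′ → t < d
      go (q ∷ v) ((_ , new) , _) sorted (here refl) = new t∉seen
      go (q ∷ v) ((_ , new) , _) sorted (there d∈)  = <-≤-trans (new t∉seen) (sorted (_ ∷ʳ refl ∷ from∈ d∈))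

    t<c : t < c
    t<c = ≤∧≢⇒< (first-maximum w revisedAscent (there (∈-++⁺ʳ u′ (there (here refl))))) (λ e → t∉u (here e))

    u>t : All (t <_) (c ∷ u′)
    u>t = t<c ∷ above-before-1 t (c ∷ []) u′ (t ∷ v′) revisedAscent (t<c ∷ []) (λ p → t∉u (there p))
                  (All.tail (All.++⁻ˡ (c ∷ u′) positive))
                  (λ s a<t t<b → avoids132 (_ ∷ʳ ++⁺ s (_ ∷ʳ refl ∷ minimum _)) a<t t<b)

    -- Cayley: 2 occurs, but not in u′ or v′.
    t≡2 : t ≡ 2
    t≡2 with t ≟ 2
    ... | yes e  = e
    ... | no t≢2 = ⊥-elim (2∉w (cayley (here refl) (s≤s z≤n) 2≤c))
      where
      2≤t : 2 ≤ t
      2≤t = v≥2 (here refl)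
      2∉w : 2 ∉ w
      2∉w p with ∈-++⁻ (c ∷ u′) {1 ∷ t ∷ v′} p
      ... | inj₁ q                 = ≤⇒≯ 2≤t (All.lookup u>t q)
      ... | inj₂ (there (here e))  = t≢2 (sym e)
      ... | inj₂ (there (there q)) = ≤⇒≯ 2≤t (t<v′ q)

    u>2 : All (2 <_) (c ∷ u′)
    u>2 = All.map (subst (_< _) t≡2) u>t

    v′>2 : All (2 <_) v′
    v′>2 = All.tabulate (λ d∈ → subst (_< _) t≡2 (t<v′ d∈))

  final-map : ∀ f x → ¬ x ≡ [] → final (map f x) ≡ f (final x)
  final-map f []          x≢[] = ⊥-elim (x≢[] refl)
  final-map f (a ∷ [])    _    = refl
  final-map f (a ∷ b ∷ x) _    = final-map f (b ∷ x) (λ ())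

  dropLast-map : ∀ f x → dropLast (map f x) ≡ map f (dropLast x)
  dropLast-map f []          = refl
  dropLast-map f (a ∷ [])    = refl
  dropLast-map f (a ∷ b ∷ x) = cong (f a ∷_) (dropLast-map f (b ∷ x))

  lastTwoEqual-map-suc : ∀ a b x → lastTwoEqual (map suc (a ∷ b ∷ x)) ≡ lastTwoEqual (a ∷ b ∷ x)
  lastTwoEqual-map-suc a b x =
    cong₂ _≡ᵇ_ (trans (cong final (dropLast-map suc (a ∷ b ∷ x))) (final-map suc (dropLast (a ∷ b ∷ x)) (λ ())))
               (final-map suc (a ∷ b ∷ x) (λ ()))

  Bracketed-map-suc⁻ : ∀ x → Bracketed (map suc x) → Bracketed x
  Bracketed-map-suc⁻ []          k = ⊥-elim (<-irrefl refl (Bracketed.second<first k))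
  Bracketed-map-suc⁻ (a ∷ [])    k = ⊥-elim (<-irrefl refl (Bracketed.second<first k))
  Bracketed-map-suc⁻ (a ∷ b ∷ x) k = record
    { second<first  = ≤-pred second<first
    ; final≡first   = suc-injective (trans (sym (final-map suc (a ∷ b ∷ x) (λ ()))) final≡first)
    ; lastTwoDiffer = λ t → lastTwoDiffer (subst T (sym (lastTwoEqual-map-suc a b x)) t)
    }
    where open Bracketed k

  penultimate-∈ : ∀ a b x → penultimate (a ∷ b ∷ x) ∈ a ∷ b ∷ x
  penultimate-∈ a b []      = here refl
  penultimate-∈ a b (c ∷ x) = there (penultimate-∈ b c x)

  Ascents-drop-seen : ∀ s t w → (∀ {v} → v ∈ w → v ∉ t) → Ascents (s ++ t) w → Ascents s w
  Ascents-drop-seen s t w fresh = Ascents-cong w (λ v∈ p → [ (λ q → q) , (λ q → ⊥-elim (fresh v∈ q)) ]′ (∈-++⁻ s p))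
    (λ _ → ∈-++⁺ˡ)

  Ascents-add-seen : ∀ s t w → (∀ {v} → v ∈ w → v ∉ t) → Ascents s w → Ascents (s ++ t) w
  Ascents-add-seen s t w fresh = Ascents-cong w (λ _ → ∈-++⁺ˡ)
    (λ v∈ p → [ (λ q → q) , (λ q → ⊥-elim (fresh v∈ q)) ]′ (∈-++⁻ s p))

  final-∷ : ∀ a ys → ¬ ys ≡ [] → final (a ∷ ys) ≡ final ys
  final-∷ a ys ys≢[] = final-++ (a ∷ []) ys≢[]

  module RaiseAndInsert1 {c u′ v} (r : RAS132 (c ∷ u′ ++ 1 ∷ v)) (k : Bracketed (c ∷ u′ ++ 1 ∷ v)) (1∉ : 1 ∉ c ∷ u′) where
    open BracketedAt1 r k 1∉
    private
      w : List ℕ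
      w = c ∷ u′ ++ 1 ∷ v
      U : List ℕ
      U = map suc (c ∷ u′)
      V : List ℕ
      V = map suc v
      W : List ℕ
      W = U ++ 1 ∷ 2 ∷ V
      ω : List ℕ
      ω = U ++ 2 ∷ V

    map-suc-w : map suc w ≡ ω
    map-suc-w = map-++ suc (c ∷ u′) (1 ∷ v)

    V≢[] : ¬ V ≡ []
    V≢[] e = v≢[] (map-suc-[] v e)
      where
      map-suc-[] : ∀ v → map suc v ≡ [] → v ≡ []
      map-suc-[] [] _ = refl

    V≥3 : ∀ {d} → d ∈ V → 3 ≤ d
    V≥3 d∈ with ∈-map⁻ suc d∈
    ... | _ , d∈v , refl = s≤s (v≥2 d∈v)

    U≥3 : ∀ {d} → d ∈ U → 3 ≤ d
    U≥3 d∈ with ∈-map⁻ suc d∈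
    ... | _ , d∈u , refl = s≤s (u≥2 d∈u)

    1∉2∷V : ∀ {d} → d ∈ 2 ∷ V → d ∉ 1 ∷ []
    1∉2∷V (here refl) (here ())
    1∉2∷V (there p)   (here refl) with V≥3 p
    ... | s≤s ()

    ascents′ : RevisedAscent W
    ascents′ with Ascents-++⁻ (suc c ∷ []) (map suc u′) 2 V
                    (subst (Ascents (suc c ∷ [])) (map-++ suc u′ (1 ∷ v)) (Ascents-map⁺ s≤s (c ∷ []) (u′ ++ 1 ∷ v) revisedAscent))
    ... | before , after = Ascents-++⁺ (suc c ∷ []) (map suc u′) 1 (2 ∷ V)
      (AscentsBefore-retarget (suc c ∷ []) (map suc u′) 2 1 before
         (λ ne final<2 → <⇒≱ final<2 (≤-trans (s≤s (s≤s z≤n)) (U≥3 (there (final-∈ (map suc u′) ne)))))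
         (λ ne → ≤-trans (s≤s z≤n) (U≥3 (there (final-∈ (map suc u′) ne)))))
      (((λ p → ≤-trans (n≤1+n 2) (U≥3 p)) , (λ _ → s≤s (s≤s z≤n))) , Ascents-add-seen U (1 ∷ []) (2 ∷ V) 1∉2∷V after)

    W→ω : ∀ {x} → x ∈ W → ¬ x ≡ 1 → x ∈ ω
    W→ω p x≢1 with ∈-++⁻ U p
    ... | inj₁ q         = ∈-++⁺ˡ q
    ... | inj₂ (here e)  = ⊥-elim (x≢1 e)
    ... | inj₂ (there q) = ∈-++⁺ʳ U q

    ω→W : ∀ {x} → x ∈ ω → x ∈ W
    ω→W p with ∈-++⁻ U p
    ... | inj₁ q = ∈-++⁺ˡ q
    ... | inj₂ q = ∈-++⁺ʳ U (there q)

    cayley′ : Cayley W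
    cayley′ v∈ {suc zero}    _ _   = ∈-++⁺ʳ U (here refl)
    cayley′ {v} v∈ {suc (suc t)} _ t≤v
      with ∈-map⁻ suc (subst (v ∈_) (sym map-suc-w) (W→ω v∈ (λ { refl → <⇒≱ (s≤s (s≤s z≤n)) t≤v })))
    ... | _ , v′∈ , refl = ω→W (subst (suc (suc t) ∈_) map-suc-w (∈-map⁺ suc (cayley v′∈ (s≤s z≤n) (≤-pred t≤v))))

    avoids-ω : Avoids132 ω
    avoids-ω = subst Avoids132 map-suc-w (Avoids132-map⁺ s≤s w avoids132)

    avoids′ : Avoids132 W
    avoids′ s a<d d<b with triple-⊆-++ U (1 ∷ 2 ∷ V) s
    ... | inj₁ s′                                  = avoids-ω (++⁺ʳ (2 ∷ V) s′) a<d d<b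
    ... | inj₂ (inj₁ (s′ , here refl))             = <⇒≱ a<d (≤-trans (s≤s z≤n) (U≥3 (proj₁ (pair-⊆⇒∈ s′))))
    ... | inj₂ (inj₁ (s′ , there d∈))              = avoids-ω (++⁺ s′ (from∈ d∈)) a<d d<b
    ... | inj₂ (inj₂ (inj₁ (a∈ , refl ∷ _)))       = n≮0 (<-≤-trans a<d (≤-pred d<b))
    ... | inj₂ (inj₂ (inj₁ (a∈ , _ ∷ʳ s′)))        = avoids-ω (++⁺ (from∈ a∈) s′) a<d d<b
    ... | inj₂ (inj₂ (inj₂ (refl ∷ refl ∷ _)))     = <⇒≱ d<b a<d
    ... | inj₂ (inj₂ (inj₂ (_ ∷ʳ s′)))             = avoids-ω (++⁺ˡ U s′) a<d d<b
    ... | inj₂ (inj₂ (inj₂ (refl ∷ _ ∷ʳ s′))) with ⊆-map⁻ suc v s′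
    ...   | (_ ∷ _ ∷ []) , s″ , refl =
      avoids132 (++⁺ˡ (c ∷ u′) (refl ∷ s″)) (v≥2 (proj₂ (pair-⊆⇒∈ s″))) (≤-pred d<b)

    ras132 : RAS132 W
    ras132 = mkRAS132 (λ ()) (All.++⁺ (map-suc-positive (c ∷ u′)) (s≤s z≤n ∷ s≤s z≤n ∷ map-suc-positive v))
                      cayley′ ascents′ avoids′

    final-W : final W ≡ suc c
    final-W = begin
      final W          ≡⟨ final-++ U (λ ()) ⟩
      final (1 ∷ 2 ∷ V) ≡⟨ final-∷ 1 (2 ∷ V) (λ ()) ⟩
      final (2 ∷ V)    ≡⟨ final-∷ 2 V V≢[] ⟩
      final V          ≡⟨ final-map suc v v≢[] ⟩
      suc (final v)    ≡⟨ cong suc (sym (final-∷ 1 v v≢[])) ⟩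
      suc (final (1 ∷ v)) ≡⟨ cong suc (sym (final-++ (c ∷ u′) (λ ()))) ⟩
      suc (final w)    ≡⟨ cong suc final≡first ⟩
      suc c            ∎
      where open ≡-Reasoning

    second<suc-c : second W < suc c
    second<suc-c = go u′ second<first
      where
      go : ∀ u′ → second (c ∷ u′ ++ 1 ∷ v) < c → second (suc c ∷ map suc u′ ++ 1 ∷ 2 ∷ V) < suc c
      go []      _  = s≤s (≤-trans (s≤s z≤n) 2≤c)
      go (_ ∷ _) lt = s≤s lt

    lastTwoEqual-W : lastTwoEqual W ≡ lastTwoEqual w
    lastTwoEqual-W = go v v≢[]
      where
      open ≡-Reasoning
      go : ∀ v → ¬ v ≡ [] → lastTwoEqual (U ++ 1 ∷ 2 ∷ map suc v) ≡ lastTwoEqual (c ∷ u′ ++ 1 ∷ v)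
      go []       v≢[] = ⊥-elim (v≢[] refl)
      go (b ∷ v′) _    = begin
        lastTwoEqual (U ++ 1 ∷ 2 ∷ suc b ∷ map suc v′)
          ≡⟨ cong lastTwoEqual (sym (++-assoc U (1 ∷ []) (2 ∷ suc b ∷ map suc v′))) ⟩
        lastTwoEqual ((U ++ 1 ∷ []) ++ 2 ∷ suc b ∷ map suc v′) ≡⟨ lastTwoEqual-++ (U ++ 1 ∷ []) ⟩
        lastTwoEqual (map suc (1 ∷ b ∷ v′))                    ≡⟨ lastTwoEqual-map-suc 1 b v′ ⟩
        lastTwoEqual (1 ∷ b ∷ v′)                              ≡⟨ sym (lastTwoEqual-++ (c ∷ u′)) ⟩
        lastTwoEqual (c ∷ u′ ++ 1 ∷ b ∷ v′)                    ∎

    2≤penultimate-W : 2 ≤ penultimate W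
    2≤penultimate-W = go v v≢[] V≥3
      where
      go : ∀ v → ¬ v ≡ [] → (∀ {d} → d ∈ map suc v → 3 ≤ d) → 2 ≤ penultimate (U ++ 1 ∷ 2 ∷ map suc v)
      go []       v≢[] _   = ⊥-elim (v≢[] refl)
      go (b ∷ v′) _    ≥3 = subst (2 ≤_) (sym penultimate≡) (≥2 (penultimate-∈ 2 (suc b) (map suc v′)))
        where
        penultimate≡ : penultimate (U ++ 1 ∷ 2 ∷ suc b ∷ map suc v′) ≡ penultimate (2 ∷ suc b ∷ map suc v′)
        penultimate≡ = trans (cong penultimate (sym (++-assoc U (1 ∷ []) (2 ∷ suc b ∷ map suc v′))))
          (penultimate-++ (U ++ 1 ∷ []))
        ≥2 : ∀ {x} → x ∈ 2 ∷ suc b ∷ map suc v′ → 2 ≤ x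
        ≥2 (here refl) = ≤-refl
        ≥2 (there p)   = ≤-trans (n≤1+n 2) (≥3 p)

    class : T (bracketed W ∧ not (penultimateIs1 W))
    class = ∧-intro (bracketed⁺ W record
      { second<first  = second<suc-c
      ; final≡first   = final-W
      ; lastTwoDiffer = λ t → lastTwoDiffer (subst T lastTwoEqual-W t)
      }) (not⁺ (λ t → <⇒≱ (s≤s (s≤s z≤n)) (subst (2 ≤_) (≡ᵇ⇒≡ _ 1 t) 2≤penultimate-W)))

    length≡ : length W ≡ suc (length w)
    length≡ = begin
      length (U ++ 1 ∷ 2 ∷ V)            ≡⟨ length-++ U ⟩
      length U + suc (suc (length V))    ≡⟨ cong₂ (λ a b → a + suc (suc b)) (length-map suc (c ∷ u′)) (length-map suc v) ⟩
      suc (length u′) + suc (suc (length v)) ≡⟨ cong suc (+-suc (length u′) (suc (length v))) ⟩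
      suc (suc (length u′ + suc (length v))) ≡⟨ cong (λ z → suc (suc z)) (sym (length-++ u′)) ⟩
      suc (length w)                      ∎
      where open ≡-Reasoning

  module Remove1AndLower {c u′ v′} (r : RAS132 (c ∷ u′ ++ 1 ∷ 2 ∷ v′)) (k : Bracketed (c ∷ u′ ++ 1 ∷ 2 ∷ v′))
                         (1∉ : 1 ∉ c ∷ u′) (v′≢[] : ¬ v′ ≡ []) (u>2 : All (2 <_) (c ∷ u′)) (v′>2 : All (2 <_) v′) where
    open BracketedAt1 r k 1∉
    private
      w : List ℕ
      w = c ∷ u′ ++ 1 ∷ 2 ∷ v′
      ω : List ℕ
      ω = c ∷ u′ ++ 2 ∷ v′
      w′ : List ℕ
      w′ = map pred ω

    ω≥2 : All (2 ≤_) ω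
    ω≥2 = All.++⁺ (All.map <⇒≤ u>2) (≤-refl ∷ All.map <⇒≤ v′>2)

    map-suc-w′ : map suc w′ ≡ ω
    map-suc-w′ = suc-pred-map ω (All.map (≤-trans (s≤s z≤n)) ω≥2)

    ω⊆w : ω ⊆ w
    ω⊆w = refl ∷ ++⁺ (⊆-refl {x = u′}) (1 ∷ʳ ⊆-refl)

    w→ω : ∀ {x} → x ∈ w → ¬ x ≡ 1 → x ∈ ω
    w→ω p x≢1 with ∈-++⁻ (c ∷ u′) p
    ... | inj₁ q         = ∈-++⁺ˡ q
    ... | inj₂ (here e)  = ⊥-elim (x≢1 e)
    ... | inj₂ (there q) = ∈-++⁺ʳ (c ∷ u′) q

    1∉2∷v′ : ∀ {d} → d ∈ 2 ∷ v′ → d ∉ 1 ∷ []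
    1∉2∷v′ (here refl) (here ())
    1∉2∷v′ (there p)   (here refl) with All.lookup v′>2 p
    ... | s≤s ()

    ascents-ω : RevisedAscent ω
    ascents-ω with Ascents-++⁻ (c ∷ []) u′ 1 (2 ∷ v′) revisedAscent
    ... | before , (_ , after) = Ascents-++⁺ (c ∷ []) u′ 2 v′
      (AscentsBefore-retarget (c ∷ []) u′ 1 2 before
         (λ ne final<1 → <⇒≱ final<1 (All.lookup positive (there (∈-++⁺ˡ (final-∈ u′ ne)))))
         (λ ne → <⇒≤ (All.lookup u>2 (there (final-∈ u′ ne)))))
      (Ascents-drop-seen (c ∷ u′) (1 ∷ []) (2 ∷ v′) 1∉2∷v′ after)

    cayley′ : Cayley w′
    cayley′ {v} v∈ {t} 1≤t t≤v =
      ∈-map-reflect s≤s (subst (suc t ∈_) (sym map-suc-w′)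
        (w→ω (cayley (∈-resp-⊆ (subst (suc v ∈_) map-suc-w′ (∈-map⁺ suc v∈)) ω⊆w) (s≤s z≤n) (s≤s t≤v))
             (λ e → <⇒≢ (s≤s 1≤t) (sym e))))

    ras132 : RAS132 w′
    ras132 = mkRAS132 (λ ())
      (All.tabulate λ {x} x∈ → ≤-pred (All.lookup ω≥2 (subst (suc x ∈_) map-suc-w′ (∈-map⁺ suc x∈))))
      cayley′
      (RevisedAscent-map⁻ s≤s w′ (subst RevisedAscent (sym map-suc-w′) ascents-ω))
      (Avoids132-map⁻ s≤s w′ (subst Avoids132 (sym map-suc-w′) (Avoids132-⊆ ω⊆w avoids132)))

    bracketed-ω : Bracketed ω
    bracketed-ω = record
      { second<first  = second<c u′ second<first
      ; final≡first   = trans final≡ final≡first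
      ; lastTwoDiffer = λ t → lastTwoDiffer (subst T (lastTwoEqual≡ v′ v′≢[]) t)
      }
      where
      second<c : ∀ u′ → second (c ∷ u′ ++ 1 ∷ 2 ∷ v′) < c → second (c ∷ u′ ++ 2 ∷ v′) < c
      second<c []      _  = All.head u>2
      second<c (_ ∷ _) lt = lt
      final≡ : final ω ≡ final w
      final≡ = trans (final-++ (c ∷ u′) (λ ())) (trans (sym (final-∷ 1 (2 ∷ v′) (λ ()))) (sym (final-++ (c ∷ u′) (λ ()))))
      lastTwoEqual≡ : ∀ v′ → ¬ v′ ≡ [] → lastTwoEqual (c ∷ u′ ++ 2 ∷ v′) ≡ lastTwoEqual (c ∷ u′ ++ 1 ∷ 2 ∷ v′)
      lastTwoEqual≡ []      v′≢[] = ⊥-elim (v′≢[] refl)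
      lastTwoEqual≡ (b ∷ v) _     = trans (lastTwoEqual-++ (c ∷ u′))
        (sym (trans (cong lastTwoEqual (sym (++-assoc (c ∷ u′) (1 ∷ []) (2 ∷ b ∷ v)))) (lastTwoEqual-++ ((c ∷ u′) ++ 1 ∷ []))))

    bracketed-w′ : Bracketed w′
    bracketed-w′ = Bracketed-map-suc⁻ w′ (subst Bracketed (sym map-suc-w′) bracketed-ω)

    length≡ : suc (length w′) ≡ length w
    length≡ = cong suc
      (trans (length-map pred ω) (trans (cong suc (length-++ u′)) (trans (sym (+-suc (length u′) (suc (length v′)))) (sym (length-++ u′)))))

  raiseAndInsert1 : List ℕ → List ℕ
  raiseAndInsert1 w = map suc (before1 w) ++ 1 ∷ 2 ∷ map suc (after1 w)

  remove1AndLower : List ℕ → List ℕ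
  remove1AndLower w = map pred (before1 w ++ after1 w)

  bracketed-view : ∀ w → RAS132 w → Bracketed w → ∃₂ λ c u′ → ∃ λ v → w ≡ c ∷ u′ ++ 1 ∷ v × 1 ∉ c ∷ u′
  bracketed-view w r k with before1 w | after1 w | split-at-1 w (RAS132⇒1∈ r)
  ... | c ∷ u′ | v | e , 1∉    = c , u′ , v , e , 1∉
  ... | []     | v | refl , _  = ⊥-elim (second≮1 v (RAS132.positive r) (Bracketed.second<first k))
    where
    second≮1 : ∀ v → All (1 ≤_) (1 ∷ v) → ¬ second (1 ∷ v) < 1
    second≮1 []      _             (s≤s ())
    second≮1 (b ∷ v) (_ ∷ 1≤b ∷ _) b<1 = <⇒≱ b<1 1≤b

  penultimate≠1-view : ∀ y → RAS132 y → Bracketed y → ¬ T (penultimateIs1 y) →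
    ∃₂ λ c u′ → ∃ λ v′ → y ≡ c ∷ u′ ++ 1 ∷ 2 ∷ v′ × 1 ∉ c ∷ u′ × ¬ v′ ≡ [] × All (2 <_) (c ∷ u′) × All (2 <_) v′
  penultimate≠1-view y r k ¬1 with bracketed-view y r k
  ... | c , u′ , v , refl , 1∉ = go v r k ¬1 (BracketedAt1.v≢[] r k 1∉)
    where
    go : ∀ v → RAS132 (c ∷ u′ ++ 1 ∷ v) → Bracketed (c ∷ u′ ++ 1 ∷ v) → ¬ T (penultimateIs1 (c ∷ u′ ++ 1 ∷ v)) → ¬ v ≡ [] →
         ∃₂ λ c′ u″ → ∃ λ v′ → c ∷ u′ ++ 1 ∷ v ≡ c′ ∷ u″ ++ 1 ∷ 2 ∷ v′ ×
         1 ∉ c′ ∷ u″ × ¬ v′ ≡ [] × All (2 <_) (c′ ∷ u″) × All (2 <_) v′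
    go []           _ _ _  v≢[] = ⊥-elim (v≢[] refl)
    go (t ∷ [])     _ _ ¬1 _    = ⊥-elim (¬1 (subst (λ z → T (z ≡ᵇ 1)) (sym (penultimate-++ (c ∷ u′))) tt))
    go (t ∷ b ∷ v′) r k _  _ with BracketedAt1Then.t≡2 r k 1∉ (λ ())
    ... | refl = c , u′ , b ∷ v′ , refl , 1∉ , (λ ()) , BracketedAt1Then.u>2 r k 1∉ (λ ()) ,
      BracketedAt1Then.v′>2 r k 1∉ (λ ())

  >2⇒pred≢1 : ∀ {xs} → All (2 <_) xs → 1 ∉ map pred xs
  >2⇒pred≢1 xs>2 p with ∈-map⁻ pred p
  ... | suc (suc (suc _)) , _   , ()
  ... | suc (suc zero)    , x∈ , refl with All.lookup xs>2 x∈
  ...   | s≤s (s≤s ())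

  raiseAndInsert1-++ : ∀ u v → 1 ∉ u → raiseAndInsert1 (u ++ 1 ∷ v) ≡ map suc u ++ 1 ∷ 2 ∷ map suc v
  raiseAndInsert1-++ u v 1∉ = cong₂ (λ a b → map suc a ++ 1 ∷ 2 ∷ map suc b) (before1-++ u v 1∉) (after1-++ u v 1∉)

  remove1AndLower-++ : ∀ u v → 1 ∉ u → remove1AndLower (u ++ 1 ∷ v) ≡ map pred (u ++ v)
  remove1AndLower-++ u v 1∉ = cong₂ (λ a b → map pred (a ++ b)) (before1-++ u v 1∉) (after1-++ u v 1∉)

  raiseAndInsert1-counted : ∀ {m x} → Counted (suc m) bracketed x →
    Counted (suc (suc m)) (λ x → bracketed x ∧ not (penultimateIs1 x)) (raiseAndInsert1 x) ×
    remove1AndLower (raiseAndInsert1 x) ≡ x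
  raiseAndInsert1-counted {m} {x} (length≡ , r , t) with bracketed-view x r (bracketed⁻ x t)
  ... | c , u′ , v , refl , 1∉ =
    subst (Counted (suc (suc m)) (λ x → bracketed x ∧ not (penultimateIs1 x))) (sym raised)
      (trans I.length≡ (cong suc length≡) , I.ras132 , I.class) ,
    (begin
      remove1AndLower (raiseAndInsert1 x)                       ≡⟨ cong remove1AndLower raised ⟩
      remove1AndLower (map suc (c ∷ u′) ++ 1 ∷ 2 ∷ map suc v)
        ≡⟨ remove1AndLower-++ (map suc (c ∷ u′)) (2 ∷ map suc v) 1∉U ⟩
      map pred (map suc (c ∷ u′) ++ map suc (1 ∷ v))            ≡⟨ cong (map pred) (sym (map-++ suc (c ∷ u′) (1 ∷ v))) ⟩
      map pred (map suc x)                                      ≡⟨ pred-suc-map x ⟩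
      x                                                         ∎)
    where
    open ≡-Reasoning
    module I = RaiseAndInsert1 r (bracketed⁻ _ t) 1∉
    raised : raiseAndInsert1 (c ∷ u′ ++ 1 ∷ v) ≡ map suc (c ∷ u′) ++ 1 ∷ 2 ∷ map suc v
    raised = raiseAndInsert1-++ (c ∷ u′) v 1∉
    1∉U : 1 ∉ map suc (c ∷ u′)
    1∉U = 1∉map-suc (All.++⁻ˡ (c ∷ u′) (RAS132.positive r))

  remove1AndLower-counted : ∀ {m y} → Counted (suc (suc m)) (λ x → bracketed x ∧ not (penultimateIs1 x)) y →
    Counted (suc m) bracketed (remove1AndLower y) × raiseAndInsert1 (remove1AndLower y) ≡ y
  remove1AndLower-counted {m} {y} (length≡ , r , t) with penultimate≠1-view y r (bracketed⁻ y (∧-elimˡ {bracketed y} t))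
    (not⁻ (∧-elimʳ {bracketed y} t))
  ... | c , u′ , v′ , refl , 1∉ , v′≢[] , u>2 , v′>2 =
    subst (Counted (suc m) bracketed) (sym lowered)
      (suc-injective (trans R.length≡ length≡) , R.ras132 , bracketed⁺ _ R.bracketed-w′) ,
    (begin
      raiseAndInsert1 (remove1AndLower y)
        ≡⟨ cong raiseAndInsert1 (trans lowered (map-++ pred (c ∷ u′) (2 ∷ v′))) ⟩
      raiseAndInsert1 (map pred (c ∷ u′) ++ 1 ∷ map pred v′)
        ≡⟨ raiseAndInsert1-++ (map pred (c ∷ u′)) (map pred v′) (>2⇒pred≢1 u>2) ⟩
      map suc (map pred (c ∷ u′)) ++ 1 ∷ 2 ∷ map suc (map pred v′)
        ≡⟨ cong₂ (λ a b → a ++ 1 ∷ 2 ∷ b) (suc-pred-map (c ∷ u′) (positive u>2)) (suc-pred-map v′ (positive v′>2)) ⟩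
      y                                                               ∎)
    where
    open ≡-Reasoning
    module R = Remove1AndLower r (bracketed⁻ _ (∧-elimˡ {bracketed (c ∷ u′ ++ 1 ∷ 2 ∷ v′)} t)) 1∉ v′≢[] u>2 v′>2
    lowered : remove1AndLower y ≡ map pred (c ∷ u′ ++ 2 ∷ v′)
    lowered = remove1AndLower-++ (c ∷ u′) (2 ∷ v′) 1∉
    positive : ∀ {xs} → All (2 <_) xs → All (1 ≤_) xs
    positive = All.map (λ 2<x → ≤-trans (s≤s z≤n) (<⇒≤ 2<x))

  count-penultimate≢1 : ∀ m → length (words132 (suc m) bracketed) ≡
                              length (words132 (suc (suc m)) (λ x → bracketed x ∧ not (penultimateIs1 x)))
  count-penultimate≢1 m = words132-bijection raiseAndInsert1 remove1AndLower (raiseAndInsert1-counted {m})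
    (remove1AndLower-counted {m})

module SplittingAtTheFinalLetter where

  open RevisedAscentSequences
  open BooleanCharacterisation
  open Counting
  open ElementaryBijections
  open BracketedWords
  open import Data.Bool using (Bool; true; false; T; _∧_; not)
  open import Data.Empty using (⊥; ⊥-elim)
  open import Data.List using (List; []; _∷_; _++_; map; length; drop; concatMap; cartesianProduct; upTo; takeWhile; dropWhile)
  open import Data.List.Properties using (length-++; length-map; ++-assoc; takeWhile++dropWhile)
  open import Data.List.Membership.Propositional using (_∈_; _∉_)
  open import Data.List.Membership.Propositional.Properties
  open import Data.List.Relation.Binary.Sublist.Propositional using ([]; _∷_; _∷ʳ_; ⊆-refl; from∈)
  open import Data.List.Relation.Binary.Sublist.Propositional.Properties using (++⁺ˡ; ++⁺ʳ)
  open import Data.List.Relation.Unary.All as All using (All; []; _∷_)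
  import Data.List.Relation.Unary.All.Properties as All
  open import Data.List.Relation.Unary.AllPairs as AllPairs using ([]; _∷_)
  import Data.List.Relation.Unary.AllPairs.Properties as AllPairsₚ
  open import Data.List.Relation.Unary.Any using (here; there)
  open import Data.List.Relation.Unary.Unique.Propositional using (Unique)
  import Data.List.Relation.Unary.Unique.Propositional.Properties as Unique
  open import Data.Nat using (ℕ; suc; pred; _+_; _∸_; _≤_; _<_; z≤n; s≤s; _≤ᵇ_; _≟_; _≤?_)
  open import Data.Nat.Properties
  open import Data.List.Membership.DecPropositional _≟_ using (_∈?_)
  open import Data.Product using (∃; ∃₂; _×_; _,_; proj₁; proj₂)
  open import Data.Sum using (_⊎_; inj₁; inj₂)
  open import Data.Unit using (tt)
  open import Function using (_∘_)
  open import Relation.Binary.PropositionalEquality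
  open import Relation.Nullary using (¬_; yes; no)

  endsDistinct : List ℕ → Bool
  endsDistinct x = endsAbove1 x ∧ not (lastTwoEqual x)

  first-occurrence : ∀ {v : ℕ} xs → v ∈ xs → ∃₂ λ p q → xs ≡ p ++ v ∷ q × v ∉ p
  first-occurrence {v} (a ∷ xs) v∈ with v ≟ a
  ... | yes refl = [] , xs , refl , (λ ())
  ... | no v≢a with v∈
  ...   | here e  = ⊥-elim (v≢a e)
  ...   | there p with first-occurrence xs p
  ...     | p′ , q , refl , v∉ = a ∷ p′ , q , refl , (λ { (here e) → v≢a e ; (there z) → v∉ z })

  lastTwoEqual-++-∷-∷ : ∀ (p q : List ℕ) a b r → lastTwoEqual (p ++ a ∷ b ∷ r) ≡ lastTwoEqual (q ++ a ∷ b ∷ r)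
  lastTwoEqual-++-∷-∷ p q a b r = trans (lastTwoEqual-++ p) (sym (lastTwoEqual-++ q))

  -- Y ++ t ∷ T with c = final x, Y ≥ c and t < c becomes Y lowered to start at 1
  -- and the bracketed word c ∷ t ∷ T.
  module SplitAtFinal {a Y′ t T′} (r : RAS132 (a ∷ Y′ ++ t ∷ T′)) (e : T (endsDistinct (a ∷ Y′ ++ t ∷ T′)))
                      (Y≥c : All (final (a ∷ Y′ ++ t ∷ T′) ≤_) (a ∷ Y′)) (t<c : t < final (a ∷ Y′ ++ t ∷ T′)) where
    open RAS132 r
    private
      x : List ℕ
      x = a ∷ Y′ ++ t ∷ T′
      Y : List ℕ
      Y = a ∷ Y′
      Tt : List ℕ
      Tt = t ∷ T′
      c : ℕ
      c = final x
      k : ℕ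
      k = pred c

    c∈x : c ∈ x
    c∈x = final-∈ x (λ ())

    2≤c : 2 ≤ c
    2≤c = ≤∧≢⇒< (All.lookup positive c∈x) λ c≡1 → not⁻ (∧-elimˡ {endsAbove1 x} e) (≡⇒≡ᵇ c 1 (sym c≡1))

    final-T : final Tt ≡ c
    final-T = sym (final-++ Y (λ ()))

    -- A letter v > c in T would form a 132 with t before it and the final c after it.
    T≤c : All (_≤ c) Tt
    T≤c = <⇒≤ t<c ∷ All.tabulate bounded
      where
      bounded : ∀ {v} → v ∈ T′ → v ≤ c
      bounded {v} v∈ with v ≤? c
      ... | yes v≤c = v≤c
      ... | no v≰c with ∈-∃++ v∈
      ...   | p , []     , refl = ⊥-elim (<-irrefl (sym (trans (sym (final-++ (t ∷ p) (λ ()))) final-T)) (≰⇒> v≰c))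
      ...   | p , q₀ ∷ q , refl = ⊥-elim (avoids132 (++⁺ˡ Y (refl ∷ ++⁺ˡ p (refl ∷ from∈ c∈q))) t<c (≰⇒> v≰c))
        where
        c∈q : c ∈ q₀ ∷ q
        c∈q = subst (_∈ q₀ ∷ q) (trans (sym (final-++ (t ∷ p) (λ ()))) final-T) (final-∈ (q₀ ∷ q) (λ ()))

    -- The final c is old; were its first occurrence in T, that new c would need a
    -- larger successor.
    c∈Y : c ∈ Y
    c∈Y with c ∈? Y
    ... | yes c∈Y = c∈Y
    ... | no  c∉Y with ∈-++⁻ Y c∈x
    ...   | inj₁ c∈Y = ⊥-elim (c∉Y c∈Y)
    ...   | inj₂ c∈T with first-occurrence Tt c∈T
    ...     | p , q , T≡ , c∉p = ⊥-elim (no-first-occurrence q T≡)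
      where
      c∉seen : c ∉ (a ∷ []) ++ (Y′ ++ p)
      c∉seen z with ∈-++⁻ Y {p} (subst (c ∈_) (sym (++-assoc (a ∷ []) Y′ p)) z)
      ... | inj₁ z₁ = c∉Y z₁
      ... | inj₂ z₂ = c∉p z₂
      ascents : ∀ q → Tt ≡ p ++ c ∷ q → Ascents (a ∷ []) ((Y′ ++ p) ++ c ∷ q)
      ascents q T≡ = subst (Ascents (a ∷ [])) (trans (cong (Y′ ++_) T≡) (sym (++-assoc Y′ p (c ∷ q)))) revisedAscent
      no-first-occurrence : ∀ q → Tt ≡ p ++ c ∷ q → ⊥
      no-first-occurrence []      T≡ = c∉seen (proj₂ (Ascents-snoc⁻ (a ∷ []) (Y′ ++ p) c (ascents [] T≡)))
      no-first-occurrence (b ∷ q) T≡ =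
        <⇒≱ (proj₂ (Ascents-step (a ∷ []) (Y′ ++ p) c b q (ascents (b ∷ q) T≡)) c∉seen)
            (All.lookup T≤c (subst (b ∈_) (sym T≡) (∈-++⁺ʳ p (there (here refl)))))

    Y-raise : map (_+ k) (map (_∸ k) Y) ≡ Y
    Y-raise = +-∸-map k Y (All.map (≤-trans pred[n]≤n) Y≥c)

    suc-k : suc k ≡ c
    suc-k = suc-pred c {{>-nonZero (≤-trans (s≤s z≤n) 2≤c)}}
      where open import Data.Nat using (>-nonZero)

    ascents-Y : Ascents (a ∷ []) Y′
    ascents-Y with Ascents-++⁻ (a ∷ []) Y′ t T′ revisedAscent
    ... | before , _ = AscentsBefore⇒Ascents (a ∷ []) Y′ t before λ ne →
      AscentsBefore-final-old (a ∷ []) Y′ t before ne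
        (λ final<t → <⇒≱ (<-≤-trans t<c (All.lookup Y≥c (there (final-∈ Y′ ne)))) (<⇒≤ final<t))

    raise-∈ : ∀ {v} → v ∈ map (_∸ k) Y → v + k ∈ Y
    raise-∈ {v} p = subst (v + k ∈_) Y-raise (∈-map⁺ (_+ k) p)

    lower-∈ : ∀ {v} → v + k ∈ Y → v ∈ map (_∸ k) Y
    lower-∈ {v} p = ∈-map-reflect (+-mono k) (subst (v + k ∈_) (sym Y-raise) p)

    cayley-y : Cayley (map (_∸ k) Y)
    cayley-y {v} v∈ {u} 1≤u u≤v with ∈-++⁻ Y (cayley (∈-++⁺ˡ (raise-∈ v∈)) (≤-trans 1≤u (m≤m+n u k)) (+-monoˡ-≤ k u≤v))
    ... | inj₁ p = lower-∈ p
    ... | inj₂ p = lower-∈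
      (subst (_∈ Y) (sym (≤-antisym (All.lookup T≤c p) (subst (_≤ u + k) suc-k (+-monoˡ-≤ k 1≤u)))) c∈Y)

    ras132-y : RAS132 (map (_∸ k) Y)
    ras132-y = mkRAS132 (λ ())
      (All.tabulate λ {v} p → +-cancelʳ-≤ k 1 v (subst (_≤ v + k) (sym suc-k) (All.lookup Y≥c (raise-∈ p))))
      cayley-y
      (RevisedAscent-map⁻ (+-mono k) (map (_∸ k) Y) (subst RevisedAscent (sym Y-raise) ascents-Y))
      (Avoids132-map⁻ (+-mono k) (map (_∸ k) Y) (subst Avoids132 (sym Y-raise) (Avoids132-⊆ (++⁺ʳ Tt ⊆-refl) avoids132)))

    ≤c : ∀ {v} → v ∈ c ∷ Tt → v ≤ c
    ≤c (here refl) = ≤-refl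
    ≤c (there p)   = All.lookup T≤c p

    cayley-w : Cayley (c ∷ Tt)
    cayley-w {v} v∈ {u} 1≤u u≤v with ∈-++⁻ Y (cayley (in-x v∈) 1≤u u≤v)
      where
      in-x : ∀ {v} → v ∈ c ∷ Tt → v ∈ x
      in-x (here refl) = c∈x
      in-x (there p)   = ∈-++⁺ʳ Y p
    ... | inj₁ p = here (≤-antisym (≤-trans u≤v (≤c v∈)) (All.lookup Y≥c p))
    ... | inj₂ p = there p

    avoids-w : Avoids132 (c ∷ Tt)
    avoids-w (_ ∷ʳ s)   a<d d<b = avoids132 (++⁺ˡ Y s) a<d d<b
    avoids-w (refl ∷ s) a<d d<b = <⇒≱ a<d (All.lookup T≤c (proj₂ (pair-⊆⇒∈ s)))

    ras132-w : RAS132 (c ∷ Tt)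
    ras132-w = mkRAS132 (λ ()) (All.lookup positive c∈x ∷ All.++⁻ʳ Y positive) cayley-w
      (Ascents-cong Tt (λ v∈ p → here (≤-antisym (All.lookup T≤c v∈) (All.lookup Y≥c p))) (λ { _ (here refl) → c∈Y ; _ (there ()) })
         (proj₂ (Ascents-++⁻ (a ∷ []) Y′ t T′ revisedAscent)))
      avoids-w

    bracketed-w : T (bracketed (c ∷ Tt))
    bracketed-w = bracketed⁺ (c ∷ Tt) record
      { second<first  = t<c
      ; final≡first   = trans (final-∷ c Tt (λ ())) final-T
      ; lastTwoDiffer = λ eq → not⁻ (∧-elimʳ {endsAbove1 x} e) (subst T (lastTwoEqual≡ T′ final-T) eq)
      }
      where
      lastTwoEqual≡ : ∀ T′ → final (t ∷ T′) ≡ c → lastTwoEqual (c ∷ t ∷ T′) ≡ lastTwoEqual (Y ++ t ∷ T′)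
      lastTwoEqual≡ []      t≡c = ⊥-elim (<-irrefl t≡c t<c)
      lastTwoEqual≡ (b ∷ T) _   = lastTwoEqual-++-∷-∷ (c ∷ []) Y t b T

    length≡ : length (map (_∸ k) Y) + length (c ∷ Tt) ≡ suc (length x)
    length≡ = trans (cong (_+ length (c ∷ Tt)) (length-map (_∸ k) Y))
                    (trans (+-suc (length Y) (length Tt)) (cong suc (sym (length-++ Y))))

  module JoinAtFinal {y₀ y′ c t T′} (ry : RAS132 (y₀ ∷ y′)) (rw : RAS132 (c ∷ t ∷ T′)) (kw : Bracketed (c ∷ t ∷ T′)) where
    open Bracketed kw renaming (second<first to t<c)
    private
      module y = RAS132 ry
      module w = RAS132 rw
      k : ℕ
      k = pred c
      Y : List ℕ
      Y = map (_+ k) (y₀ ∷ y′)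
      Tt : List ℕ
      Tt = t ∷ T′
      x : List ℕ
      x = Y ++ Tt

    2≤c : 2 ≤ c
    2≤c = ≤-trans (s≤s (All.lookup w.positive (there (here refl)))) t<c

    suc-k : suc k ≡ c
    suc-k = suc-pred c {{>-nonZero (≤-trans (s≤s z≤n) 2≤c)}}
      where open import Data.Nat using (>-nonZero)

    Y≥c : ∀ {v} → v ∈ Y → c ≤ v
    Y≥c p with ∈-map⁻ (_+ k) p
    ... | v′ , v′∈ , refl = subst (_≤ v′ + k) suc-k (+-monoˡ-≤ k (All.lookup y.positive v′∈))

    T≤c : ∀ {v} → v ∈ Tt → v ≤ c
    T≤c p = first-maximum (c ∷ Tt) w.revisedAscent (there p)

    c∈Y : c ∈ Y
    c∈Y = subst (_∈ Y) suc-k (∈-map⁺ (_+ k) (RAS132⇒1∈ ry))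

    cayley-x : Cayley x
    cayley-x {v} v∈ {u} 1≤u u≤v with ∈-++⁻ Y v∈
    ... | inj₂ p with w.cayley (there p) 1≤u u≤v
    ...   | here refl = ∈-++⁺ˡ c∈Y
    ...   | there q   = ∈-++⁺ʳ Y q
    cayley-x {v} v∈ {u} 1≤u u≤v | inj₁ p with c ≤? u
    ... | no c≰u with w.cayley (here refl) 1≤u (<⇒≤ (≰⇒> c≰u))
    ...   | here refl = ⊥-elim (c≰u ≤-refl)
    ...   | there q   = ∈-++⁺ʳ Y q
    cayley-x {v} v∈ {u} 1≤u u≤v | inj₁ p | yes c≤u with ∈-map⁻ (_+ k) p
    ... | v′ , v′∈ , refl = ∈-++⁺ˡ (subst (_∈ Y) (m∸n+n≡m k≤u) (∈-map⁺ (_+ k) (y.cayley v′∈ 1≤u∸k u∸k≤v′)))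
      where
      k≤u : k ≤ u
      k≤u = ≤-trans (≤-trans (n≤1+n k) (≤-reflexive suc-k)) c≤u
      1≤u∸k : 1 ≤ u ∸ k
      1≤u∸k = subst (_≤ u ∸ k) (m+n∸n≡m 1 k) (∸-monoˡ-≤ k (subst (_≤ u) (sym suc-k) c≤u))
      u∸k≤v′ : u ∸ k ≤ v′
      u∸k≤v′ = subst (u ∸ k ≤_) (m+n∸n≡m v′ k) (∸-monoˡ-≤ k u≤v)

    ascents-x : RevisedAscent x
    ascents-x = Ascents-++⁺ (y₀ + k ∷ []) (map (_+ k) y′) t T′
      (Ascents⇒AscentsBefore (y₀ + k ∷ []) (map (_+ k) y′) t (Ascents-map⁺ (+-mono k) (y₀ ∷ []) y′ y.revisedAscent)
         (λ ne → <⇒≤ (<-≤-trans t<c (Y≥c (there (final-∈ (map (_+ k) y′) ne))))))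
      (Ascents-cong Tt (λ { _ (here refl) → c∈Y ; _ (there ()) }) (λ v∈ p → here (≤-antisym (T≤c v∈) (Y≥c p)))
         w.revisedAscent)

    avoids-x : Avoids132 x
    avoids-x s a<d d<b with triple-⊆-++ Y Tt s
    ... | inj₁ s′                    = Avoids132-map⁺ (+-mono k) (y₀ ∷ y′) y.avoids132 s′ a<d d<b
    ... | inj₂ (inj₁ (s′ , d∈))      = <⇒≱ a<d (≤-trans (T≤c d∈) (Y≥c (proj₁ (pair-⊆⇒∈ s′))))
    ... | inj₂ (inj₂ (inj₁ (a∈ , s′))) = <⇒≱ a<d (≤-trans (T≤c (proj₂ (pair-⊆⇒∈ s′))) (Y≥c a∈))
    ... | inj₂ (inj₂ (inj₂ s′))      = w.avoids132 (c ∷ʳ s′) a<d d<b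

    ras132 : RAS132 x
    ras132 = mkRAS132 (++-∷≢[] Y)
      (All.++⁺ (All.tabulate (λ p → ≤-trans (s≤s z≤n) (≤-trans 2≤c (Y≥c p)))) (All.tail w.positive))
      cayley-x ascents-x avoids-x

    final-x : final x ≡ c
    final-x = trans (final-++ Y (λ ())) (trans (sym (final-∷ c Tt (λ ()))) final≡first)

    T′≢[] : ¬ T′ ≡ []
    T′≢[] refl = <-irrefl final≡first t<c

    class : T (endsDistinct x)
    class = ∧-intro (not⁺ (λ t → <⇒≢ 2≤c (sym (trans (sym final-x) (≡ᵇ⇒≡ _ 1 t)))))
                    (not⁺ (λ eq → lastTwoDiffer (subst T (lastTwoEqual≡ T′ T′≢[]) eq)))
      where
      lastTwoEqual≡ : ∀ T′ → ¬ T′ ≡ [] → lastTwoEqual (Y ++ t ∷ T′) ≡ lastTwoEqual (c ∷ t ∷ T′)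
      lastTwoEqual≡ []      T′≢[] = ⊥-elim (T′≢[] refl)
      lastTwoEqual≡ (b ∷ T) _     = lastTwoEqual-++-∷-∷ Y (c ∷ []) t b T

    takeWhile-x : takeWhile (c ≤?_) x ≡ Y
    takeWhile-x = takeWhile-++ Y (All.tabulate Y≥c)
      where
      takeWhile-++ : ∀ Z → All (c ≤_) Z → takeWhile (c ≤?_) (Z ++ Tt) ≡ Z
      takeWhile-++ []      []          with c ≤ᵇ t in c≤ᵇt
      ... | true  = ⊥-elim (<⇒≱ t<c (≤ᵇ⇒≤ c t (subst T (sym c≤ᵇt) tt)))
      ... | false = refl
      takeWhile-++ (z ∷ Z) (c≤z ∷ Z≥c) with c ≤ᵇ z in c≤ᵇz
      ... | true  = cong (z ∷_) (takeWhile-++ Z Z≥c)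
      ... | false = ⊥-elim (subst T c≤ᵇz (≤⇒≤ᵇ c≤z))

    dropWhile-x : dropWhile (c ≤?_) x ≡ Tt
    dropWhile-x = dropWhile-++ Y (All.tabulate Y≥c)
      where
      dropWhile-++ : ∀ Z → All (c ≤_) Z → dropWhile (c ≤?_) (Z ++ Tt) ≡ Tt
      dropWhile-++ []      []          with c ≤ᵇ t in c≤ᵇt
      ... | true  = ⊥-elim (<⇒≱ t<c (≤ᵇ⇒≤ c t (subst T (sym c≤ᵇt) tt)))
      ... | false = refl
      dropWhile-++ (z ∷ Z) (c≤z ∷ Z≥c) with c ≤ᵇ z in c≤ᵇz
      ... | true  = dropWhile-++ Z Z≥c
      ... | false = ⊥-elim (subst T c≤ᵇz (≤⇒≤ᵇ c≤z))

    length≡ : suc (length x) ≡ length (y₀ ∷ y′) + length (c ∷ Tt)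
    length≡ = trans (cong suc (trans (length-++ Y) (cong (_+ length Tt) (length-map (_+ k) (y₀ ∷ y′)))))
                    (sym (+-suc (length (y₀ ∷ y′)) (length Tt)))

  dropWhile-≤ : ∀ c x → All (c ≤_) x ⊎ (∃₂ λ t T′ → dropWhile (c ≤?_) x ≡ t ∷ T′ × t < c)
  dropWhile-≤ c []      = inj₁ []
  dropWhile-≤ c (a ∷ x) with c ≤ᵇ a in c≤ᵇa
  ... | false = inj₂ (a , x , refl , ≰⇒> (λ c≤a → subst T c≤ᵇa (≤⇒≤ᵇ c≤a)))
  ... | true with dropWhile-≤ c x
  ...   | inj₁ x≥c = inj₁ (≤ᵇ⇒≤ c a (subst T (sym c≤ᵇa) tt) ∷ x≥c)
  ...   | inj₂ rest = inj₂ rest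

  endsDistinct-view : ∀ x → RAS132 x → T (endsDistinct x) → ∃₂ λ a Y′ → ∃₂ λ t T′ →
    x ≡ a ∷ Y′ ++ t ∷ T′ × takeWhile (final x ≤?_) x ≡ a ∷ Y′ × dropWhile (final x ≤?_) x ≡ t ∷ T′ ×
    All (final x ≤_) (a ∷ Y′) × t < final x
  endsDistinct-view x r e with dropWhile-≤ (final x) x
  ... | inj₁ x≥c = ⊥-elim (<⇒≱ 1<c (All.lookup x≥c (RAS132⇒1∈ r)))
    where
    1<c : 1 < final x
    1<c = ≤∧≢⇒< (All.lookup (RAS132.positive r) (final-∈ x (RAS132.nonEmpty r)))
                 (λ 1≡c → not⁻ (∧-elimˡ {endsAbove1 x} e) (≡⇒≡ᵇ _ 1 (sym 1≡c)))
  ... | inj₂ (t , T′ , D≡ , t<c) =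
    view (takeWhile (final x ≤?_) x)
      (trans (cong (takeWhile (final x ≤?_) x ++_) (sym D≡)) (takeWhile++dropWhile (final x ≤?_) x))
         (All.all-takeWhile (final x ≤?_) x) refl
    where
    view : ∀ Z → Z ++ t ∷ T′ ≡ x → All (final x ≤_) Z → takeWhile (final x ≤?_) x ≡ Z → ∃₂ λ a Y′ → ∃₂ λ t′ T″ →
           x ≡ a ∷ Y′ ++ t′ ∷ T″ × takeWhile (final x ≤?_) x ≡ a ∷ Y′ × dropWhile (final x ≤?_) x ≡ t′ ∷ T″ ×
           All (final x ≤_) (a ∷ Y′) × t′ < final x
    view []       refl _   _  = ⊥-elim (<⇒≱ t<c (first-maximum x (RAS132.revisedAscent r) (final-∈ x (RAS132.nonEmpty r))))
    view (a ∷ Y′) x≡   Z≥c tw = a , Y′ , t , T′ , sym x≡ , tw , D≡ , Z≥c , t<c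

  splitAtFinal : List ℕ → List ℕ × List ℕ
  splitAtFinal x = map (_∸ pred (final x)) (takeWhile (final x ≤?_) x) , final x ∷ dropWhile (final x ≤?_) x

  joinAtFinal : List ℕ × List ℕ → List ℕ
  joinAtFinal (y , w) = map (_+ pred (first w)) y ++ drop 1 w

  splittingBlock : ℕ → ℕ → List (List ℕ × List ℕ)
  splittingBlock n i = cartesianProduct (words132 (suc i) anyWord) (words132 (suc n ∸ i) bracketed)

  splittings : ℕ → List (List ℕ × List ℕ)
  splittings n = concatMap (splittingBlock n) (upTo (suc n))

  ∈-splittings⁺ : ∀ n {i y w} → i ≤ n → y ∈ words132 (suc i) anyWord → w ∈ words132 (suc n ∸ i) bracketed →
                  (y , w) ∈ splittings n
  ∈-splittings⁺ n i≤n y∈ w∈ = ∈-concat⁺′ (∈-cartesianProduct⁺ y∈ w∈) (∈-map⁺ (splittingBlock n) (∈-upTo⁺ (s≤s i≤n)))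

  ∈-splittings⁻ : ∀ n {y w} → (y , w) ∈ splittings n →
                  ∃ λ i → i ≤ n × y ∈ words132 (suc i) anyWord × w ∈ words132 (suc (n ∸ i)) bracketed
  ∈-splittings⁻ n {y} {w} p with ∈-concat⁻′ (map (splittingBlock n) (upTo (suc n))) p
  ... | l , p∈l , l∈ with ∈-map⁻ (splittingBlock n) l∈
  ... | i , i∈ , refl with ∈-cartesianProduct⁻ (words132 (suc i) anyWord) (words132 (suc n ∸ i) bracketed) p∈l
  ... | y∈ , w∈ = i , i≤n , y∈ , subst (λ m → w ∈ words132 m bracketed) (+-∸-assoc 1 i≤n) w∈
    where
    i≤n : i ≤ n
    i≤n = ≤-pred (∈-upTo⁻ i∈)

  splittings-unique : ∀ n → Unique (splittings n)
  splittings-unique n =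
    Unique.concat⁺ (All.tabulate blocks-unique) (AllPairsₚ.map⁺ (AllPairs.map blocks-disjoint (Unique.upTo⁺ (suc n))))
    where
    blocks-unique : ∀ {l} → l ∈ map (splittingBlock n) (upTo (suc n)) → Unique l
    blocks-unique l∈ with ∈-map⁻ (splittingBlock n) {xs = upTo (suc n)} l∈
    ... | i , _ , refl = Unique.cartesianProduct⁺ (words132-unique (suc i) anyWord) (words132-unique (suc n ∸ i) bracketed)
    blocks-disjoint : ∀ {i j} → ¬ i ≡ j → ∀ {p} → ¬ (p ∈ splittingBlock n i × p ∈ splittingBlock n j)
    blocks-disjoint {i} {j} i≢j {y , w} (p , q)
      with ∈-cartesianProduct⁻ (words132 (suc i) anyWord) (words132 (suc n ∸ i) bracketed) p
         | ∈-cartesianProduct⁻ (words132 (suc j) anyWord) (words132 (suc n ∸ j) bracketed) q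
    ... | y∈i , _ | y∈j , _ =
      i≢j (suc-injective (trans (sym (proj₁ (∈-words132⁻ i anyWord y∈i))) (proj₁ (∈-words132⁻ j anyWord y∈j))))

  bracketed-singleton : ∀ c → ¬ T (bracketed (c ∷ []))
  bracketed-singleton c t = <-irrefl refl (Bracketed.second<first (bracketed⁻ (c ∷ []) t))

  splitAtFinal-inverse : ∀ n {x} → x ∈ words132 (suc n) endsDistinct →
    splitAtFinal x ∈ splittings n × joinAtFinal (splitAtFinal x) ≡ x
  splitAtFinal-inverse n {x} x∈ with ∈-words132⁻ n endsDistinct x∈
  ... | length≡ , r , e with endsDistinct-view x r e
  ... | a , Y′ , t , T′ , refl , tw , dw , Y≥c , t<c =
    subst (_∈ splittings n) (sym split≡) (∈-splittings⁺ n i≤n (∈-words132⁺ _ _ (length-map _ (a ∷ Y′)) S.ras132-y tt)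
                                                               (∈-words132⁺ _ _ length-w S.ras132-w S.bracketed-w)) ,
    trans (cong joinAtFinal split≡) (cong (_++ t ∷ T′) S.Y-raise)
    where
    module S = SplitAtFinal r e Y≥c t<c
    c : ℕ
    c = final (a ∷ Y′ ++ t ∷ T′)
    split≡ : splitAtFinal (a ∷ Y′ ++ t ∷ T′) ≡ (map (_∸ pred c) (a ∷ Y′) , c ∷ t ∷ T′)
    split≡ = cong₂ _,_ (cong (map (_∸ pred c)) tw) (cong (c ∷_) dw)
    sum≡ : suc (length Y′) + suc (suc (length T′)) ≡ suc (suc n)
    sum≡ = trans (sym (cong (_+ suc (suc (length T′))) (length-map (_∸ pred c) (a ∷ Y′))))
      (trans S.length≡ (cong suc length≡))
    e′ : length Y′ + suc (length T′) ≡ n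
    e′ = suc-injective (trans (sym (+-suc (length Y′) (suc (length T′)))) (suc-injective sum≡))
    i≤n : length Y′ ≤ n
    i≤n = m+n≤o⇒m≤o (length Y′) (≤-reflexive e′)
    length-w : length (c ∷ t ∷ T′) ≡ suc n ∸ length Y′
    length-w = sym
      (trans (+-∸-assoc 1 i≤n) (cong suc (trans (cong (_∸ length Y′) (sym e′)) (m+n∸m≡n (length Y′) (suc (length T′))))))

  joinAtFinal-inverse : ∀ n {p} → p ∈ splittings n →
    joinAtFinal p ∈ words132 (suc n) endsDistinct × splitAtFinal (joinAtFinal p) ≡ p
  joinAtFinal-inverse n {y , w} p∈ with ∈-splittings⁻ n p∈
  ... | i , i≤n , y∈ , w∈ with ∈-words132⁻ i anyWord y∈ | ∈-words132⁻ (n ∸ i) bracketed w∈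
  ... | length-y , ry , _ | length-w , rw , kw = join y w length-y ry length-w rw kw
    where
    join : ∀ y w → length y ≡ suc i → RAS132 y → length w ≡ suc (n ∸ i) → RAS132 w → T (bracketed w) →
           joinAtFinal (y , w) ∈ words132 (suc n) endsDistinct × splitAtFinal (joinAtFinal (y , w)) ≡ (y , w)
    join []       _            _        ry _        _  _  = ⊥-elim (RAS132.nonEmpty ry refl)
    join (_ ∷ _)  []           _        _  _        rw _  = ⊥-elim (RAS132.nonEmpty rw refl)
    join (_ ∷ _)  (c ∷ [])     _        _  _        _  kw = ⊥-elim (bracketed-singleton c kw)
    join (y₀ ∷ y′) (c ∷ t ∷ T′) length-y ry length-w rw kw =
      ∈-words132⁺ (suc n) endsDistinct length-x J.ras132 J.class ,
      trans (cong (λ z → map (_∸ pred z) (takeWhile (z ≤?_) x) , z ∷ dropWhile (z ≤?_) x) J.final-x)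
            (cong₂ _,_ (trans (cong (map (_∸ pred c)) J.takeWhile-x) (∸-+-map (pred c) (y₀ ∷ y′)))
                       (cong (c ∷_) J.dropWhile-x))
      where
      module J = JoinAtFinal ry rw (bracketed⁻ _ kw)
      x : List ℕ
      x = joinAtFinal (y₀ ∷ y′ , c ∷ t ∷ T′)
      length-x : length x ≡ suc n
      length-x = suc-injective
        (trans J.length≡ (trans (cong₂ _+_ length-y length-w) (cong suc (trans (+-suc i (n ∸ i)) (cong suc (m+[n∸m]≡n i≤n))))))

  count-endsDistinct-splittings : ∀ n → length (words132 (suc n) endsDistinct) ≡ length (splittings n)
  count-endsDistinct-splittings n =
    inverses⇒length≡ (words132-unique (suc n) endsDistinct) (splittings-unique n) splitAtFinal joinAtFinal
      (proj₁ ∘ splitAtFinal-inverse n) (proj₁ ∘ joinAtFinal-inverse n) (proj₂ ∘ splitAtFinal-inverse n)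
        (proj₂ ∘ joinAtFinal-inverse n)

module Recurrences where

  open RevisedAscentSequences
  open BooleanCharacterisation
  open ElementaryBijections
  open BracketedWords
  open SplittingAtTheFinalLetter
  open import Data.Bool using (Bool)
  open import Data.List using (List; []; _∷_; map; length; concatMap; cartesianProduct; upTo; applyUpTo)
  open import Data.List.Properties using (length-++; length-map; map-applyUpTo)
  open import Data.Nat using (ℕ; zero; suc; _+_; _*_; _∸_)
  open import Data.Nat.ListAction using (sum)
  open import Data.Nat.Properties using (+-comm)
  open import Data.Product using (_,_)
  open import Function using (_∘_)
  open import Relation.Binary.PropositionalEquality

  count : (List ℕ → Bool) → ℕ → ℕ
  count p n = length (words132 n p)

  count-anyWord-step-final : ∀ m → count anyWord (suc (suc m)) ≡ count anyWord (suc m) + count endsAbove1 (suc (suc m))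
  count-anyWord-step-final m =
    trans (length-words132-split (suc (suc m)) anyWord endsWith1)
      (cong (_+ count endsAbove1 (suc (suc m))) (sym (count-endsWith1 m)))

  count-endsAbove1-step : ∀ m → count endsAbove1 (suc (suc m)) ≡ count endsAbove1 (suc m) + count endsDistinct (suc (suc m))
  count-endsAbove1-step m =
    trans (length-words132-split (suc (suc m)) endsAbove1 lastTwoEqual)
      (cong (_+ count endsDistinct (suc (suc m))) (sym (count-lastTwoEqual m)))

  count-anyWord-step-first : ∀ m → count anyWord (suc (suc m)) ≡ count anyWord (suc m) + count firstTwoDistinct (suc (suc m))
  count-anyWord-step-first m =
    trans (length-words132-split (suc (suc m)) anyWord firstTwoEqual)
          (cong (_+ count firstTwoDistinct (suc (suc m))) (sym (count-firstTwoEqual m)))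

  count-bracketed-step : ∀ m → count bracketed (suc (suc (suc m)))
    ≡ count firstTwoDistinct (suc m) + count bracketed (suc (suc m))
  count-bracketed-step m =
    trans (length-words132-split (suc (suc (suc m))) bracketed penultimateIs1)
          (cong₂ _+_ (sym (count-penultimateIs1 m)) (sym (count-penultimate≢1 (suc m))))

  count-bracketed : ∀ j → count bracketed (suc (suc (suc j))) ≡ count anyWord (suc j)
  count-bracketed zero    = count-bracketed-step 0
  count-bracketed (suc j) = begin
    count bracketed (4 + j)                              ≡⟨ count-bracketed-step (suc j) ⟩
    count firstTwoDistinct (2 + j) + count bracketed (3 + j)
      ≡⟨ cong (λ k → count firstTwoDistinct (2 + j) + k) (count-bracketed j) ⟩
    count firstTwoDistinct (2 + j) + count anyWord (1 + j)   ≡⟨ +-comm (count firstTwoDistinct (2 + j)) _ ⟩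
    count anyWord (1 + j) + count firstTwoDistinct (2 + j)   ≡⟨ sym (count-anyWord-step-first j) ⟩
    count anyWord (2 + j)                                ∎
    where open ≡-Reasoning

  length-concatMap : ∀ {A B : Set} (f : A → List B) xs → length (concatMap f xs) ≡ sum (map (length ∘ f) xs)
  length-concatMap f []       = refl
  length-concatMap f (x ∷ xs) = trans (length-++ (f x)) (cong (λ k → length (f x) + k) (length-concatMap f xs))

  length-cartesianProduct : ∀ {A B : Set} (xs : List A) (ys : List B) → length (cartesianProduct xs ys)
    ≡ length xs * length ys
  length-cartesianProduct []       ys = refl
  length-cartesianProduct (x ∷ xs) ys =
    trans (length-++ (map (x ,_) ys)) (cong₂ _+_ (length-map (x ,_) ys) (length-cartesianProduct xs ys))

  count-endsDistinct : ∀ n → count endsDistinct (suc n)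
    ≡ sum (applyUpTo (λ i → count anyWord (suc i) * count bracketed (suc n ∸ i)) (suc n))
  count-endsDistinct n = begin
    count endsDistinct (suc n)                            ≡⟨ count-endsDistinct-splittings n ⟩
    length (splittings n)                                 ≡⟨ length-concatMap (splittingBlock n) (upTo (suc n)) ⟩
    sum (map (length ∘ splittingBlock n) (upTo (suc n)))
      ≡⟨ cong sum (map-applyUpTo (λ i → i) (length ∘ splittingBlock n) (suc n)) ⟩
    sum (applyUpTo (length ∘ splittingBlock n) (suc n))
      ≡⟨ cong sum
        (applyUpTo-cong (suc n) (λ i → length-cartesianProduct (words132 (suc i) anyWord) (words132 (suc n ∸ i) bracketed))) ⟩
    sum (applyUpTo (λ i → count anyWord (suc i) * count bracketed (suc n ∸ i)) (suc n)) ∎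
    where
    open ≡-Reasoning
    applyUpTo-cong : ∀ k {f g : ℕ → ℕ} → (∀ i → f i ≡ g i) → applyUpTo f k ≡ applyUpTo g k
    applyUpTo-cong zero    f≗g = refl
    applyUpTo-cong (suc k) f≗g = cong₂ _∷_ (f≗g 0) (applyUpTo-cong k (f≗g ∘ suc))

open PowerSeries
open BooleanCharacterisation using (countB≡length-words132; anyWord)
open SplittingAtTheFinalLetter using (endsDistinct)
open BracketedWords using (bracketed)
open Recurrences
open import Data.Integer using (-[1+_]; _+_; _*_)
open import Data.Integer.Properties using (pos-*; neg-distribˡ-*; +-identityˡ)
open import Data.List using (applyUpTo)
open import Data.Nat as ℕ using (ℕ; zero; suc; _∸_)
import Data.Nat.Properties as ℕ
open import Data.Nat.ListAction using (sum)
open import Data.Product using (_,_)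
open import Function using (_∘_)
open import Relation.Binary.PropositionalEquality using (refl; sym; trans; cong; cong₂; _≗_; module ≡-Reasoning)

-- B = t - t²: then D = A² - 4tB, and (A - √D)/(2t) is the root of A F = B + t F²
-- with F(0) = 0.
polyB : Series
polyB 1 = + 1
polyB 2 = -[1+ 0 ]
polyB _ = + 0

polyA²-4tB≗polyD : polyA ⊛ polyA ⊕ -[1+ 3 ] · shift polyB ≗ polyD
polyA²-4tB≗polyD 0 = refl
polyA²-4tB≗polyD 1 = refl
polyA²-4tB≗polyD 2 = refl
polyA²-4tB≗polyD 3 = refl
polyA²-4tB≗polyD 4 = refl
polyA²-4tB≗polyD (suc (suc (suc (suc (suc i))))) =
  cong (_+ -[1+ 3 ] * + 0) (sumTo-zero (5 ℕ.+ i) vanishing)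
  where
  vanishing : ∀ j → polyA j * polyA (5 ℕ.+ i ∸ j) ≡ + 0
  vanishing 0                   = refl
  vanishing 1                   = refl
  vanishing 2                   = refl
  vanishing (suc (suc (suc j))) = refl

seriesS≗ : seriesS ≗ polyA ⊕ -[1+ 1 ] · shift F132
seriesS≗ zero    = refl
seriesS≗ (suc n) = cong (λ z → polyA (suc n) + z) (neg-distribˡ-* (+ 2) (F132 n))

F132-suc : ∀ n → F132 (suc n) ≡ + count anyWord (suc n)
F132-suc n = cong +_ (countB≡length-words132 (suc n))

-- The splitting of the words ending in two distinct letters, read as a
-- convolution.
F132⊛F132 : ∀ n → (F132 ⊛ F132) n ≡ + count endsDistinct (suc n)
F132⊛F132 n = sym (begin
  + count endsDistinct (suc n)             ≡⟨ cong +_ (count-endsDistinct n) ⟩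
  + sum (applyUpTo (λ i → count anyWord (suc i) ℕ.* count bracketed (suc n ∸ i)) (suc n))
    ≡⟨ +-sum-applyUpTo n (λ i → count anyWord (suc i) ℕ.* count bracketed (suc n ∸ i)) ⟩
  sumTo n (λ i → + (count anyWord (suc i) ℕ.* count bracketed (suc n ∸ i)))
    ≡⟨ sumTo-cong n (λ i i≤n →
         trans (pos-* (count anyWord (suc i)) (count bracketed (suc n ∸ i)))
               (cong₂ _*_ (sym (F132-suc i)) (cong (+_ ∘ count bracketed) (ℕ.+-∸-assoc 1 i≤n)))) ⟩
  (G ⊛ (K ∘ suc)) n                        ≡⟨ ⊛-congʳ G K∘suc≗shiftF n ⟩
  (G ⊛ shift F132) n                       ≡⟨ ⊛-shiftʳ G F132 n ⟩
  shift (G ⊛ F132) n                       ≡⟨ sym (⊛-shiftˡ G F132 n) ⟩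
  (shift G ⊛ F132) n                       ≡⟨ ⊛-congˡ F132 shiftG≗F n ⟩
  (F132 ⊛ F132) n                          ∎)
  where
  open ≡-Reasoning
  G K : Series
  G = F132 ∘ suc
  K k = + count bracketed k
  shiftG≗F : shift G ≗ F132
  shiftG≗F zero    = refl
  shiftG≗F (suc n) = refl
  K∘suc≗shiftF : K ∘ suc ≗ shift F132
  K∘suc≗shiftF zero          = refl
  K∘suc≗shiftF (suc zero)    = refl
  K∘suc≗shiftF (suc (suc j)) = trans (cong +_ (count-bracketed j)) (sym (F132-suc j))

F132-quadratic : polyA ⊛ F132 ≗ polyB ⊕ shift (F132 ⊛ F132)
F132-quadratic 0 = refl
F132-quadratic 1 = refl
F132-quadratic 2 = refl
F132-quadratic (suc (suc (suc m))) = begin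
  (polyA ⊛ F132) (3 ℕ.+ m)                                 ≡⟨ polyA-⊛ F132 (suc m) ⟩
  F132 (3 ℕ.+ m) + -[1+ 1 ] * F132 (2 ℕ.+ m) + F132 (1 ℕ.+ m)
    ≡⟨ cong₂ (λ u v → u + -[1+ 1 ] * v + F132 (1 ℕ.+ m)) (F132-suc (2 ℕ.+ m)) (F132-suc (1 ℕ.+ m)) ⟩
  + count anyWord (3 ℕ.+ m) + -[1+ 1 ] * + count anyWord (2 ℕ.+ m) + F132 (1 ℕ.+ m)
    ≡⟨ cong (λ u → + count anyWord (3 ℕ.+ m) + -[1+ 1 ] * + count anyWord (2 ℕ.+ m) + u) (F132-suc m) ⟩
  + count anyWord (3 ℕ.+ m) + -[1+ 1 ] * + count anyWord (2 ℕ.+ m) + + count anyWord (1 ℕ.+ m)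
    ≡⟨ second-difference (count-anyWord-step-final m) (count-anyWord-step-final (suc m)) (count-endsAbove1-step (suc m)) ⟩
  + count endsDistinct (3 ℕ.+ m)                           ≡⟨ sym (F132⊛F132 (2 ℕ.+ m)) ⟩
  (F132 ⊛ F132) (2 ℕ.+ m)                                  ≡⟨ sym (+-identityˡ _) ⟩
  polyB (3 ℕ.+ m) + shift (F132 ⊛ F132) (3 ℕ.+ m)           ∎
  where open ≡-Reasoning

mainTheorem14 : (seriesS 0 ≡ + 1) × (∀ n → (seriesS ⊛ seriesS) n ≡ polyD n)
mainTheorem14 = refl , λ n →
  trans (⊛-quadratic {polyA} {polyB} {F132} {seriesS} seriesS≗ F132-quadratic n) (polyA²-4tB≗polyD n)
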